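{- For each nominal $\mathsf{PROP}$ $\mathcal T$ there is an isomorphism of nominal $\mathsf{PROP}$s $\mathit{NOM}(\mathit{ORD}(\mathcal T))\to\mathcal T$, natural in $\mathcal T$, mapping the arrow $[\boldsymbol c\rangle\langle\boldsymbol a]f[\boldsymbol b\rangle\langle\boldsymbol d]$ generated by an arrow $f:\underline{\boldsymbol a}\to\underline{\boldsymbol b}$ of $\mathcal T$ to $[\boldsymbol c|\boldsymbol a];f;[\boldsymbol b|\boldsymbol d]$.
   Context: $\mathcal N$ is a countably infinite set of names; bold letters denote lists of pairwise distinct names, $\underline{\boldsymbol a}$ the set of entries, $+$ concatenation. A $\mathsf{PROP}$ (MacLane) is a symmetric strict monoidal category with objects the natural numbers $\underline n$, tensor $\oplus$ addition on objects, composition $;$ (diagrammatic), satisfying the symmetric strict monoidal laws including naturality of symmetries; morphisms of $\mathsf{PROP}$s are identity-on-objects strict symmetric monoidal functors. $\langle\boldsymbol a|\boldsymbol a'\rangle$ (with $\underline{\boldsymbol a}=\underline{\boldsymbol a'}$) is the symmetry mapping $i\mapsto j$ where $a_i=a'_j$. A nominal $\mathsf{PROP}$ is a small category with objects finite subsets of $\mathcal N$, partial commutative associative tensor $\uplus$ (disjoint union; on arrows defined iff domains disjoint and codomains disjoint), unit $\emptyset$, interchange whenever both sides defined, containing all bijections $\pi_A:A\to\pi[A]$, with permutation action $\pi\cdot f=(\pi_A)^{ -1};f;\pi_B$; morphisms are identity-on-objects strict monoidal equivariant functors. $[\boldsymbol a|\boldsymbol b]=\biguplus_i\delta_{a_ib_i}$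 with $\delta_{ab}:\{a\}\to\{b\}$. For a nominal $\mathsf{PROP}$ $\mathcal T$, $\mathit{ORD}(\mathcal T)$ is the $\mathsf{PROP}$ with arrows $\langle\boldsymbol a]f[\boldsymbol b\rangle:\underline n\to\underline m$ ($f:A\to B$ in $\mathcal T$, $\boldsymbol a,\boldsymbol b$ enumerating $A,B$) subject to $\langle\boldsymbol a]f;g[\boldsymbol c\rangle=\langle\boldsymbol a]f[\boldsymbol b\rangle;\langle\boldsymbol b]g[\boldsymbol c\rangle$, $\langle\boldsymbol a_f+\boldsymbol a_g]f\uplus g[\boldsymbol b_f+\boldsymbol b_g\rangle=\langle\boldsymbol a_f]f[\boldsymbol b_f\rangle\oplus\langle\boldsymbol a_g]g[\boldsymbol b_g\rangle$, $\langle\boldsymbol a]\mathit{id}[\boldsymbol a\rangle=\mathit{id}$, $\langle\boldsymbol a][\boldsymbol a'|\boldsymbol b];f[\boldsymbol c\rangle=\langle\boldsymbol a|\boldsymbol a'\rangle;\langle\boldsymbol b]f[\boldsymbol c\rangle$, $\langle\boldsymbol a]f;[\boldsymbol b|\boldsymbol c][\boldsymbol c'\rangle=\langle\boldsymbol a]f[\boldsymbol b\rangle;\langle\boldsymbol c|\boldsymbol c'\rangle$. For a $\mathsf{PROP}$ $\mathcal S$, $\mathit{NOM}(\mathcal S)$ is the nominal $\mathsf{PROP}$ with arrows $[\boldsymbol a\rangle g\langle\boldsymbol b]:\underline{\boldsymbol a}\to\underline{\boldsymbol b}$ ($g:\underline n\to\underline m$ in $\mathcal S$, $|\boldsymbol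 a|=n$, $|\boldsymbol b|=m$) subject to $[\boldsymbol a\rangle f;g\langle\boldsymbol c]=[\boldsymbol a\rangle f\langle\boldsymbol b];[\boldsymbol b\rangle g\langle\boldsymbol c]$, $[\boldsymbol a+\boldsymbol c\rangle f\oplus g\langle\boldsymbol b+\boldsymbol d]=[\boldsymbol a\rangle f\langle\boldsymbol b]\uplus[\boldsymbol c\rangle g\langle\boldsymbol d]$, $[\boldsymbol a\rangle\mathit{id}\langle\boldsymbol b]=[\boldsymbol a|\boldsymbol b]$, $[\boldsymbol a\rangle\langle\boldsymbol b|\boldsymbol b'\rangle;f\langle\boldsymbol c]=[\boldsymbol a|\boldsymbol b];[\boldsymbol b'\rangle f\langle\boldsymbol c]$, $[\boldsymbol a\rangle f;\langle\boldsymbol b|\boldsymbol b'\rangle\langle\boldsymbol c]=[\boldsymbol a\rangle f\langle\boldsymbol b];[\boldsymbol b'|\boldsymbol c]$. $\mathit{NOM}$ and $\mathit{ORD}$ act on morphisms by $\mathit{NOM}(F)([\boldsymbol a\rangle g\langle\boldsymbol b])=[\boldsymbol a\rangle Fg\langle\boldsymbol b]$ and $\mathit{ORD}(F)(\langle\boldsymbol a]f[\boldsymbol b\rangle)=\langle\boldsymbol a]Ff[\boldsymbol b\rangle$. -}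

module Defs where

open import Level using (Level)
open import Data.Nat using (ℕ; zero; suc; _+_; _≟_)
open import Data.Nat.Properties using (suc-injective)
open import Data.Bool using (Bool; true; false; _∨_)
open import Data.Bool.Properties using (∨-identityʳ)
open import Data.Maybe using (Maybe; just; nothing)
open import Data.List using (List; []; _∷_; _++_; length; lookup) renaming (map to mapL)
open import Data.List.Relation.Unary.Unique.Propositional using (Unique)
import Data.List.Relation.Unary.AllPairs as AllPairs
import Data.List.Relation.Unary.All as All
open import Data.List.Membership.Propositional using (_∈_)
open import Data.List.Relation.Unary.Any using (here; there)
open import Data.Fin using (Fin)
open import Data.Fin.Properties using (+↔⊎)
open import Data.Fin.Permutation using (Permutation; _⟨$⟩ʳ_; _∘ₚ_)
import Data.Fin.Permutation as Perm
open import Data.Sum using (_⊎_; inj₁; inj₂)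
open import Data.Sum.Function.Propositional using (_⊎-↔_)
open import Data.Product using (Σ; _×_; _,_)
open import Data.Empty using (⊥; ⊥-elim)
open import Relation.Nullary using (yes; no; ¬_)
open import Relation.Binary.PropositionalEquality
  using (_≡_; refl; sym; trans; cong; subst₂)
open import Relation.Binary.Structures using (IsEquivalence)
open import Function.Bundles using (_↔_; Inverse; mk↔ₛ′)
open import Function.Construct.Composition using (_↔-∘_)
open import Function.Construct.Identity using (↔-id)
open import Function.Construct.Symmetry using (↔-sym)
open import Function.Related.TypeIsomorphisms using (⊎-comm)

Name : Set
Name = ℕ

-- Canonical encoding of finite subsets of ℕ: a non-empty finite set is
-- its characteristic bit string b₀ b₁ … b_{k-1} followed by the (true)
-- bit of its maximum element k ('end').  Every finite subset has exactly
-- one code, so equality of objects is plain ≡.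
data NE : Set where
  end  : NE
  _∷ᵇ_ : Bool → NE → NE

FSet : Set
FSet = Maybe NE

∅ : FSet
∅ = nothing

singNE : ℕ → NE
singNE zero    = end
singNE (suc n) = false ∷ᵇ singNE n

⟦_⟧ : ℕ → FSet
⟦ n ⟧ = just (singNE n)

orNE : NE → NE → NE
orNE end      end      = end
orNE end      (b ∷ᵇ y) = true ∷ᵇ y
orNE (a ∷ᵇ x) end      = true ∷ᵇ x
orNE (a ∷ᵇ x) (b ∷ᵇ y) = (a ∨ b) ∷ᵇ orNE x y

infixr 6 _∪_
_∪_ : FSet → FSet → FSet
nothing ∪ B       = B
just x  ∪ nothing = just x
just x  ∪ just y  = just (orNE x y)

memNE : ℕ → NE → Bool
memNE zero    end      = true
memNE (suc n) end      = false
memNE zero    (b ∷ᵇ x) = b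
memNE (suc n) (b ∷ᵇ x) = memNE n x

infix 4 _∈ₛ_
_∈ₛ_ : ℕ → FSet → Set
x ∈ₛ nothing = ⊥
x ∈ₛ just A  = memNE x A ≡ true

Disjoint : FSet → FSet → Set
Disjoint A B = ∀ x → x ∈ₛ A → x ∈ₛ B → ⊥

fromList : List ℕ → FSet
fromList []       = ∅
fromList (x ∷ xs) = ⟦ x ⟧ ∪ fromList xs

elemsNE : NE → List ℕ
elemsNE end             = 0 ∷ []
elemsNE (true ∷ᵇ x)     = 0 ∷ mapL suc (elemsNE x)
elemsNE (false ∷ᵇ x)    = mapL suc (elemsNE x)

elems : FSet → List ℕ
elems nothing  = []
elems (just x) = elemsNE x

Perm𝒩 : Set
Perm𝒩 = ℕ ↔ ℕ

app : Perm𝒩 → ℕ → ℕ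
app π = Inverse.to π

idπ : Perm𝒩
idπ = ↔-id ℕ

-- ρ ∘π π : first π, then ρ
_∘π_ : Perm𝒩 → Perm𝒩 → Perm𝒩
ρ ∘π π = ρ ↔-∘ π

_[_] : Perm𝒩 → FSet → FSet
π [ A ] = fromList (mapL (app π) (elems A))

swapN : ℕ → ℕ → ℕ → ℕ
swapN a b x with x ≟ a
... | yes _ = b
... | no _ with x ≟ b
...   | yes _ = a
...   | no _  = x

swapN-a : ∀ a b → swapN a b a ≡ b
swapN-a a b with a ≟ a
... | yes _ = refl
... | no ¬p = ⊥-elim (¬p refl)

swapN-b : ∀ a b → swapN a b b ≡ a
swapN-b a b with b ≟ a
... | yes p = p
... | no _ with b ≟ b
...   | yes _ = refl
...   | no ¬p = ⊥-elim (¬p refl)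

swapN-other : ∀ a b x → ¬ x ≡ a → ¬ x ≡ b → swapN a b x ≡ x
swapN-other a b x p q with x ≟ a
... | yes r = ⊥-elim (p r)
... | no _ with x ≟ b
...   | yes r = ⊥-elim (q r)
...   | no _  = refl

swapN-invol : ∀ a b x → swapN a b (swapN a b x) ≡ x
swapN-invol a b x with x ≟ a
... | yes refl = swapN-b x b
... | no p with x ≟ b
...   | yes refl = swapN-a a x
...   | no q = swapN-other a b x p q

τ : ℕ → ℕ → Perm𝒩
τ a b = mk↔ₛ′ (swapN a b) (swapN a b) (swapN-invol a b) (swapN-invol a b)

elems-sing : ∀ a → elemsNE (singNE a) ≡ a ∷ []
elems-sing zero    = refl
elems-sing (suc a) = cong (mapL suc) (elems-sing a)

τ-sing : ∀ a b → τ a b [ ⟦ a ⟧ ] ≡ ⟦ b ⟧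
τ-sing a b rewrite elems-sing a | swapN-a a b = refl

∨-true : ∀ x y → x ∨ y ≡ true → x ≡ true ⊎ y ≡ true
∨-true true  y p = inj₁ refl
∨-true false y p = inj₂ p

memNE-or : ∀ z x y → memNE z (orNE x y) ≡ memNE z x ∨ memNE z y
memNE-or zero    end      end      = refl
memNE-or zero    end      (b ∷ᵇ y) = refl
memNE-or zero    (a ∷ᵇ x) end      = sym (Data.Bool.Properties.∨-zeroʳ a)
memNE-or zero    (a ∷ᵇ x) (b ∷ᵇ y) = refl
memNE-or (suc n) end      end      = refl
memNE-or (suc n) end      (b ∷ᵇ y) = refl
memNE-or (suc n) (a ∷ᵇ x) end      = sym (∨-identityʳ (memNE n x))
memNE-or (suc n) (a ∷ᵇ x) (b ∷ᵇ y) = memNE-or n x y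

∈-∪ : ∀ z A B → z ∈ₛ A ∪ B → z ∈ₛ A ⊎ z ∈ₛ B
∈-∪ z nothing  B        p = inj₂ p
∈-∪ z (just x) nothing  p = inj₁ p
∈-∪ z (just x) (just y) p = ∨-true _ _ (trans (sym (memNE-or z x y)) p)

∈-sing : ∀ z a → memNE z (singNE a) ≡ true → z ≡ a
∈-sing zero    zero    p = refl
∈-sing (suc z) zero    ()
∈-sing zero    (suc a) ()
∈-sing (suc z) (suc a) p = cong suc (∈-sing z a p)

∈-fromList : ∀ z xs → z ∈ₛ fromList xs → z ∈ xs
∈-fromList z []       ()
∈-fromList z (x ∷ xs) p with ∈-∪ z ⟦ x ⟧ (fromList xs) p
... | inj₁ q = here (∈-sing z x q)
... | inj₂ q = there (∈-fromList z xs q)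

unique-disj : ∀ x xs → Unique (x ∷ xs) → Disjoint ⟦ x ⟧ (fromList xs)
unique-disj x xs u z p q with ∈-sing z x p
... | refl = All.lookup (AllPairs.head u) (∈-fromList z xs q) refl

unique-tail : ∀ {x : ℕ} {xs : List ℕ} → Unique (x ∷ xs) → Unique xs
unique-tail {x} {xs} u = AllPairs.tail u

cast₂ : {X Y : Set} (H : X → Y → Set) {x x' : X} {y y' : Y} →
        x ≡ x' → y ≡ y' → H x y → H x' y'
cast₂ H = subst₂ H

-- The arrow [a|b] = ⨄ᵢ δ_{aᵢbᵢ}, for any structure with id_∅, δ, ⊎

module Brak {H : FSet → FSet → Set}
            (id∅ : H ∅ ∅)
            (δ : ∀ a b → H ⟦ a ⟧ ⟦ b ⟧)
            (ten : ∀ {A B C D} → H A B → H C D →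
                   .(Disjoint A C) → .(Disjoint B D) → H (A ∪ C) (B ∪ D)) where
  brak : (a b : List ℕ) → .(Unique a) → .(Unique b) → length a ≡ length b →
         H (fromList a) (fromList b)
  brak []      []      ua ub e = id∅
  brak []      (_ ∷ _) ua ub ()
  brak (_ ∷ _) []      ua ub ()
  brak (x ∷ a) (y ∷ b) ua ub e =
    ten (δ x y) (brak a b (unique-tail ua) (unique-tail ub) (suc-injective e))
        (unique-disj x a ua) (unique-disj y b ub)

_⊕ₚ_ : ∀ {m n k l} → Permutation m n → Permutation k l → Permutation (m + k) (n + l)
π ⊕ₚ ρ = ↔-sym +↔⊎ ↔-∘ ((π ⊎-↔ ρ) ↔-∘ +↔⊎)

-- the block swap  m + n → n + m  (wire i < m goes to n + i, wire m + j to j)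
swapₚ : ∀ m n → Permutation (m + n) (n + m)
swapₚ m n = ↔-sym (+↔⊎ {n} {m}) ↔-∘ (⊎-comm (Fin m) (Fin n) ↔-∘ +↔⊎ {m} {n})

-- The symmetries are given by 'perm': perm π is
-- the symmetry sending input wire i to output wire π i; the block swaps
-- perm (swapₚ m n) are the symmetries σ_{m,n}.
record PROP : Set₁ where
  infixr 9 _⨾_
  infixr 10 _⊕_
  infix 4 _≈_
  field
    Hom  : ℕ → ℕ → Set
    _≈_  : ∀ {m n} → Hom m n → Hom m n → Set
    ≈-equiv : ∀ {m n} → IsEquivalence (_≈_ {m} {n})
    id   : ∀ {n} → Hom n n
    _⨾_  : ∀ {m n k} → Hom m n → Hom n k → Hom m k
    _⊕_  : ∀ {m n k l} → Hom m n → Hom k l → Hom (m + k) (n + l)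
    perm : ∀ {m n} → Permutation m n → Hom m n
    ⨾-cong : ∀ {m n k} {f f' : Hom m n} {g g' : Hom n k} →
             f ≈ f' → g ≈ g' → f ⨾ g ≈ f' ⨾ g'
    ⊕-cong : ∀ {m n k l} {f f' : Hom m n} {g g' : Hom k l} →
             f ≈ f' → g ≈ g' → f ⊕ g ≈ f' ⊕ g'
    idˡ   : ∀ {m n} (f : Hom m n) → id ⨾ f ≈ f
    idʳ   : ∀ {m n} (f : Hom m n) → f ⨾ id ≈ f
    assoc : ∀ {m n k l} (f : Hom m n) (g : Hom n k) (h : Hom k l) →
            (f ⨾ g) ⨾ h ≈ f ⨾ (g ⨾ h)
    ⊕-id  : ∀ {m k} → id {m} ⊕ id {k} ≈ id
    ⊕-interchange : ∀ {m n o k l p} (f : Hom m n) (g : Hom n o) (f' : Hom k l) (g' : Hom l p) →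
            (f ⨾ g) ⊕ (f' ⨾ g') ≈ (f ⊕ f') ⨾ (g ⊕ g')
    ⊕-unitˡ : ∀ {m n} (f : Hom m n) → id {0} ⊕ f ≈ f
    ⊕-unitʳ : ∀ {m n} (f : Hom m n) (e₁ : m + 0 ≡ m) (e₂ : n + 0 ≡ n) →
            cast₂ Hom e₁ e₂ (f ⊕ id {0}) ≈ f
    ⊕-assoc : ∀ {m n k l o p} (f : Hom m n) (g : Hom k l) (h : Hom o p)
            (e₁ : (m + k) + o ≡ m + (k + o)) (e₂ : (n + l) + p ≡ n + (l + p)) →
            cast₂ Hom e₁ e₂ ((f ⊕ g) ⊕ h) ≈ f ⊕ (g ⊕ h)
    perm-ext  : ∀ {m n} (π ρ : Permutation m n) → (∀ i → π ⟨$⟩ʳ i ≡ ρ ⟨$⟩ʳ i) →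
                perm π ≈ perm ρ
    perm-id   : ∀ {n} → perm (Perm.id {n}) ≈ id
    perm-comp : ∀ {m n k} (π : Permutation m n) (ρ : Permutation n k) →
                perm (π ∘ₚ ρ) ≈ perm π ⨾ perm ρ
    perm-⊕    : ∀ {m n k l} (π : Permutation m n) (ρ : Permutation k l) →
                perm (π ⊕ₚ ρ) ≈ perm π ⊕ perm ρ
    perm-nat  : ∀ {m n k l} (f : Hom m n) (g : Hom k l) →
                (f ⊕ g) ⨾ perm (swapₚ n l) ≈ perm (swapₚ m k) ⨾ (g ⊕ f)

-- Objects: finite sets of names.  The tensor ⊎ ('ten') on arrows is
-- partial: it takes (irrelevant) proofs that domains and codomains are
-- disjoint.  'bij π A' is the bijection π_A : A → π[A].
record NomPROP : Set₁ where
  infixr 9 _⨾_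
  infix 4 _≈_
  field
    Hom  : FSet → FSet → Set
    _≈_  : ∀ {A B} → Hom A B → Hom A B → Set
    ≈-equiv : ∀ {A B} → IsEquivalence (_≈_ {A} {B})
    id   : ∀ {A} → Hom A A
    _⨾_  : ∀ {A B C} → Hom A B → Hom B C → Hom A C
    ten  : ∀ {A B C D} → Hom A B → Hom C D →
           .(Disjoint A C) → .(Disjoint B D) → Hom (A ∪ C) (B ∪ D)
    bij  : (π : Perm𝒩) (A : FSet) → Hom A (π [ A ])
    ⨾-cong : ∀ {A B C} {f f' : Hom A B} {g g' : Hom B C} →
             f ≈ f' → g ≈ g' → f ⨾ g ≈ f' ⨾ g'
    ten-cong : ∀ {A B C D} {f f' : Hom A B} {g g' : Hom C D}
               .(p : Disjoint A C) .(q : Disjoint B D) →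
               f ≈ f' → g ≈ g' → ten f g p q ≈ ten f' g' p q
    idˡ   : ∀ {A B} (f : Hom A B) → id ⨾ f ≈ f
    idʳ   : ∀ {A B} (f : Hom A B) → f ⨾ id ≈ f
    assoc : ∀ {A B C D} (f : Hom A B) (g : Hom B C) (h : Hom C D) →
            (f ⨾ g) ⨾ h ≈ f ⨾ (g ⨾ h)
    ten-id : ∀ {A C} .(p : Disjoint A C) → ten (id {A}) (id {C}) p p ≈ id
    interchange : ∀ {A B C A' B' C'} (f : Hom A B) (g : Hom B C) (f' : Hom A' B') (g' : Hom B' C')
            .(p : Disjoint A A') .(q : Disjoint B B') .(r : Disjoint C C') →
            ten (f ⨾ g) (f' ⨾ g') p r ≈ ten f f' p q ⨾ ten g g' q r
    ten-unitˡ : ∀ {A B} (f : Hom A B) .(p : Disjoint ∅ A) .(q : Disjoint ∅ B) →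
            ten (id {∅}) f p q ≈ f
    ten-unitʳ : ∀ {A B} (f : Hom A B) .(p : Disjoint A ∅) .(q : Disjoint B ∅)
            (e₁ : A ∪ ∅ ≡ A) (e₂ : B ∪ ∅ ≡ B) →
            cast₂ Hom e₁ e₂ (ten f (id {∅}) p q) ≈ f
    ten-assoc : ∀ {A B C D E F} (f : Hom A B) (g : Hom C D) (h : Hom E F)
            .(p : Disjoint A C) .(q : Disjoint B D)
            .(p' : Disjoint (A ∪ C) E) .(q' : Disjoint (B ∪ D) F)
            .(r : Disjoint C E) .(s : Disjoint D F)
            .(r' : Disjoint A (C ∪ E)) .(s' : Disjoint B (D ∪ F))
            (e₁ : (A ∪ C) ∪ E ≡ A ∪ (C ∪ E)) (e₂ : (B ∪ D) ∪ F ≡ B ∪ (D ∪ F)) →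
            cast₂ Hom e₁ e₂ (ten (ten f g p q) h p' q') ≈ ten f (ten g h r s) r' s'
    ten-comm : ∀ {A B C D} (f : Hom A B) (g : Hom C D)
            .(p : Disjoint A C) .(q : Disjoint B D)
            .(p' : Disjoint C A) .(q' : Disjoint D B)
            (e₁ : A ∪ C ≡ C ∪ A) (e₂ : B ∪ D ≡ D ∪ B) →
            cast₂ Hom e₁ e₂ (ten f g p q) ≈ ten g f p' q'
    bij-ext  : ∀ (π ρ : Perm𝒩) (A : FSet) → (∀ x → x ∈ₛ A → app π x ≡ app ρ x) →
               (e : π [ A ] ≡ ρ [ A ]) → cast₂ Hom refl e (bij π A) ≈ bij ρ A
    bij-id   : ∀ (A : FSet) (e : idπ [ A ] ≡ A) → cast₂ Hom refl e (bij idπ A) ≈ id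
    bij-comp : ∀ (π ρ : Perm𝒩) (A : FSet) (e : ρ [ π [ A ] ] ≡ (ρ ∘π π) [ A ]) →
               cast₂ Hom refl e (bij π A ⨾ bij ρ (π [ A ])) ≈ bij (ρ ∘π π) A
    bij-ten  : ∀ (π : Perm𝒩) (A C : FSet)
               .(p : Disjoint A C) .(q : Disjoint (π [ A ]) (π [ C ]))
               (e : π [ A ] ∪ π [ C ] ≡ π [ A ∪ C ]) →
               cast₂ Hom refl e (ten (bij π A) (bij π C) p q) ≈ bij π (A ∪ C)

  δ : ∀ a b → Hom ⟦ a ⟧ ⟦ b ⟧
  δ a b = cast₂ Hom refl (τ-sing a b) (bij (τ a b) ⟦ a ⟧)

  [_∣_]⟨_,_,_⟩ : (a b : List ℕ) → .(Unique a) → .(Unique b) → length a ≡ length b →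
                 Hom (fromList a) (fromList b)
  [ a ∣ b ]⟨ ua , ub , e ⟩ = Brak.brak (id {∅}) δ ten a b ua ub e

record NomMor (T T' : NomPROP) : Set where
  private
    module T  = NomPROP T
    module T' = NomPROP T'
  field
    map      : ∀ {A B} → T.Hom A B → T'.Hom A B
    map-cong : ∀ {A B} {f g : T.Hom A B} → f T.≈ g → map f T'.≈ map g
    map-id   : ∀ {A} → map (T.id {A}) T'.≈ T'.id
    map-⨾    : ∀ {A B C} (f : T.Hom A B) (g : T.Hom B C) → map (f T.⨾ g) T'.≈ map f T'.⨾ map g
    map-ten  : ∀ {A B C D} (f : T.Hom A B) (g : T.Hom C D)
               .(p : Disjoint A C) .(q : Disjoint B D) →
               map (T.ten f g p q) T'.≈ T'.ten (map f) (map g) p q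
    map-bij  : ∀ (π : Perm𝒩) (A : FSet) → map (T.bij π A) T'.≈ T'.bij π A

IsIso : ∀ {T T' : NomPROP} → NomMor T T' → Set
IsIso {T} {T'} F =
  Σ (NomMor T' T) λ G →
    (∀ {A B} (f : NomPROP.Hom T A B) →
       NomPROP._≈_ T (NomMor.map G (NomMor.map F f)) f) ×
    (∀ {A B} (g : NomPROP.Hom T' A B) →
       NomPROP._≈_ T' (NomMor.map F (NomMor.map G g)) g)

module ORDdef (T : NomPROP) where
  open NomPROP T using (Hom; _≈_; id; _⨾_; ten; [_∣_]⟨_,_,_⟩)

  infixr 9 _o⨾_
  infixr 10 _o⊕_
  -- terms of the free PROP on the generators ⟨a]f[b⟩
  -- (f : A → B in T, a and b lists of distinct names enumerating A and B)
  data OTm : ℕ → ℕ → Set where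
    gen   : (a b : List ℕ) → .(Unique a) → .(Unique b) →
            Hom (fromList a) (fromList b) → OTm (length a) (length b)
    oid   : ∀ {n} → OTm n n
    _o⨾_  : ∀ {m n k} → OTm m n → OTm n k → OTm m k
    _o⊕_  : ∀ {m n k l} → OTm m n → OTm k l → OTm (m + k) (n + l)
    operm : ∀ {m n} → Permutation m n → OTm m n

  infix 4 _∼_
  data _∼_ : ∀ {m n} → OTm m n → OTm m n → Set where
    ∼refl  : ∀ {m n} {f : OTm m n} → f ∼ f
    ∼sym   : ∀ {m n} {f g : OTm m n} → f ∼ g → g ∼ f
    ∼trans : ∀ {m n} {f g h : OTm m n} → f ∼ g → g ∼ h → f ∼ h
    ⨾-cong : ∀ {m n k} {f f' : OTm m n} {g g' : OTm n k} →
             f ∼ f' → g ∼ g' → f o⨾ g ∼ f' o⨾ g'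
    ⊕-cong : ∀ {m n k l} {f f' : OTm m n} {g g' : OTm k l} →
             f ∼ f' → g ∼ g' → f o⊕ g ∼ f' o⊕ g'
    idˡ   : ∀ {m n} (f : OTm m n) → oid o⨾ f ∼ f
    idʳ   : ∀ {m n} (f : OTm m n) → f o⨾ oid ∼ f
    assoc : ∀ {m n k l} (f : OTm m n) (g : OTm n k) (h : OTm k l) →
            (f o⨾ g) o⨾ h ∼ f o⨾ (g o⨾ h)
    ⊕-id  : ∀ {m k} → oid {m} o⊕ oid {k} ∼ oid
    ⊕-interchange : ∀ {m n o k l p} (f : OTm m n) (g : OTm n o) (f' : OTm k l) (g' : OTm l p) →
            (f o⨾ g) o⊕ (f' o⨾ g') ∼ (f o⊕ f') o⨾ (g o⊕ g')
    ⊕-unitˡ : ∀ {m n} (f : OTm m n) → oid {0} o⊕ f ∼ f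
    ⊕-unitʳ : ∀ {m n} (f : OTm m n) (e₁ : m + 0 ≡ m) (e₂ : n + 0 ≡ n) →
            cast₂ OTm e₁ e₂ (f o⊕ oid {0}) ∼ f
    ⊕-assoc : ∀ {m n k l o p} (f : OTm m n) (g : OTm k l) (h : OTm o p)
            (e₁ : (m + k) + o ≡ m + (k + o)) (e₂ : (n + l) + p ≡ n + (l + p)) →
            cast₂ OTm e₁ e₂ ((f o⊕ g) o⊕ h) ∼ f o⊕ (g o⊕ h)
    perm-ext  : ∀ {m n} (π ρ : Permutation m n) → (∀ i → π ⟨$⟩ʳ i ≡ ρ ⟨$⟩ʳ i) →
                operm π ∼ operm ρ
    perm-id   : ∀ {n} → operm (Perm.id {n}) ∼ oid
    perm-comp : ∀ {m n k} (π : Permutation m n) (ρ : Permutation n k) →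
                operm (π ∘ₚ ρ) ∼ operm π o⨾ operm ρ
    perm-⊕    : ∀ {m n k l} (π : Permutation m n) (ρ : Permutation k l) →
                operm (π ⊕ₚ ρ) ∼ operm π o⊕ operm ρ
    perm-nat  : ∀ {m n k l} (f : OTm m n) (g : OTm k l) →
                (f o⊕ g) o⨾ operm (swapₚ n l) ∼ operm (swapₚ m k) o⨾ (g o⊕ f)
    gen-cong : ∀ (a b : List ℕ) .(ua : Unique a) .(ub : Unique b)
               {f g : Hom (fromList a) (fromList b)} →
               f ≈ g → gen a b ua ub f ∼ gen a b ua ub g
    rel-⨾ : ∀ (a b c : List ℕ) .(ua : Unique a) .(ub : Unique b) .(uc : Unique c)
            (f : Hom (fromList a) (fromList b)) (g : Hom (fromList b) (fromList c)) →
            gen a c ua uc (f ⨾ g) ∼ gen a b ua ub f o⨾ gen b c ub uc g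
    rel-⊎ : ∀ (af bf ag bg : List ℕ)
            .(uaf : Unique af) .(ubf : Unique bf) .(uag : Unique ag) .(ubg : Unique bg)
            .(ua : Unique (af ++ ag)) .(ub : Unique (bf ++ bg))
            (f : Hom (fromList af) (fromList bf)) (g : Hom (fromList ag) (fromList bg))
            .(p : Disjoint (fromList af) (fromList ag)) .(q : Disjoint (fromList bf) (fromList bg))
            (eA : fromList af ∪ fromList ag ≡ fromList (af ++ ag))
            (eB : fromList bf ∪ fromList bg ≡ fromList (bf ++ bg))
            (e₁ : length (af ++ ag) ≡ length af + length ag)
            (e₂ : length (bf ++ bg) ≡ length bf + length bg) →
            cast₂ OTm e₁ e₂ (gen (af ++ ag) (bf ++ bg) ua ub (cast₂ Hom eA eB (ten f g p q)))
              ∼ gen af bf uaf ubf f o⊕ gen ag bg uag ubg g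
    rel-id : ∀ (a : List ℕ) .(ua : Unique a) → gen a a ua ua id ∼ oid
    -- ⟨a][a'|b];f[c⟩ = ⟨a|a'⟩;⟨b]f[c⟩
    -- (⟨a|a'⟩ is the symmetry ρ with ρ(i) = j iff aᵢ = a'ⱼ)
    rel-symˡ : ∀ (a a' b c : List ℕ) .(ua : Unique a) .(ua' : Unique a')
               .(ub : Unique b) .(uc : Unique c)
               (eS : fromList a' ≡ fromList a) (el : length a' ≡ length b)
               (ρ : Permutation (length a) (length a'))
               (hρ : ∀ i → lookup a' (ρ ⟨$⟩ʳ i) ≡ lookup a i)
               (f : Hom (fromList b) (fromList c)) →
               gen a c ua uc (cast₂ Hom eS refl ([ a' ∣ b ]⟨ ua' , ub , el ⟩ ⨾ f))
                 ∼ operm ρ o⨾ cast₂ OTm (sym el) refl (gen b c ub uc f)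
    rel-symʳ : ∀ (a b c c' : List ℕ) .(ua : Unique a) .(ub : Unique b)
               .(uc : Unique c) .(uc' : Unique c')
               (eS : fromList c ≡ fromList c') (el : length b ≡ length c)
               (ρ : Permutation (length c) (length c'))
               (hρ : ∀ i → lookup c' (ρ ⟨$⟩ʳ i) ≡ lookup c i)
               (f : Hom (fromList a) (fromList b)) →
               gen a c' ua uc' (cast₂ Hom refl eS (f ⨾ [ b ∣ c ]⟨ ub , uc , el ⟩))
                 ∼ gen a b ua ub f o⨾ cast₂ OTm (sym el) refl (operm ρ)

ORD : NomPROP → PROP
ORD T = record
  { Hom = OTm ; _≈_ = _∼_
  ; ≈-equiv = record { refl = ∼refl ; sym = ∼sym ; trans = ∼trans }
  ; id = oid ; _⨾_ = _o⨾_ ; _⊕_ = _o⊕_ ; perm = operm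
  ; ⨾-cong = ⨾-cong ; ⊕-cong = ⊕-cong ; idˡ = idˡ ; idʳ = idʳ ; assoc = assoc
  ; ⊕-id = ⊕-id ; ⊕-interchange = ⊕-interchange ; ⊕-unitˡ = ⊕-unitˡ
  ; ⊕-unitʳ = ⊕-unitʳ ; ⊕-assoc = ⊕-assoc ; perm-ext = perm-ext ; perm-id = perm-id
  ; perm-comp = perm-comp ; perm-⊕ = perm-⊕ ; perm-nat = perm-nat }
  where open ORDdef T

ordMap : ∀ {T T' : NomPROP} → (∀ {A B} → NomPROP.Hom T A B → NomPROP.Hom T' A B) →
         ∀ {m n} → ORDdef.OTm T m n → ORDdef.OTm T' m n
ordMap F (ORDdef.gen a b ua ub f) = ORDdef.gen a b ua ub (F f)
ordMap F ORDdef.oid = ORDdef.oid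
ordMap F (f ORDdef.o⨾ g) = ordMap F f ORDdef.o⨾ ordMap F g
ordMap F (f ORDdef.o⊕ g) = ordMap F f ORDdef.o⊕ ordMap F g
ordMap F (ORDdef.operm π) = ORDdef.operm π

module NOMdef (S : PROP) where
  open PROP S using (Hom; _≈_; id; _⨾_; _⊕_; perm)

  infixr 9 _n⨾_
  data NTm : FSet → FSet → Set where
    ngen : (a b : List ℕ) → .(Unique a) → .(Unique b) →
           Hom (length a) (length b) → NTm (fromList a) (fromList b)
    nid  : ∀ {A} → NTm A A
    _n⨾_ : ∀ {A B C} → NTm A B → NTm B C → NTm A C
    nten : ∀ {A B C D} → NTm A B → NTm C D →
           .(Disjoint A C) → .(Disjoint B D) → NTm (A ∪ C) (B ∪ D)
    nbij : (π : Perm𝒩) (A : FSet) → NTm A (π [ A ])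

  nδ : ∀ a b → NTm ⟦ a ⟧ ⟦ b ⟧
  nδ a b = cast₂ NTm refl (τ-sing a b) (nbij (τ a b) ⟦ a ⟧)

  [_∣_]ₙ⟨_,_,_⟩ : (a b : List ℕ) → .(Unique a) → .(Unique b) → length a ≡ length b →
                  NTm (fromList a) (fromList b)
  [ a ∣ b ]ₙ⟨ ua , ub , e ⟩ = Brak.brak (nid {∅}) nδ nten a b ua ub e

  infix 4 _≃_
  data _≃_ : ∀ {A B} → NTm A B → NTm A B → Set where
    ≃refl  : ∀ {A B} {f : NTm A B} → f ≃ f
    ≃sym   : ∀ {A B} {f g : NTm A B} → f ≃ g → g ≃ f
    ≃trans : ∀ {A B} {f g h : NTm A B} → f ≃ g → g ≃ h → f ≃ h
    ⨾-cong : ∀ {A B C} {f f' : NTm A B} {g g' : NTm B C} →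
             f ≃ f' → g ≃ g' → f n⨾ g ≃ f' n⨾ g'
    ten-cong : ∀ {A B C D} {f f' : NTm A B} {g g' : NTm C D}
               .(p : Disjoint A C) .(q : Disjoint B D) →
               f ≃ f' → g ≃ g' → nten f g p q ≃ nten f' g' p q
    idˡ   : ∀ {A B} (f : NTm A B) → nid n⨾ f ≃ f
    idʳ   : ∀ {A B} (f : NTm A B) → f n⨾ nid ≃ f
    assoc : ∀ {A B C D} (f : NTm A B) (g : NTm B C) (h : NTm C D) →
            (f n⨾ g) n⨾ h ≃ f n⨾ (g n⨾ h)
    ten-id : ∀ {A C} .(p : Disjoint A C) → nten (nid {A}) (nid {C}) p p ≃ nid
    interchange : ∀ {A B C A' B' C'} (f : NTm A B) (g : NTm B C) (f' : NTm A' B') (g' : NTm B' C')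
            .(p : Disjoint A A') .(q : Disjoint B B') .(r : Disjoint C C') →
            nten (f n⨾ g) (f' n⨾ g') p r ≃ nten f f' p q n⨾ nten g g' q r
    ten-unitˡ : ∀ {A B} (f : NTm A B) .(p : Disjoint ∅ A) .(q : Disjoint ∅ B) →
            nten (nid {∅}) f p q ≃ f
    ten-unitʳ : ∀ {A B} (f : NTm A B) .(p : Disjoint A ∅) .(q : Disjoint B ∅)
            (e₁ : A ∪ ∅ ≡ A) (e₂ : B ∪ ∅ ≡ B) →
            cast₂ NTm e₁ e₂ (nten f (nid {∅}) p q) ≃ f
    ten-assoc : ∀ {A B C D E F} (f : NTm A B) (g : NTm C D) (h : NTm E F)
            .(p : Disjoint A C) .(q : Disjoint B D)
            .(p' : Disjoint (A ∪ C) E) .(q' : Disjoint (B ∪ D) F)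
            .(r : Disjoint C E) .(s : Disjoint D F)
            .(r' : Disjoint A (C ∪ E)) .(s' : Disjoint B (D ∪ F))
            (e₁ : (A ∪ C) ∪ E ≡ A ∪ (C ∪ E)) (e₂ : (B ∪ D) ∪ F ≡ B ∪ (D ∪ F)) →
            cast₂ NTm e₁ e₂ (nten (nten f g p q) h p' q') ≃ nten f (nten g h r s) r' s'
    ten-comm : ∀ {A B C D} (f : NTm A B) (g : NTm C D)
            .(p : Disjoint A C) .(q : Disjoint B D)
            .(p' : Disjoint C A) .(q' : Disjoint D B)
            (e₁ : A ∪ C ≡ C ∪ A) (e₂ : B ∪ D ≡ D ∪ B) →
            cast₂ NTm e₁ e₂ (nten f g p q) ≃ nten g f p' q'
    bij-ext  : ∀ (π ρ : Perm𝒩) (A : FSet) → (∀ x → x ∈ₛ A → app π x ≡ app ρ x) →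
               (e : π [ A ] ≡ ρ [ A ]) → cast₂ NTm refl e (nbij π A) ≃ nbij ρ A
    bij-id   : ∀ (A : FSet) (e : idπ [ A ] ≡ A) → cast₂ NTm refl e (nbij idπ A) ≃ nid
    bij-comp : ∀ (π ρ : Perm𝒩) (A : FSet) (e : ρ [ π [ A ] ] ≡ (ρ ∘π π) [ A ]) →
               cast₂ NTm refl e (nbij π A n⨾ nbij ρ (π [ A ])) ≃ nbij (ρ ∘π π) A
    bij-ten  : ∀ (π : Perm𝒩) (A C : FSet)
               .(p : Disjoint A C) .(q : Disjoint (π [ A ]) (π [ C ]))
               (e : π [ A ] ∪ π [ C ] ≡ π [ A ∪ C ]) →
               cast₂ NTm refl e (nten (nbij π A) (nbij π C) p q) ≃ nbij π (A ∪ C)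
    gen-cong : ∀ (a b : List ℕ) .(ua : Unique a) .(ub : Unique b)
               {f g : Hom (length a) (length b)} →
               f ≈ g → ngen a b ua ub f ≃ ngen a b ua ub g
    rel-⨾ : ∀ (a b c : List ℕ) .(ua : Unique a) .(ub : Unique b) .(uc : Unique c)
            (f : Hom (length a) (length b)) (g : Hom (length b) (length c)) →
            ngen a c ua uc (f ⨾ g) ≃ ngen a b ua ub f n⨾ ngen b c ub uc g
    rel-⊕ : ∀ (a b c d : List ℕ)
            .(ua : Unique a) .(ub : Unique b) .(uc : Unique c) .(ud : Unique d)
            .(uac : Unique (a ++ c)) .(ubd : Unique (b ++ d))
            (f : Hom (length a) (length b)) (g : Hom (length c) (length d))
            .(p : Disjoint (fromList a) (fromList c)) .(q : Disjoint (fromList b) (fromList d))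
            (e₁ : length (a ++ c) ≡ length a + length c)
            (e₂ : length (b ++ d) ≡ length b + length d)
            (eA : fromList a ∪ fromList c ≡ fromList (a ++ c))
            (eB : fromList b ∪ fromList d ≡ fromList (b ++ d)) →
            ngen (a ++ c) (b ++ d) uac ubd (cast₂ Hom (sym e₁) (sym e₂) (f ⊕ g))
              ≃ cast₂ NTm eA eB (nten (ngen a b ua ub f) (ngen c d uc ud g) p q)
    rel-id : ∀ (a b : List ℕ) .(ua : Unique a) .(ub : Unique b) (e : length a ≡ length b) →
             ngen a b ua ub (cast₂ Hom refl e id) ≃ [ a ∣ b ]ₙ⟨ ua , ub , e ⟩
    -- [a⟩⟨b|b'⟩;f⟨c] = [a|b];[b'⟩f⟨c]
    -- (⟨b|b'⟩ is the symmetry ρ with ρ(i) = j iff bᵢ = b'ⱼ)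
    rel-symˡ : ∀ (a b b' c : List ℕ) .(ua : Unique a) .(ub : Unique b)
               .(ub' : Unique b') .(uc : Unique c)
               (eS : fromList b ≡ fromList b') (el : length a ≡ length b)
               (ρ : Permutation (length b) (length b'))
               (hρ : ∀ i → lookup b' (ρ ⟨$⟩ʳ i) ≡ lookup b i)
               (f : Hom (length b') (length c)) →
               ngen a c ua uc (cast₂ Hom (sym el) refl (perm ρ ⨾ f))
                 ≃ [ a ∣ b ]ₙ⟨ ua , ub , el ⟩ n⨾ cast₂ NTm (sym eS) refl (ngen b' c ub' uc f)
    rel-symʳ : ∀ (a b b' c : List ℕ) .(ua : Unique a) .(ub : Unique b)
               .(ub' : Unique b') .(uc : Unique c)
               (eS : fromList b ≡ fromList b') (el : length b' ≡ length c)
               (ρ : Permutation (length b) (length b'))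
               (hρ : ∀ i → lookup b' (ρ ⟨$⟩ʳ i) ≡ lookup b i)
               (f : Hom (length a) (length b)) →
               ngen a c ua uc (cast₂ Hom refl el (f ⨾ perm ρ))
                 ≃ ngen a b ua ub f n⨾ cast₂ NTm (sym eS) refl [ b' ∣ c ]ₙ⟨ ub' , uc , el ⟩

NOM : PROP → NomPROP
NOM S = record
  { Hom = NTm ; _≈_ = _≃_
  ; ≈-equiv = record { refl = ≃refl ; sym = ≃sym ; trans = ≃trans }
  ; id = nid ; _⨾_ = _n⨾_ ; ten = nten ; bij = nbij
  ; ⨾-cong = ⨾-cong ; ten-cong = ten-cong ; idˡ = idˡ ; idʳ = idʳ ; assoc = assoc
  ; ten-id = ten-id ; interchange = interchange ; ten-unitˡ = ten-unitˡ
  ; ten-unitʳ = ten-unitʳ ; ten-assoc = ten-assoc ; ten-comm = ten-comm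
  ; bij-ext = bij-ext ; bij-id = bij-id ; bij-comp = bij-comp ; bij-ten = bij-ten }
  where open NOMdef S

nomMap : ∀ {S S' : PROP} → (∀ {m n} → PROP.Hom S m n → PROP.Hom S' m n) →
         ∀ {A B} → NOMdef.NTm S A B → NOMdef.NTm S' A B
nomMap F (NOMdef.ngen a b ua ub g) = NOMdef.ngen a b ua ub (F g)
nomMap F NOMdef.nid = NOMdef.nid
nomMap F (f NOMdef.n⨾ g) = nomMap F f NOMdef.n⨾ nomMap F g
nomMap F (NOMdef.nten f g p q) = NOMdef.nten (nomMap F f) (nomMap F g) p q
nomMap F (NOMdef.nbij π A) = NOMdef.nbij π A

-- An arrow of ORD(T) becomes an arrow of T as soon as its input and output
-- wires are given distinct names: a generator ⟨a]f[b⟩ read at names c, d is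
-- [c|a];f;[b|d], symmetries become brackets, and composites use an arbitrary
-- choice of names on the middle boundary.  The choice is immaterial because
-- every bracket [a|b] is the bijection π_{a} of any permutation π renaming a
-- onto b, so brackets compose like the renamings they induce and cancel
-- around any arrow.  This interpretation respects all relations of ORD(T),
-- and reading a generator [c⟩g⟨d] of NOM(ORD(T)) at c, d gives Φ.  Its
-- inverse sends f : A → B to the generator [a⟩⟨a]f[b⟩⟨b] for the increasing
-- enumerations a, b of A, B; the relations of NOM and ORD allow any other
-- enumerations to be used instead, which makes both composites the identity.
-- Naturality holds because morphisms of nominal PROPs preserve brackets.

module Submission where

open import Defs
open import Data.Nat using (ℕ)
open import Data.List using (List; length)
open import Data.List.Relation.Unary.Unique.Propositional using (Unique)
open import Data.Product using (Σ; _×_; _,_)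
open import Relation.Binary.PropositionalEquality using (_≡_; sym)

module FiniteSets where

  open import Data.Nat using (zero; suc; _≟_)
  open import Data.Nat.Properties using (suc-injective)
  open import Data.Bool using (Bool; true; false; _∨_)
  open import Data.Bool.Properties using (∨-zeroʳ)
  open import Data.Maybe using (just; nothing)
  open import Data.List using ([]; _∷_; _++_) renaming (map to mapL)
  open import Data.List.Properties using (map-∘; map-id)
  open import Data.List.Membership.Propositional using (_∈_; _∉_)
  open import Data.List.Membership.Propositional.Properties using (∈-map⁺; ∈-map⁻)
  open import Data.List.Relation.Unary.Any using (here; there)
  open import Data.List.Relation.Unary.Unique.DecPropositional _≟_ using (unique?)
  import Data.List.Relation.Unary.Unique.Propositional.Properties as Unique
  open import Data.List.Relation.Unary.AllPairs using ([]; _∷_)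
  import Data.List.Relation.Unary.All as All
  open import Data.List.Relation.Unary.All using ([]; _∷_)
  open import Data.Sum using ([_,_]′)
  open import Data.Empty using (⊥-elim)
  open import Data.Empty.Irrelevant using () renaming (⊥-elim to ⊥-elim-irr)
  open import Relation.Nullary.Decidable using (recompute)
  open import Relation.Binary.PropositionalEquality
    using (refl; trans; cong; cong₂; subst)
  open import Function.Bundles using (Injection)
  open import Function.Properties.Inverse using (Inverse⇒Injection)

  ∈ₛ-⟦⟧ : ∀ a → a ∈ₛ ⟦ a ⟧
  ∈ₛ-⟦⟧ zero = refl
  ∈ₛ-⟦⟧ (suc a) = ∈ₛ-⟦⟧ a

  ∈ₛ-∪ˡ : ∀ z A B → z ∈ₛ A → z ∈ₛ A ∪ B
  ∈ₛ-∪ˡ z (just x) nothing  p = p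
  ∈ₛ-∪ˡ z (just x) (just y) p = trans (memNE-or z x y) (cong (_∨ memNE z y) p)

  ∈ₛ-∪ʳ : ∀ z A B → z ∈ₛ B → z ∈ₛ A ∪ B
  ∈ₛ-∪ʳ z nothing  B        p = p
  ∈ₛ-∪ʳ z (just x) (just y) p =
    trans (memNE-or z x y) (trans (cong (memNE z x ∨_) p) (∨-zeroʳ (memNE z x)))

  ∈ₛ-fromList⁺ : ∀ {z} xs → z ∈ xs → z ∈ₛ fromList xs
  ∈ₛ-fromList⁺ (x ∷ xs) (here refl) = ∈ₛ-∪ˡ x ⟦ x ⟧ (fromList xs) (∈ₛ-⟦⟧ x)
  ∈ₛ-fromList⁺ (x ∷ xs) (there p)   = ∈ₛ-∪ʳ _ ⟦ x ⟧ (fromList xs) (∈ₛ-fromList⁺ xs p)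

  NE-inhabited : ∀ x → Σ ℕ λ n → memNE n x ≡ true
  NE-inhabited end = zero , refl
  NE-inhabited (b ∷ᵇ x) with NE-inhabited x
  ... | n , p = suc n , p

  NE-ext : ∀ x y → (∀ n → memNE n x ≡ memNE n y) → x ≡ y
  NE-ext end end h = refl
  NE-ext end (b ∷ᵇ y) h with NE-inhabited y
  ... | n , p with trans (sym p) (sym (h (suc n)))
  ... | ()
  NE-ext (a ∷ᵇ x) end h with NE-inhabited x
  ... | n , p with trans (sym p) (h (suc n))
  ... | ()
  NE-ext (a ∷ᵇ x) (b ∷ᵇ y) h = cong₂ _∷ᵇ_ (h zero) (NE-ext x y (λ n → h (suc n)))

  Bool-ext : ∀ (x y : Bool) → (x ≡ true → y ≡ true) → (y ≡ true → x ≡ true) → x ≡ y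
  Bool-ext true  true  f g = refl
  Bool-ext true  false f g = sym (f refl)
  Bool-ext false true  f g = g refl
  Bool-ext false false f g = refl

  ∈ₛ-ext : ∀ {A B} → (∀ z → z ∈ₛ A → z ∈ₛ B) → (∀ z → z ∈ₛ B → z ∈ₛ A) → A ≡ B
  ∈ₛ-ext {nothing} {nothing} f g = refl
  ∈ₛ-ext {nothing} {just y}  f g with NE-inhabited y
  ... | n , p = ⊥-elim (g n p)
  ∈ₛ-ext {just x}  {nothing} f g with NE-inhabited x
  ... | n , p = ⊥-elim (f n p)
  ∈ₛ-ext {just x}  {just y}  f g =
    cong just (NE-ext x y (λ n → Bool-ext _ _ (f n) (g n)))

  fromList-ext : ∀ xs ys → (∀ z → z ∈ xs → z ∈ ys) → (∀ z → z ∈ ys → z ∈ xs) →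
                 fromList xs ≡ fromList ys
  fromList-ext xs ys f g =
    ∈ₛ-ext (λ z p → ∈ₛ-fromList⁺ ys (f z (∈-fromList z xs p)))
           (λ z p → ∈ₛ-fromList⁺ xs (g z (∈-fromList z ys p)))

  ⊆-fromList : ∀ a a' → fromList a ≡ fromList a' → ∀ z → z ∈ a → z ∈ a'
  ⊆-fromList a a' e z p = ∈-fromList z a' (subst (z ∈ₛ_) e (∈ₛ-fromList⁺ a p))

  recomputeUnique : ∀ {xs} → .(Unique xs) → Unique xs
  recomputeUnique {xs} u = recompute (unique? xs) u

  app-injective : ∀ π {x y} → app π x ≡ app π y → x ≡ y
  app-injective π = Injection.injective (Inverse⇒Injection π)

  elemsNE-sound : ∀ {z} x → z ∈ elemsNE x → memNE z x ≡ true
  elemsNE-sound end          (here refl) = refl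
  elemsNE-sound (true ∷ᵇ x)  (here refl) = refl
  elemsNE-sound (true ∷ᵇ x)  (there p) with ∈-map⁻ suc p
  ... | w , q , refl = elemsNE-sound x q
  elemsNE-sound (false ∷ᵇ x) p with ∈-map⁻ suc p
  ... | w , q , refl = elemsNE-sound x q

  elemsNE-complete : ∀ z x → memNE z x ≡ true → z ∈ elemsNE x
  elemsNE-complete zero    end          p = here refl
  elemsNE-complete zero    (true ∷ᵇ x)  p = here refl
  elemsNE-complete (suc z) (true ∷ᵇ x)  p = there (∈-map⁺ suc (elemsNE-complete z x p))
  elemsNE-complete (suc z) (false ∷ᵇ x) p = ∈-map⁺ suc (elemsNE-complete z x p)

  elems-sound : ∀ {z} A → z ∈ elems A → z ∈ₛ A
  elems-sound (just x) p = elemsNE-sound x p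

  elems-complete : ∀ z A → z ∈ₛ A → z ∈ elems A
  elems-complete z (just x) p = elemsNE-complete z x p

  fromList-elems : ∀ A → fromList (elems A) ≡ A
  fromList-elems A = ∈ₛ-ext (λ z p → elems-sound A (∈-fromList z (elems A) p))
                            (λ z p → ∈ₛ-fromList⁺ (elems A) (elems-complete z A p))

  zero∉map-suc : ∀ xs → zero ∉ mapL suc xs
  zero∉map-suc xs p with ∈-map⁻ suc p
  ... | _ , _ , ()

  elemsNE-unique : ∀ x → Unique (elemsNE x)
  elemsNE-unique end = [] ∷ []
  elemsNE-unique (true ∷ᵇ x) =
    All.tabulate (λ p e → zero∉map-suc (elemsNE x) (subst (_∈ _) (sym e) p))
    ∷ Unique.map⁺ suc-injective (elemsNE-unique x)
  elemsNE-unique (false ∷ᵇ x) = Unique.map⁺ suc-injective (elemsNE-unique x)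

  elems-unique : ∀ A → Unique (elems A)
  elems-unique nothing  = []
  elems-unique (just x) = elemsNE-unique x

  ∪-comm : ∀ A B → A ∪ B ≡ B ∪ A
  ∪-comm A B = ∈ₛ-ext (λ z p → [ ∈ₛ-∪ʳ z B A , ∈ₛ-∪ˡ z B A ]′ (∈-∪ z A B p))
                      (λ z p → [ ∈ₛ-∪ʳ z A B , ∈ₛ-∪ˡ z A B ]′ (∈-∪ z B A p))

  ∪-assoc : ∀ A B C → (A ∪ B) ∪ C ≡ A ∪ (B ∪ C)
  ∪-assoc A B C = ∈ₛ-ext to from
    where
    to : ∀ z → z ∈ₛ (A ∪ B) ∪ C → z ∈ₛ A ∪ (B ∪ C)
    to z p = [ (λ q → [ ∈ₛ-∪ˡ z A _ , (λ r → ∈ₛ-∪ʳ z A _ (∈ₛ-∪ˡ z B C r)) ]′ (∈-∪ z A B q))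
             , (λ q → ∈ₛ-∪ʳ z A _ (∈ₛ-∪ʳ z B C q)) ]′ (∈-∪ z (A ∪ B) C p)
    from : ∀ z → z ∈ₛ A ∪ (B ∪ C) → z ∈ₛ (A ∪ B) ∪ C
    from z p = [ (λ q → ∈ₛ-∪ˡ z _ C (∈ₛ-∪ˡ z A B q))
               , (λ q → [ (λ r → ∈ₛ-∪ˡ z _ C (∈ₛ-∪ʳ z A B r)) , ∈ₛ-∪ʳ z _ C ]′ (∈-∪ z B C q))
               ]′ (∈-∪ z A (B ∪ C) p)

  ∪-identityʳ : ∀ A → A ∪ ∅ ≡ A
  ∪-identityʳ nothing  = refl
  ∪-identityʳ (just x) = refl

  fromList-++ : ∀ a b → fromList (a ++ b) ≡ fromList a ∪ fromList b
  fromList-++ []      b = refl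
  fromList-++ (x ∷ a) b =
    trans (cong (⟦ x ⟧ ∪_) (fromList-++ a b)) (sym (∪-assoc ⟦ x ⟧ (fromList a) (fromList b)))

  image-fromList : ∀ π a → π [ fromList a ] ≡ fromList (mapL (app π) a)
  image-fromList π a = fromList-ext _ _ to from
    where
    to : ∀ z → z ∈ mapL (app π) (elems (fromList a)) → z ∈ mapL (app π) a
    to z p with ∈-map⁻ (app π) p
    ... | w , q , refl = ∈-map⁺ (app π) (∈-fromList w a (elems-sound (fromList a) q))
    from : ∀ z → z ∈ mapL (app π) a → z ∈ mapL (app π) (elems (fromList a))
    from z p with ∈-map⁻ (app π) p
    ... | w , q , refl = ∈-map⁺ (app π) (elems-complete w (fromList a) (∈ₛ-fromList⁺ a q))

  ∈-image⁻ : ∀ π A z → z ∈ₛ π [ A ] → Σ ℕ λ w → w ∈ₛ A × app π w ≡ z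
  ∈-image⁻ π A z p with ∈-map⁻ (app π) (∈-fromList z _ p)
  ... | w , q , e = w , elems-sound A q , sym e

  ∈-image⁺ : ∀ π A w → w ∈ₛ A → app π w ∈ₛ π [ A ]
  ∈-image⁺ π A w p = ∈ₛ-fromList⁺ _ (∈-map⁺ (app π) (elems-complete w A p))

  image-∪ : ∀ π A C → π [ A ] ∪ π [ C ] ≡ π [ A ∪ C ]
  image-∪ π A C = ∈ₛ-ext to from
    where
    image-mono : ∀ {z} X → (∀ w → w ∈ₛ X → w ∈ₛ A ∪ C) → z ∈ₛ π [ X ] → z ∈ₛ π [ A ∪ C ]
    image-mono {z} X X⊆A∪C q with ∈-image⁻ π X z q
    ... | w , w∈X , refl = ∈-image⁺ π (A ∪ C) w (X⊆A∪C w w∈X)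
    to : ∀ z → z ∈ₛ π [ A ] ∪ π [ C ] → z ∈ₛ π [ A ∪ C ]
    to z p = [ image-mono A (λ w → ∈ₛ-∪ˡ w A C) , image-mono C (λ w → ∈ₛ-∪ʳ w A C) ]′ (∈-∪ z _ _ p)
    from : ∀ z → z ∈ₛ π [ A ∪ C ] → z ∈ₛ π [ A ] ∪ π [ C ]
    from z p with ∈-image⁻ π (A ∪ C) z p
    ... | w , w∈A∪C , refl = [ (λ q → ∈ₛ-∪ˡ _ (π [ A ]) _ (∈-image⁺ π A w q))
                             , (λ q → ∈ₛ-∪ʳ _ (π [ A ]) _ (∈-image⁺ π C w q)) ]′ (∈-∪ w A C w∈A∪C)

  image-∘π : ∀ π ρ A → ρ [ π [ A ] ] ≡ (ρ ∘π π) [ A ]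
  image-∘π π ρ A =
    trans (image-fromList ρ (mapL (app π) (elems A))) (cong fromList (sym (map-∘ (elems A))))

  image-ext : ∀ π ρ A → (∀ x → x ∈ₛ A → app π x ≡ app ρ x) → π [ A ] ≡ ρ [ A ]
  image-ext π ρ A h = cong fromList (map-ext (elems A) (λ x q → h x (elems-sound A q)))
    where
    map-ext : ∀ xs → (∀ x → x ∈ xs → app π x ≡ app ρ x) → mapL (app π) xs ≡ mapL (app ρ) xs
    map-ext []       h' = refl
    map-ext (x ∷ xs) h' = cong₂ _∷_ (h' x (here refl)) (map-ext xs (λ y q → h' y (there q)))

  image-idπ : ∀ A → idπ [ A ] ≡ A
  image-idπ A = trans (cong fromList (map-id (elems A))) (fromList-elems A)

  image-Disjoint : ∀ π A C → Disjoint A C → Disjoint (π [ A ]) (π [ C ])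
  image-Disjoint π A C d z p q with ∈-image⁻ π A z p | ∈-image⁻ π C z q
  ... | w , w∈A , e | w' , w'∈C , e' =
    d w w∈A (subst (_∈ₛ C) (app-injective π (trans e' (sym e))) w'∈C)

  unique-++ : ∀ a c → Unique a → Unique c → Disjoint (fromList a) (fromList c) → Unique (a ++ c)
  unique-++ a c ua uc d = Unique.++⁺ ua uc (λ { (p , q) → d _ (∈ₛ-fromList⁺ a p) (∈ₛ-fromList⁺ c q) })

  recomputeDisjoint : ∀ {A C} → .(Disjoint A C) → Disjoint A C
  recomputeDisjoint p x a c = ⊥-elim-irr (p x a c)

  -- The renaming of a unique list onto another one of the same length
  -- fixes the head by a final transposition; uniqueness makes that
  -- transposition harmless on the tail.
  renamingPerm : List ℕ → List ℕ → Perm𝒩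
  renamingPerm (x ∷ a) (y ∷ b) = τ (app (renamingPerm a b) x) y ∘π renamingPerm a b
  renamingPerm _       _       = idπ

  renamingPerm-spec : ∀ a b → Unique a → Unique b → length a ≡ length b →
                      mapL (app (renamingPerm a b)) a ≡ b
  renamingPerm-spec []      []      _  _  _ = refl
  renamingPerm-spec (x ∷ a) (y ∷ b) ua ub e =
    cong₂ _∷_ (swapN-a (app π x) y) tail-fixed
    where
    π = renamingPerm a b
    ih = renamingPerm-spec a b (unique-tail ua) (unique-tail ub) (suc-injective e)
    swap-fixes : ∀ {w} → w ∈ b → swapN (app π x) y w ≡ w
    swap-fixes {w} w∈b with ∈-map⁻ (app π) (subst (w ∈_) (sym ih) w∈b)
    ... | z , z∈a , refl =
      swapN-other (app π x) y (app π z)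
        (λ πz≡πx → Unique.Unique[x∷xs]⇒x∉xs ua (subst (_∈ a) (app-injective π πz≡πx) z∈a))
        (λ πz≡y → Unique.Unique[x∷xs]⇒x∉xs ub (subst (_∈ b) πz≡y w∈b))
    fix-all : ∀ ws → (∀ {w} → w ∈ ws → swapN (app π x) y w ≡ w) →
              mapL (swapN (app π x) y) ws ≡ ws
    fix-all []       _ = refl
    fix-all (w ∷ ws) h = cong₂ _∷_ (h (here refl)) (fix-all ws (λ q → h (there q)))
    tail-fixed : mapL (λ z → swapN (app π x) y (app π z)) a ≡ b
    tail-fixed = trans (map-∘ a) (trans (cong (mapL (swapN (app π x) y)) ih) (fix-all b swap-fixes))
  renamingPerm-spec []      (_ ∷ _) _ _ ()
  renamingPerm-spec (_ ∷ _) []      _ _ ()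

  findRenaming : ∀ a b → .(Unique a) → .(Unique b) → length a ≡ length b →
                 Σ Perm𝒩 λ π → mapL (app π) a ≡ b
  findRenaming a b ua ub e =
    renamingPerm a b , renamingPerm-spec a b (recomputeUnique ua) (recomputeUnique ub) e

module NameVectors where

  open FiniteSets
  open import Data.Nat using (zero; suc; _+_; _<_)
  open import Data.Nat.Properties using (<-irrefl; ≤-refl; m≤n⇒m≤1+n; suc-injective)
  open import Data.Fin using (Fin; zero; suc; _↑ˡ_; _↑ʳ_)
  import Data.Fin as Fin
  open import Data.Fin.Properties using (splitAt-↑ˡ; splitAt-↑ʳ; cast-is-id) renaming (suc-injective to Fin-suc-injective)
  import Data.Fin.Permutation as Perm
  open import Data.Fin.Permutation using (Permutation; _⟨$⟩ʳ_; _⟨$⟩ˡ_; inverseʳ; inverseˡ; _∘ₚ_)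
  open import Data.List using ([]; _∷_; _++_) renaming (map to mapL)
  import Data.List as L
  open import Data.List.Properties using (∷-injective)
  open import Data.List.Membership.Propositional using (_∈_)
  open import Data.List.Membership.Propositional.Properties using (∈-++⁺ˡ; ∈-++⁺ʳ; ∈-lookup)
  open import Data.List.Relation.Unary.Any using (here; there; index)
  open import Data.List.Relation.Unary.Any.Properties using (lookup-index)
  open import Data.List.Relation.Unary.AllPairs using ([]; _∷_)
  import Data.List.Relation.Unary.All as All
  open import Data.Vec using (Vec; []; _∷_; toList; lookup; tabulate; take; drop)
    renaming (_++_ to _++ᵥ_; map to mapV)
  open import Data.Vec.Properties
    using ( lookup∘tabulate; tabulate∘lookup; tabulate-cong; toList-++; lookup-map; take++drop≡id
          ; toList∘fromList; length-toList; toList-map)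
  import Data.Vec as Vec
  import Data.Vec.Properties as Vec
  open import Data.Empty using (⊥; ⊥-elim)
  open import Relation.Binary.PropositionalEquality
    using (_≢_; refl; trans; cong; subst; subst₂; module ≡-Reasoning)
  open import Function.Bundles using (mk↔ₛ′)

  private variable
    m n k l : ℕ

  ⟪_⟫ : Vec ℕ n → FSet
  ⟪ v ⟫ = fromList (toList v)

  toList-take++drop : ∀ m (c : Vec ℕ (m + k)) → toList (take m c) L.++ toList (drop m c) ≡ toList c
  toList-take++drop m c = trans (sym (toList-++ (take m c) (drop m c))) (cong toList (take++drop≡id m c))

  toList-injective : (v w : Vec ℕ n) → toList v ≡ toList w → v ≡ w
  toList-injective v w e = trans (sym (Vec.cast-is-id refl v)) (Vec.toList-injective refl v w e)

  ⟪fromList⟫ : ∀ xs → ⟪ Vec.fromList xs ⟫ ≡ fromList xs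
  ⟪fromList⟫ xs = cong fromList (toList∘fromList xs)

  unique-fromList : ∀ xs → .(Unique xs) → Unique (toList (Vec.fromList xs))
  unique-fromList xs u = subst Unique (sym (toList∘fromList xs)) (recomputeUnique u)

  take-++ : ∀ {A : Set} (c₁ : Vec A m) (c₂ : Vec A k) → take m (c₁ ++ᵥ c₂) ≡ c₁
  take-++ []       c₂ = refl
  take-++ (x ∷ c₁) c₂ = cong (x ∷_) (take-++ c₁ c₂)

  drop-++ : ∀ {A : Set} (c₁ : Vec A m) (c₂ : Vec A k) → drop m (c₁ ++ᵥ c₂) ≡ c₂
  drop-++ []       c₂ = refl
  drop-++ (x ∷ c₁) c₂ = drop-++ c₁ c₂

  ++-split : ∀ (xs xs' ys ys' : List ℕ) → length xs ≡ length xs' → xs ++ ys ≡ xs' ++ ys' →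
             (xs ≡ xs') × (ys ≡ ys')
  ++-split []       []         ys ys' _ e    = refl , e
  ++-split (x ∷ xs) (x' ∷ xs') ys ys' l e with ∷-injective e
  ... | refl , e' with ++-split xs xs' ys ys' (suc-injective l) e'
  ... | refl , e'' = refl , e''
  ++-split []       (_ ∷ _)    ys ys' () e
  ++-split (_ ∷ _)  []         ys ys' () e

  unique-++⁻ˡ : ∀ (xs : List ℕ) {ys} → Unique (xs ++ ys) → Unique xs
  unique-++⁻ˡ []       u       = []
  unique-++⁻ˡ (x ∷ xs) (h ∷ t) = All.tabulate (λ p → All.lookup h (∈-++⁺ˡ p)) ∷ unique-++⁻ˡ xs t

  unique-++⁻ʳ : ∀ (xs : List ℕ) {ys} → Unique (xs ++ ys) → Unique ys
  unique-++⁻ʳ []       u       = u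
  unique-++⁻ʳ (x ∷ xs) (h ∷ t) = unique-++⁻ʳ xs t

  unique-++⁻-disjoint : ∀ (xs : List ℕ) {ys} → Unique (xs ++ ys) → ∀ {z} → z ∈ xs → z ∈ ys → ⊥
  unique-++⁻-disjoint (x ∷ xs) (h ∷ t) (here refl) q = All.lookup h (∈-++⁺ʳ xs q) refl
  unique-++⁻-disjoint (x ∷ xs) (h ∷ t) (there p)   q = unique-++⁻-disjoint xs t p q

  unique-take : ∀ m (c : Vec ℕ (m + k)) → Unique (toList c) → Unique (toList (take m c))
  unique-take m c u = unique-++⁻ˡ (toList (take m c)) (subst Unique (sym (toList-take++drop m c)) u)

  unique-drop : ∀ m (c : Vec ℕ (m + k)) → Unique (toList c) → Unique (toList (drop m c))
  unique-drop m c u = unique-++⁻ʳ (toList (take m c)) (subst Unique (sym (toList-take++drop m c)) u)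

  Disjoint-take-drop : ∀ m (c : Vec ℕ (m + k)) → Unique (toList c) → Disjoint ⟪ take m c ⟫ ⟪ drop m c ⟫
  Disjoint-take-drop m c u z p q =
    unique-++⁻-disjoint (toList (take m c)) (subst Unique (sym (toList-take++drop m c)) u)
                        (∈-fromList z _ p) (∈-fromList z _ q)

  ⟪⟫-take-drop : ∀ m (c : Vec ℕ (m + k)) → ⟪ c ⟫ ≡ ⟪ take m c ⟫ ∪ ⟪ drop m c ⟫
  ⟪⟫-take-drop m c = trans (cong fromList (sym (toList-take++drop m c)))
                            (fromList-++ (toList (take m c)) (toList (drop m c)))

  -- A fixed choice of distinct names for the intermediate boundary of a composite.
  downFrom : (n : ℕ) → Vec ℕ n
  downFrom zero    = []
  downFrom (suc n) = n ∷ downFrom n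

  downFrom-< : ∀ n z → z ∈ toList (downFrom n) → z < n
  downFrom-< (suc n) z (here refl) = ≤-refl
  downFrom-< (suc n) z (there p)   = m≤n⇒m≤1+n (downFrom-< n z p)

  unique-downFrom : ∀ n → Unique (toList (downFrom n))
  unique-downFrom zero    = []
  unique-downFrom (suc n) =
    All.tabulate (λ {z} p e → <-irrefl (sym e) (downFrom-< n z p)) ∷ unique-downFrom n

  lookup-∈ : ∀ (v : Vec ℕ n) i → lookup v i ∈ toList v
  lookup-∈ (x ∷ v) zero    = here refl
  lookup-∈ (x ∷ v) (suc i) = there (lookup-∈ v i)

  ∈-lookup⁻ : ∀ (v : Vec ℕ n) {z} → z ∈ toList v → Σ (Fin n) λ i → z ≡ lookup v i
  ∈-lookup⁻ (x ∷ v) (here refl) = zero , refl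
  ∈-lookup⁻ (x ∷ v) (there p) with ∈-lookup⁻ v p
  ... | i , e = suc i , e

  lookup-injective : ∀ (v : Vec ℕ n) → Unique (toList v) → ∀ i j → lookup v i ≡ lookup v j → i ≡ j
  lookup-injective (x ∷ v) u       zero    zero    e = refl
  lookup-injective (x ∷ v) (h ∷ t) zero    (suc j) e = ⊥-elim (All.lookup h (lookup-∈ v j) e)
  lookup-injective (x ∷ v) (h ∷ t) (suc i) zero    e = ⊥-elim (All.lookup h (lookup-∈ v i) (sym e))
  lookup-injective (x ∷ v) (h ∷ t) (suc i) (suc j) e = cong suc (lookup-injective v t i j e)

  lookup-ext : (v w : Vec ℕ n) → (∀ i → lookup v i ≡ lookup w i) → v ≡ w
  lookup-ext v w h = trans (sym (tabulate∘lookup v)) (trans (tabulate-cong h) (tabulate∘lookup w))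

  unique-tabulate : ∀ {n} (f : Fin n → ℕ) → (∀ i j → f i ≡ f j → i ≡ j) → Unique (toList (tabulate f))
  unique-tabulate {zero}  f inj = []
  unique-tabulate {suc n} f inj =
    All.tabulate head-fresh ∷ unique-tabulate (λ i → f (suc i)) (λ i j e → Fin-suc-injective (inj (suc i) (suc j) e))
    where
    head-fresh : ∀ {z} → z ∈ toList (tabulate (λ i → f (suc i))) → f zero ≢ z
    head-fresh p e with ∈-lookup⁻ (tabulate (λ i → f (suc i))) p
    ... | i , e' with inj zero (suc i) (trans e (trans e' (lookup∘tabulate _ i)))
    ... | ()

  permute : Permutation m n → Vec ℕ n → Vec ℕ m
  permute π d = tabulate (λ i → lookup d (π ⟨$⟩ʳ i))

  lookup-permute : ∀ (π : Permutation m n) d i → lookup (permute π d) i ≡ lookup d (π ⟨$⟩ʳ i)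
  lookup-permute π d i = lookup∘tabulate _ i

  unique-permute : ∀ (π : Permutation m n) d → Unique (toList d) → Unique (toList (permute π d))
  unique-permute π d u = unique-tabulate _ (λ i j e → π-injective (lookup-injective d u _ _ e))
    where
    π-injective : ∀ {i j} → π ⟨$⟩ʳ i ≡ π ⟨$⟩ʳ j → i ≡ j
    π-injective e = trans (sym (inverseˡ π)) (trans (cong (π ⟨$⟩ˡ_) e) (inverseˡ π))

  ⟪⟫-permute : ∀ (π : Permutation m n) d → ⟪ permute π d ⟫ ≡ ⟪ d ⟫
  ⟪⟫-permute π d = fromList-ext _ _ to from
    where
    to : ∀ z → z ∈ toList (permute π d) → z ∈ toList d
    to z p with ∈-lookup⁻ (permute π d) p
    ... | i , e = subst (_∈ toList d) (sym (trans e (lookup-permute π d i))) (lookup-∈ d _)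
    from : ∀ z → z ∈ toList d → z ∈ toList (permute π d)
    from z p with ∈-lookup⁻ d p
    ... | j , e = subst (_∈ toList (permute π d))
                    (sym (trans e (sym (trans (lookup-permute π d (π ⟨$⟩ˡ j)) (cong (lookup d) (inverseʳ π))))))
                    (lookup-∈ (permute π d) (π ⟨$⟩ˡ j))

  map-permute : ∀ (f : ℕ → ℕ) (π : Permutation m n) d → mapV f (permute π d) ≡ permute π (mapV f d)
  map-permute f π d = lookup-ext _ _ λ i → begin
    lookup (mapV f (permute π d)) i  ≡⟨ lookup-map i f (permute π d) ⟩
    f (lookup (permute π d) i)       ≡⟨ cong f (lookup-permute π d i) ⟩
    f (lookup d (π ⟨$⟩ʳ i))           ≡⟨ lookup-map (π ⟨$⟩ʳ i) f d ⟨
    lookup (mapV f d) (π ⟨$⟩ʳ i)      ≡⟨ lookup-permute π (mapV f d) i ⟨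
    lookup (permute π (mapV f d)) i  ∎
    where open ≡-Reasoning

  permute-∘ₚ : ∀ {o} (π : Permutation m n) (ρ : Permutation n o) d →
               permute π (permute ρ d) ≡ permute (π ∘ₚ ρ) d
  permute-∘ₚ π ρ d = lookup-ext _ _ λ i →
    trans (lookup-permute π (permute ρ d) i) (trans (lookup-permute ρ d _) (sym (lookup-permute (π ∘ₚ ρ) d i)))

  permute-id : ∀ (d : Vec ℕ n) → permute Perm.id d ≡ d
  permute-id d = lookup-ext _ _ (lookup-permute Perm.id d)

  lookup-take : ∀ m {k} (d : Vec ℕ (m + k)) j → lookup (take m d) j ≡ lookup d (j ↑ˡ k)
  lookup-take (suc m) (x ∷ d) zero    = refl
  lookup-take (suc m) (x ∷ d) (suc j) = lookup-take m d j

  lookup-drop : ∀ m {k} (d : Vec ℕ (m + k)) j → lookup (drop m d) j ≡ lookup d (m ↑ʳ j)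
  lookup-drop zero    d       j = refl
  lookup-drop (suc m) (x ∷ d) j = lookup-drop m d j

  ⊕ₚ-↑ˡ : ∀ (π : Permutation m n) (ρ : Permutation k l) i → (π ⊕ₚ ρ) ⟨$⟩ʳ (i ↑ˡ k) ≡ (π ⟨$⟩ʳ i) ↑ˡ l
  ⊕ₚ-↑ˡ {m} {k = k} π ρ i rewrite splitAt-↑ˡ m i k = refl

  ⊕ₚ-↑ʳ : ∀ (π : Permutation m n) (ρ : Permutation k l) i → (π ⊕ₚ ρ) ⟨$⟩ʳ (m ↑ʳ i) ≡ n ↑ʳ (ρ ⟨$⟩ʳ i)
  ⊕ₚ-↑ʳ {m} {k = k} π ρ i rewrite splitAt-↑ʳ m k i = refl

  swapₚ-↑ˡ : ∀ m k i → swapₚ m k ⟨$⟩ʳ (i ↑ˡ k) ≡ k ↑ʳ i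
  swapₚ-↑ˡ m k i rewrite splitAt-↑ˡ m i k = refl

  swapₚ-↑ʳ : ∀ m k i → swapₚ m k ⟨$⟩ʳ (m ↑ʳ i) ≡ i ↑ˡ m
  swapₚ-↑ʳ m k i rewrite splitAt-↑ʳ m k i = refl

  take-permute-⊕ₚ : ∀ (π : Permutation m n) (ρ : Permutation k l) (d : Vec ℕ (n + l)) →
                    take m (permute (π ⊕ₚ ρ) d) ≡ permute π (take n d)
  take-permute-⊕ₚ {m} {n} π ρ d = lookup-ext _ _ λ i →
    trans (lookup-take m (permute (π ⊕ₚ ρ) d) i)
    (trans (lookup-permute (π ⊕ₚ ρ) d _)
    (trans (cong (lookup d) (⊕ₚ-↑ˡ π ρ i))
    (trans (sym (lookup-take n d _)) (sym (lookup-permute π (take n d) i)))))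

  drop-permute-⊕ₚ : ∀ (π : Permutation m n) (ρ : Permutation k l) (d : Vec ℕ (n + l)) →
                    drop m (permute (π ⊕ₚ ρ) d) ≡ permute ρ (drop n d)
  drop-permute-⊕ₚ {m} {n} π ρ d = lookup-ext _ _ λ i →
    trans (lookup-drop m (permute (π ⊕ₚ ρ) d) i)
    (trans (lookup-permute (π ⊕ₚ ρ) d _)
    (trans (cong (lookup d) (⊕ₚ-↑ʳ π ρ i))
    (trans (sym (lookup-drop n d _)) (sym (lookup-permute ρ (drop n d) i)))))

  take-permute-swapₚ : ∀ n l (d : Vec ℕ (l + n)) → take n (permute (swapₚ n l) d) ≡ drop l d
  take-permute-swapₚ n l d = lookup-ext _ _ λ i →
    trans (lookup-take n (permute (swapₚ n l) d) i)
    (trans (lookup-permute (swapₚ n l) d _)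
    (trans (cong (lookup d) (swapₚ-↑ˡ n l i)) (sym (lookup-drop l d i))))

  drop-permute-swapₚ : ∀ n l (d : Vec ℕ (l + n)) → drop n (permute (swapₚ n l) d) ≡ take l d
  drop-permute-swapₚ n l d = lookup-ext _ _ λ i →
    trans (lookup-drop n (permute (swapₚ n l) d) i)
    (trans (lookup-permute (swapₚ n l) d _)
    (trans (cong (lookup d) (swapₚ-↑ʳ n l i)) (sym (lookup-take l d i))))

  subst₂-⟨$⟩ʳ : ∀ {a b m n} (p : a ≡ m) (q : b ≡ n) (π : Permutation m n) i →
               subst₂ Permutation (sym p) (sym q) π ⟨$⟩ʳ i ≡ Fin.cast (sym q) (π ⟨$⟩ʳ Fin.cast p i)
  subst₂-⟨$⟩ʳ refl refl π i = sym (trans (cast-is-id refl _) (cong (π ⟨$⟩ʳ_) (cast-is-id refl i)))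

  lookup-toList : ∀ {n} (v : Vec ℕ n) j → L.lookup (toList v) (Fin.cast (sym (length-toList v)) j) ≡ lookup v j
  lookup-toList (x ∷ v) zero = refl
  lookup-toList (x ∷ v) (suc j) = lookup-toList v j

  lookup-fromList : ∀ (xs : List ℕ) i → lookup (Vec.fromList xs) i ≡ L.lookup xs i
  lookup-fromList (x ∷ xs) zero = refl
  lookup-fromList (x ∷ xs) (suc i) = lookup-fromList xs i

  fromList-permute : ∀ c c' (ρ : Permutation (length c) (length c')) →
            (∀ i → L.lookup c' (ρ ⟨$⟩ʳ i) ≡ L.lookup c i) → Vec.fromList c ≡ permute ρ (Vec.fromList c')
  fromList-permute c c' ρ h = lookup-ext _ _ (λ i → trans (lookup-fromList c i)
                     (trans (sym (h i)) (trans (sym (lookup-fromList c' _)) (sym (lookup-permute ρ (Vec.fromList c') i)))))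

  mapV-toList : ∀ π (c : Vec ℕ n) d → mapV (app π) c ≡ d → mapL (app π) (toList c) ≡ toList d
  mapV-toList π c d e = trans (sym (toList-map (app π) c)) (cong toList e)

  toList-mapV : ∀ π (c : Vec ℕ n) d → mapL (app π) (toList c) ≡ toList d → mapV (app π) c ≡ d
  toList-mapV π c d e = toList-injective _ _ (trans (toList-map (app π) c) e)

  map-fromList : ∀ σ xs (v : Vec ℕ (length xs)) → mapL (app σ) xs ≡ toList v → mapV (app σ) (Vec.fromList xs) ≡ v
  map-fromList σ xs v e = toList-injective _ _
    (trans (toList-map (app σ) (Vec.fromList xs)) (trans (cong (mapL (app σ)) (toList∘fromList xs)) e))

  listLookup-injective : ∀ (xs : List ℕ) → Unique xs → ∀ i j → L.lookup xs i ≡ L.lookup xs j → i ≡ j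
  listLookup-injective (x ∷ xs) u       zero    zero    e = refl
  listLookup-injective (x ∷ xs) (h ∷ t) zero    (suc j) e = ⊥-elim (All.lookup h (∈-lookup j) e)
  listLookup-injective (x ∷ xs) (h ∷ t) (suc i) zero    e = ⊥-elim (All.lookup h (∈-lookup i) (sym e))
  listLookup-injective (x ∷ xs) (h ∷ t) (suc i) (suc j) e = cong suc (listLookup-injective xs t i j e)

  reindexing : ∀ x y → Unique x → Unique y → (∀ z → z ∈ y → z ∈ x) → (∀ z → z ∈ x → z ∈ y) →
               Σ (Permutation (length y) (length x)) λ ρ → ∀ i → L.lookup x (ρ ⟨$⟩ʳ i) ≡ L.lookup y i
  reindexing x y ux uy y⊆x x⊆y = ρ , to-lookup
    where
    to : Fin (length y) → Fin (length x)
    to i = index (y⊆x _ (∈-lookup i))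
    from : Fin (length x) → Fin (length y)
    from j = index (x⊆y _ (∈-lookup j))
    to-lookup : ∀ i → L.lookup x (to i) ≡ L.lookup y i
    to-lookup i = sym (lookup-index (y⊆x _ (∈-lookup i)))
    from-lookup : ∀ j → L.lookup y (from j) ≡ L.lookup x j
    from-lookup j = sym (lookup-index (x⊆y _ (∈-lookup j)))
    ρ : Permutation (length y) (length x)
    ρ = mk↔ₛ′ to from (λ j → listLookup-injective x ux _ _ (trans (to-lookup (from j)) (from-lookup j)))
                      (λ i → listLookup-injective y uy _ _ (trans (from-lookup (to i)) (to-lookup i)))

module NomPROPProperties (T : NomPROP) where

  open FiniteSets
  open import Data.Nat.Properties using (suc-injective)
  open import Data.List using ([]; _∷_; _++_) renaming (map to mapL)
  open import Data.List.Properties using (length-map; map-∘; map-id; map-++; ∷-injective)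
  open import Data.List.Membership.Propositional using (_∈_)
  open import Data.List.Relation.Unary.Any using (here; there)
  open import Data.Product using (proj₁; proj₂)
  open import Data.Sum using (inj₁; inj₂)
  open import Relation.Binary.PropositionalEquality
    using (refl; trans; cong)
  open import Relation.Binary.Structures using (IsEquivalence)
  open import Relation.Binary.Bundles using (Setoid)
  import Relation.Binary.Reasoning.Setoid as SetoidReasoning

  open NomPROP T public

  ≈refl : ∀ {A B} {f : Hom A B} → f ≈ f
  ≈refl = IsEquivalence.refl ≈-equiv

  ≈sym : ∀ {A B} {f g : Hom A B} → f ≈ g → g ≈ f
  ≈sym = IsEquivalence.sym ≈-equiv

  ≈trans : ∀ {A B} {f g h : Hom A B} → f ≈ g → g ≈ h → f ≈ h
  ≈trans = IsEquivalence.trans ≈-equiv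

  ≡→≈ : ∀ {A B} {f g : Hom A B} → f ≡ g → f ≈ g
  ≡→≈ refl = ≈refl

  Hom-setoid : FSet → FSet → Setoid _ _
  Hom-setoid A B = record { Carrier = Hom A B ; _≈_ = _≈_ ; isEquivalence = ≈-equiv }

  module ≈-Reasoning {A B : FSet} = SetoidReasoning (Hom-setoid A B)

  cast₂-cong : ∀ {A B A' B'} (p : A ≡ A') (q : B ≡ B') {f g : Hom A B} →
               f ≈ g → cast₂ Hom p q f ≈ cast₂ Hom p q g
  cast₂-cong refl refl e = e

  -- Equality of arrows whose domains and codomains are only propositionally
  -- equal, so that transports along equalities of objects can be ignored.
  infix 4 _≅_
  record _≅_ {A B A' B'} (f : Hom A B) (g : Hom A' B') : Set where
    constructor hq
    field
      eA : A ≡ A'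
      eB : B ≡ B'
      eq : cast₂ Hom eA eB f ≈ g

  ≅refl : ∀ {A B} {f : Hom A B} → f ≅ f
  ≅refl = hq refl refl ≈refl

  ≅sym : ∀ {A B A' B'} {f : Hom A B} {g : Hom A' B'} → f ≅ g → g ≅ f
  ≅sym (hq refl refl e) = hq refl refl (≈sym e)

  ≅trans : ∀ {A B A' B' A'' B''} {f : Hom A B} {g : Hom A' B'} {h : Hom A'' B''} →
           f ≅ g → g ≅ h → f ≅ h
  ≅trans (hq refl refl e) (hq refl refl e') = hq refl refl (≈trans e e')

  ≅→≈ : ∀ {A B} {f g : Hom A B} → f ≅ g → f ≈ g
  ≅→≈ (hq refl refl e) = e

  ≈→≅ : ∀ {A B} {f g : Hom A B} → f ≈ g → f ≅ g
  ≈→≅ e = hq refl refl e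

  ≡→≅ : ∀ {A B} {f g : Hom A B} → f ≡ g → f ≅ g
  ≡→≅ refl = ≅refl

  cast≅ : ∀ {A B A' B'} (p : A ≡ A') (q : B ≡ B') (f : Hom A B) → cast₂ Hom p q f ≅ f
  cast≅ refl refl f = ≅refl

  id-≅ : ∀ {X Y} → X ≡ Y → id {X} ≅ id {Y}
  id-≅ refl = ≅refl

  ≅⨾ : ∀ {A B C A' B' C'} {f : Hom A B} {g : Hom B C} {f' : Hom A' B'} {g' : Hom B' C'} →
       f ≅ f' → g ≅ g' → (f ⨾ g) ≅ (f' ⨾ g')
  ≅⨾ (hq refl refl e) (hq refl refl e') = hq refl refl (⨾-cong e e')

  ⨾-retypeʳ : ∀ {A B C B' C'} (F : Hom A B) {G : Hom B C} {G' : Hom B' C'} (r : G ≅ G') →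
              (F ⨾ G) ≅ (cast₂ Hom refl (_≅_.eA r) F ⨾ G')
  ⨾-retypeʳ F (hq refl refl e) = ≅⨾ ≅refl (hq refl refl e)

  ⨾-retypeˡ : ∀ {A B C A' B'} {F : Hom A B} {F' : Hom A' B'} (r : F ≅ F') (G : Hom B C) →
              (F ⨾ G) ≅ (F' ⨾ cast₂ Hom (_≅_.eB r) refl G)
  ⨾-retypeˡ (hq refl refl e) G = ≅⨾ (hq refl refl e) ≅refl

  cast-⨾ˡ : ∀ {A A' B C} (e : A ≡ A') (g : Hom A B) (f : Hom B C) →
            cast₂ Hom e refl (g ⨾ f) ≡ (cast₂ Hom e refl g ⨾ f)
  cast-⨾ˡ refl g f = refl

  cast-⨾ʳ : ∀ {A B C C'} (e : C ≡ C') (f : Hom A B) (g : Hom B C) →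
            cast₂ Hom refl e (f ⨾ g) ≡ (f ⨾ cast₂ Hom refl e g)
  cast-⨾ʳ refl f g = refl

  Disjoint-sym : ∀ {A C} → Disjoint A C → Disjoint C A
  Disjoint-sym d z p q = d z q p

  Disjoint-∪ˡ₁ : ∀ {A C E} → Disjoint (A ∪ C) E → Disjoint A E
  Disjoint-∪ˡ₁ {A} {C} d z p q = d z (∈ₛ-∪ˡ z A C p) q

  Disjoint-∪ˡ₂ : ∀ {A C E} → Disjoint (A ∪ C) E → Disjoint C E
  Disjoint-∪ˡ₂ {A} {C} d z p q = d z (∈ₛ-∪ʳ z A C p) q

  Disjoint-∪ʳ : ∀ {A C E} → Disjoint A C → Disjoint A E → Disjoint A (C ∪ E)
  Disjoint-∪ʳ {A} {C} {E} d d' z p q with ∈-∪ z C E q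
  ... | inj₁ r = d z p r
  ... | inj₂ r = d' z p r

  Disjoint-subst : ∀ {A C A' C'} → A ≡ A' → C ≡ C' → Disjoint A C → Disjoint A' C'
  Disjoint-subst refl refl d = d

  ≅ten : ∀ {A B C D A' B' C' D'} {f : Hom A B} {g : Hom C D} {f' : Hom A' B'} {g' : Hom C' D'} →
         f ≅ f' → g ≅ g' → .(p : Disjoint A C) .(q : Disjoint B D)
         .(p' : Disjoint A' C') .(q' : Disjoint B' D') → ten f g p q ≅ ten f' g' p' q'
  ≅ten (hq refl refl e) (hq refl refl e') p q p' q' = hq refl refl (ten-cong p q e e')

  ≅ten' : ∀ {A B C D A' B' C' D'} {f : Hom A B} {g : Hom C D} {f' : Hom A' B'} {g' : Hom C' D'} →
          (r : f ≅ f') → (s : g ≅ g') → .(p : Disjoint A C) .(q : Disjoint B D) →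
          ten f g p q ≅ ten f' g' (Disjoint-subst (_≅_.eA r) (_≅_.eA s) p)
                                  (Disjoint-subst (_≅_.eB r) (_≅_.eB s) q)
  ≅ten' (hq refl refl e) (hq refl refl e') p q = hq refl refl (ten-cong p q e e')

  idˡ≅ : ∀ {A B} (f : Hom A B) → (id ⨾ f) ≅ f
  idˡ≅ f = ≈→≅ (idˡ f)

  idʳ≅ : ∀ {A B} (f : Hom A B) → (f ⨾ id) ≅ f
  idʳ≅ f = ≈→≅ (idʳ f)

  ten-comm≅ : ∀ {A B C D} (f : Hom A B) (g : Hom C D) .(p : Disjoint A C) .(q : Disjoint B D) →
              ten f g p q ≅ ten g f (Disjoint-sym p) (Disjoint-sym q)
  ten-comm≅ {A} {B} {C} {D} f g p q =
    hq (∪-comm A C) (∪-comm B D)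
       (ten-comm f g p q (Disjoint-sym p) (Disjoint-sym q) (∪-comm A C) (∪-comm B D))

  ten-assoc≅ : ∀ {A B C D E F} (f : Hom A B) (g : Hom C D) (h : Hom E F)
               .(p : Disjoint A C) .(q : Disjoint B D)
               .(p' : Disjoint (A ∪ C) E) .(q' : Disjoint (B ∪ D) F) →
               ten (ten f g p q) h p' q' ≅
               ten f (ten g h (Disjoint-∪ˡ₂ p') (Disjoint-∪ˡ₂ q'))
                     (Disjoint-∪ʳ p (Disjoint-∪ˡ₁ p')) (Disjoint-∪ʳ q (Disjoint-∪ˡ₁ q'))
  ten-assoc≅ {A} {B} {C} {D} {E} {F} f g h p q p' q' =
    hq (∪-assoc A C E) (∪-assoc B D F)
       (ten-assoc f g h p q p' q' (Disjoint-∪ˡ₂ p') (Disjoint-∪ˡ₂ q')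
                  (Disjoint-∪ʳ p (Disjoint-∪ˡ₁ p')) (Disjoint-∪ʳ q (Disjoint-∪ˡ₁ q'))
                  (∪-assoc A C E) (∪-assoc B D F))

  ten-unitʳ≅ : ∀ {A B} (f : Hom A B) .(p : Disjoint A ∅) .(q : Disjoint B ∅) →
               ten f (id {∅}) p q ≅ f
  ten-unitʳ≅ {A} {B} f p q =
    hq (∪-identityʳ A) (∪-identityʳ B) (ten-unitʳ f p q (∪-identityʳ A) (∪-identityʳ B))

  ten-unitˡ≅ : ∀ {A B} (f : Hom A B) .(p : Disjoint ∅ A) .(q : Disjoint ∅ B) →
               ten (id {∅}) f p q ≅ f
  ten-unitˡ≅ f p q = ≈→≅ (ten-unitˡ f p q)

  interchange≅ : ∀ {A B C A' B' C'} (f : Hom A B) (g : Hom B C) (f' : Hom A' B') (g' : Hom B' C')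
                 .(p : Disjoint A A') .(q : Disjoint B B') .(r : Disjoint C C') →
                 ten (f ⨾ g) (f' ⨾ g') p r ≅ (ten f f' p q ⨾ ten g g' q r)
  interchange≅ f g f' g' p q r = ≈→≅ (interchange f g f' g' p q r)

  bij-ext≅ : ∀ π ρ A → (∀ x → x ∈ₛ A → app π x ≡ app ρ x) → bij π A ≅ bij ρ A
  bij-ext≅ π ρ A h = hq refl (image-ext π ρ A h) (bij-ext π ρ A h (image-ext π ρ A h))

  bij-id≅ : ∀ A → bij idπ A ≅ id {A}
  bij-id≅ A = hq refl (image-idπ A) (bij-id A (image-idπ A))

  bij-comp≅ : ∀ π ρ A → (bij π A ⨾ bij ρ (π [ A ])) ≅ bij (ρ ∘π π) A
  bij-comp≅ π ρ A = hq refl (image-∘π π ρ A) (bij-comp π ρ A (image-∘π π ρ A))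

  bij-ten≅ : ∀ π A C .(p : Disjoint A C) .(q : Disjoint (π [ A ]) (π [ C ])) →
             ten (bij π A) (bij π C) p q ≅ bij π (A ∪ C)
  bij-ten≅ π A C p q = hq refl (image-∪ π A C) (bij-ten π A C p q (image-∪ π A C))

  bij-cast≅ : ∀ π {A A'} → A ≡ A' → bij π A ≅ bij π A'
  bij-cast≅ π refl = ≅refl

  bij-ext-map : ∀ π ρ xs → mapL (app π) xs ≡ mapL (app ρ) xs → bij π (fromList xs) ≅ bij ρ (fromList xs)
  bij-ext-map π ρ xs e = bij-ext≅ π ρ (fromList xs) (λ z p → pointwise xs e (∈-fromList z xs p))
    where
    pointwise : ∀ xs → mapL (app π) xs ≡ mapL (app ρ) xs → ∀ {z} → z ∈ xs → app π z ≡ app ρ z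
    pointwise (x ∷ xs) e (here refl) = proj₁ (∷-injective e)
    pointwise (x ∷ xs) e (there p)   = pointwise xs (proj₂ (∷-injective e)) p

  ⨾-bij≅bij : ∀ π ρ {A B X Y Z} {f : Hom X Y} {g : Hom Y Z} →
              f ≅ bij π A → g ≅ bij ρ B → (f ⨾ g) ≅ bij (ρ ∘π π) A
  ⨾-bij≅bij π ρ {A} (hq refl refl e) (hq refl refl e') =
    ≅trans (≅⨾ (hq refl refl e) (hq refl refl e')) (bij-comp≅ π ρ A)

  δ≅bij : ∀ π x y → app π x ≡ y → δ x y ≅ bij π ⟦ x ⟧
  δ≅bij π x y e = ≅trans (cast≅ refl (τ-sing x y) (bij (τ x y) ⟦ x ⟧)) (bij-ext≅ (τ x y) π ⟦ x ⟧ agree)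
    where
    agree : ∀ z → z ∈ₛ ⟦ x ⟧ → swapN x y z ≡ app π z
    agree z p with ∈-sing z x p
    ... | refl = trans (swapN-a z y) (sym e)

  id∅≅bij : ∀ π → id {∅} ≅ bij π ∅
  id∅≅bij π = ≅sym (≅trans (bij-ext≅ π idπ ∅ (λ x ())) (bij-id≅ ∅))

  brak≅bij : ∀ π a b .(ua : Unique a) .(ub : Unique b) (e : length a ≡ length b) →
             mapL (app π) a ≡ b → [ a ∣ b ]⟨ ua , ub , e ⟩ ≅ bij π (fromList a)
  brak≅bij π []      []      ua ub e h = id∅≅bij π
  brak≅bij π (x ∷ a) (y ∷ b) ua ub e h =
    ≅trans (≅ten (δ≅bij π x y (proj₁ (∷-injective h)))
                 (brak≅bij π a b (unique-tail ua) (unique-tail ub) (suc-injective e) (proj₂ (∷-injective h)))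
                 (unique-disj x a ua) (unique-disj y b ub)
                 (unique-disj x a ua) (image-Disjoint π ⟦ x ⟧ (fromList a) (unique-disj x a ua)))
           (bij-ten≅ π ⟦ x ⟧ (fromList a) (unique-disj x a ua)
                     (image-Disjoint π ⟦ x ⟧ (fromList a) (unique-disj x a ua)))

  brak-⨾ : ∀ a b c .(ua : Unique a) .(ub : Unique b) .(uc : Unique c) e₁ e₂ e₃ →
           ([ a ∣ b ]⟨ ua , ub , e₁ ⟩ ⨾ [ b ∣ c ]⟨ ub , uc , e₂ ⟩) ≈ [ a ∣ c ]⟨ ua , uc , e₃ ⟩
  brak-⨾ a b c ua ub uc e₁ e₂ e₃ with findRenaming a b ua ub e₁ | findRenaming b c ub uc e₂
  ... | π , πa≡b | ρ , ρb≡c =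
    ≅→≈ (≅trans (⨾-bij≅bij π ρ (brak≅bij π a b ua ub e₁ πa≡b) (brak≅bij ρ b c ub uc e₂ ρb≡c))
                (≅sym (brak≅bij (ρ ∘π π) a c ua uc e₃ ρπa≡c)))
    where ρπa≡c = trans (map-∘ a) (trans (cong (mapL (app ρ)) πa≡b) ρb≡c)

  brak-id : ∀ a .(ua : Unique a) e → [ a ∣ a ]⟨ ua , ua , e ⟩ ≈ id
  brak-id a ua e = ≅→≈ (≅trans (brak≅bij idπ a a ua ua e (map-id a)) (bij-id≅ (fromList a)))

  brak-irrelevant : ∀ a b .(ua : Unique a) .(ub : Unique b) .(ua' : Unique a) .(ub' : Unique b) e e' →
                    [ a ∣ b ]⟨ ua , ub , e ⟩ ≡ [ a ∣ b ]⟨ ua' , ub' , e' ⟩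
  brak-irrelevant a b ua ub ua' ub' e e' = cong (λ z → [ a ∣ b ]⟨ ua , ub , z ⟩) (uip e e')
    where
    uip : ∀ {x y : ℕ} (p q : x ≡ y) → p ≡ q
    uip refl refl = refl

  brak-≡ : ∀ x x' y y' .(ux : Unique x) .(ux' : Unique x') .(uy : Unique y) .(uy' : Unique y') e e' →
           x ≡ x' → y ≡ y' → [ x ∣ y ]⟨ ux , uy , e ⟩ ≅ [ x' ∣ y' ]⟨ ux' , uy' , e' ⟩
  brak-≡ x x' y y' ux ux' uy uy' e e' refl refl = ≡→≅ (brak-irrelevant x y ux uy ux' uy' e e')

  brak-++ : ∀ x x₁ x₂ b b₁ b₂ .(ux : Unique x) .(ub : Unique b) (e : length x ≡ length b)
            .(ux₁ : Unique x₁) .(ub₁ : Unique b₁) (e₁ : length x₁ ≡ length b₁)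
            .(ux₂ : Unique x₂) .(ub₂ : Unique b₂) (e₂ : length x₂ ≡ length b₂)
            .(p : Disjoint (fromList x₁) (fromList x₂)) .(q : Disjoint (fromList b₁) (fromList b₂)) →
            x ≡ x₁ ++ x₂ → b ≡ b₁ ++ b₂ →
            [ x ∣ b ]⟨ ux , ub , e ⟩
              ≅ ten [ x₁ ∣ b₁ ]⟨ ux₁ , ub₁ , e₁ ⟩ [ x₂ ∣ b₂ ]⟨ ux₂ , ub₂ , e₂ ⟩ p q
  brak-++ x x₁ x₂ b b₁ b₂ ux ub e ux₁ ub₁ e₁ ux₂ ub₂ e₂ p q refl refl
    with findRenaming (x₁ ++ x₂) (b₁ ++ b₂) ux ub e
  ... | π , h with NameVectors.++-split (mapL (app π) x₁) b₁ (mapL (app π) x₂) b₂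
                     (trans (length-map (app π) x₁) e₁) (trans (sym (map-++ (app π) x₁ x₂)) h)
  ... | h₁ , h₂ =
    ≅trans (brak≅bij π (x₁ ++ x₂) (b₁ ++ b₂) ux ub e h)
    (≅trans (bij-cast≅ π (fromList-++ x₁ x₂))
    (≅sym (≅trans (≅ten' (brak≅bij π x₁ b₁ ux₁ ub₁ e₁ h₁) (brak≅bij π x₂ b₂ ux₂ ub₂ e₂ h₂) p q)
                  (bij-ten≅ π (fromList x₁) (fromList x₂) p (image-Disjoint π _ _ p)))))

module Interpretation (T : NomPROP) where

  open FiniteSets
  open NameVectors
  open NomPROPProperties T
  open import Data.Nat using (_+_)
  open import Data.List using ([]; _++_) renaming (map to mapL)
  import Data.List as L
  import Data.List.Properties as L
  open import Data.List.Properties using (++-identityʳ; ++-assoc)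
  open import Data.Vec using (Vec; []; toList; lookup; take; drop)
    renaming (_++_ to _++ᵥ_; map to mapV)
  import Data.Vec as Vec
  open import Data.Vec.Properties
    using (length-toList; toList-++; toList-map; toList-cast; toList∘fromList; map-∘; take-map; drop-map)
  import Data.Fin.Permutation as Perm
  open import Data.Fin.Permutation using (Permutation; _⟨$⟩ʳ_; _∘ₚ_)
  open import Relation.Binary.PropositionalEquality
    using (refl; trans; cong; subst)
  open ORDdef T using (OTm; gen; oid; _o⨾_; _o⊕_; operm; _∼_)
  module O = ORDdef T

  private variable
    m n k l : ℕ

  UniqueV : Vec ℕ n → Set
  UniqueV v = Unique (toList v)

  brakV : (c d : Vec ℕ n) → .(UniqueV c) → .(UniqueV d) → Hom ⟪ c ⟫ ⟪ d ⟫
  brakV c d uc ud = [ toList c ∣ toList d ]⟨ uc , ud , trans (length-toList c) (sym (length-toList d)) ⟩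

  -- interp g c d is the value in T of the generator [c⟩g⟨d] of NOM(ORD(T)).
  interp : OTm m n → (c : Vec ℕ m) → .(UniqueV c) → (d : Vec ℕ n) → .(UniqueV d) → Hom ⟪ c ⟫ ⟪ d ⟫
  interp (gen a b ua ub f) c uc d ud =
    [ toList c ∣ a ]⟨ uc , ua , length-toList c ⟩ ⨾ (f ⨾ [ b ∣ toList d ]⟨ ub , ud , sym (length-toList d) ⟩)
  interp oid c uc d ud = brakV c d uc ud
  interp (_o⨾_ {n = n} g h) c uc d ud = interp g c uc (downFrom n) (unique-downFrom n) ⨾ interp h (downFrom n) (unique-downFrom n) d ud
  interp (_o⊕_ {m} {n} g h) c uc d ud =
    cast₂ Hom (sym (⟪⟫-take-drop m c)) (sym (⟪⟫-take-drop n d))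
      (ten (interp g (take m c) (unique-take m c uc) (take n d) (unique-take n d ud))
           (interp h (drop m c) (unique-drop m c uc) (drop n d) (unique-drop n d ud))
           (Disjoint-take-drop m c uc) (Disjoint-take-drop n d ud))
  interp (operm π) c uc d ud = cast₂ Hom refl (⟪⟫-permute π d) (brakV c (permute π d) uc (unique-permute π d ud))

  interp-toList : ∀ (g : OTm m n) c c' d d' .(uc : UniqueV c) .(uc' : UniqueV c') .(ud : UniqueV d) .(ud' : UniqueV d') →
         toList c ≡ toList c' → toList d ≡ toList d' → interp g c uc d ud ≅ interp g c' uc' d' ud'
  interp-toList g c c' d d' uc uc' ud ud' p q with toList-injective c c' p | toList-injective d d' q
  ... | refl | refl = ≅refl

  interp-cast₂ : ∀ {m' n'} (p : m ≡ m') (q : n ≡ n') (g : OTm m n) c c' d d'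
            .(uc : UniqueV c) .(uc' : UniqueV c') .(ud : UniqueV d) .(ud' : UniqueV d') →
            toList c ≡ toList c' → toList d ≡ toList d' →
            interp g c uc d ud ≅ interp (cast₂ OTm p q g) c' uc' d' ud'
  interp-cast₂ refl refl g c c' d d' uc uc' ud ud' e e' = interp-toList g c c' d d' uc uc' ud ud' e e'

  interp-⊕ : ∀ (g : OTm m n) (h : OTm k l) c d .(uc : UniqueV c) .(ud : UniqueV d) →
        interp (g o⊕ h) c uc d ud ≅
        ten (interp g (take m c) (unique-take m c uc) (take n d) (unique-take n d ud))
            (interp h (drop m c) (unique-drop m c uc) (drop n d) (unique-drop n d ud))
            (Disjoint-take-drop m c uc) (Disjoint-take-drop n d ud)
  interp-⊕ {m} {n} g h c d uc ud = cast≅ (sym (⟪⟫-take-drop m c)) (sym (⟪⟫-take-drop n d)) _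

  interp-perm : ∀ (π : Permutation m n) c d .(uc : UniqueV c) .(ud : UniqueV d) →
           interp (operm π) c uc d ud ≅ brakV c (permute π d) uc (unique-permute π d ud)
  interp-perm π c d uc ud = cast≅ refl (⟪⟫-permute π d) _

  brakV-cong : ∀ (c c' d d' : Vec ℕ n) .(uc : UniqueV c) .(uc' : UniqueV c') .(ud : UniqueV d) .(ud' : UniqueV d') →
            c ≡ c' → d ≡ d' → brakV c d uc ud ≅ brakV c' d' uc' ud'
  brakV-cong c c' d d' uc uc' ud ud' refl refl = ≅refl

  brakV≅bij : ∀ π (c d : Vec ℕ n) .(uc : UniqueV c) .(ud : UniqueV d) → mapV (app π) c ≡ d →
        brakV c d uc ud ≅ bij π ⟪ c ⟫
  brakV≅bij π c d uc ud e = brak≅bij π (toList c) (toList d) uc ud _ (mapV-toList π c d e)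

  findRenamingV : ∀ (c d : Vec ℕ n) → .(UniqueV c) → .(UniqueV d) → Σ Perm𝒩 λ π → mapV (app π) c ≡ d
  findRenamingV c d uc ud with findRenaming (toList c) (toList d) uc ud (trans (length-toList c) (sym (length-toList d)))
  ... | π , e = π , toList-mapV π c d e

  ten-brakV≅bij : ∀ π (v₁ w₁ : Vec ℕ m) (v₂ w₂ : Vec ℕ k)
                  .(u₁ : UniqueV v₁) .(u₁' : UniqueV w₁) .(u₂ : UniqueV v₂) .(u₂' : UniqueV w₂)
           .(p : Disjoint ⟪ v₁ ⟫ ⟪ v₂ ⟫) .(q : Disjoint ⟪ w₁ ⟫ ⟪ w₂ ⟫) →
           mapV (app π) v₁ ≡ w₁ → mapV (app π) v₂ ≡ w₂ →
           ten (brakV v₁ w₁ u₁ u₁') (brakV v₂ w₂ u₂ u₂') p q ≅ bij π (⟪ v₁ ⟫ ∪ ⟪ v₂ ⟫)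
  ten-brakV≅bij π v₁ w₁ v₂ w₂ u₁ u₁' u₂ u₂' p q e₁ e₂ =
    ≅trans (≅ten (brakV≅bij π v₁ w₁ u₁ u₁' e₁) (brakV≅bij π v₂ w₂ u₂ u₂' e₂) p q p (image-Disjoint π _ _ p))
           (bij-ten≅ π ⟪ v₁ ⟫ ⟪ v₂ ⟫ p (image-Disjoint π _ _ p))

  brakV-split : ∀ m (c c' : Vec ℕ (m + k)) .(uc : UniqueV c) .(uc' : UniqueV c') →
            brakV c c' uc uc' ≅ ten (brakV (take m c) (take m c') (unique-take m c uc) (unique-take m c' uc'))
                                 (brakV (drop m c) (drop m c') (unique-drop m c uc) (unique-drop m c' uc'))
                                 (Disjoint-take-drop m c uc) (Disjoint-take-drop m c' uc')
  brakV-split m c c' uc uc' with findRenamingV c c' uc uc'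
  ... | π , e = ≅trans (brakV≅bij π c c' uc uc' e)
               (≅trans (bij-cast≅ π (⟪⟫-take-drop m c))
               (≅sym (ten-brakV≅bij π (take m c) (take m c') (drop m c) (drop m c') _ _ _ _ _ _
                        (trans (sym (take-map (app π) m c)) (cong (take m) e))
                        (trans (sym (drop-map (app π) m c)) (cong (drop m) e)))))

  brakV-⨾ : ∀ (c d e : Vec ℕ n) .(uc : UniqueV c) .(ud : UniqueV d) .(ue : UniqueV e) →
             (brakV c d uc ud ⨾ brakV d e ud ue) ≈ brakV c e uc ue
  brakV-⨾ c d e uc ud ue = brak-⨾ (toList c) (toList d) (toList e) uc ud ue _ _ _

  brakV-permute : ∀ (π : Permutation m n) d' d .(ud' : UniqueV d') .(ud : UniqueV d) →
          brakV d' d ud' ud ≅ brakV (permute π d') (permute π d) (unique-permute π d' ud') (unique-permute π d ud)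
  brakV-permute π d' d ud' ud with findRenamingV d' d ud' ud
  ... | σ , e = ≅trans (brakV≅bij σ d' d ud' ud e)
                (≅trans (bij-cast≅ σ (sym (⟪⟫-permute π d')))
                (≅sym (brakV≅bij σ (permute π d') (permute π d) _ _ (trans (map-permute (app σ) π d') (cong (permute π) e)))))

  brakV-⨾-interp : ∀ (g : OTm m n) c c' d .(uc : UniqueV c) .(uc' : UniqueV c') .(ud : UniqueV d) →
       (brakV c c' uc uc' ⨾ interp g c' uc' d ud) ≈ interp g c uc d ud
  brakV-⨾-interp (gen a b ua ub f) c c' d uc uc' ud =
    ≈trans (≈sym (assoc _ _ _)) (⨾-cong (brak-⨾ (toList c) (toList c') a uc uc' ua _ _ _) ≈refl)
  brakV-⨾-interp oid c c' d uc uc' ud = brakV-⨾ c c' d uc uc' ud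
  brakV-⨾-interp (g o⨾ h) c c' d uc uc' ud = ≈trans (≈sym (assoc _ _ _)) (⨾-cong (brakV-⨾-interp g c c' _ uc uc' _) ≈refl)
  brakV-⨾-interp (_o⊕_ {m} {n} g h) c c' d uc uc' ud =
    ≅→≈ (≅trans (≅⨾ (brakV-split m c c' uc uc') (interp-⊕ g h c' d uc' ud))
        (≅trans (≅sym (interchange≅ _ _ _ _ _ _ _))
        (≅trans (≅ten (≈→≅ (brakV-⨾-interp g _ _ _ _ _ _)) (≈→≅ (brakV-⨾-interp h _ _ _ _ _ _)) _ _ _ _)
                (≅sym (interp-⊕ g h c d uc ud)))))
  brakV-⨾-interp (operm π) c c' d uc uc' ud =
    ≅→≈ (≅trans (≅⨾ (≅refl {f = brakV c c' uc uc'}) (interp-perm π c' d uc' ud))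
        (≅trans (≈→≅ (brakV-⨾ c c' (permute π d) uc uc' (unique-permute π d ud))) (≅sym (interp-perm π c d uc ud))))

  interp-⨾-brakV : ∀ (g : OTm m n) c d' d .(uc : UniqueV c) .(ud' : UniqueV d') .(ud : UniqueV d) →
       (interp g c uc d' ud' ⨾ brakV d' d ud' ud) ≈ interp g c uc d ud
  interp-⨾-brakV (gen a b ua ub f) c d' d uc ud' ud =
    ≈trans (assoc _ _ _) (⨾-cong ≈refl (≈trans (assoc _ _ _)
      (⨾-cong ≈refl (brak-⨾ b (toList d') (toList d) ub ud' ud _ _ _))))
  interp-⨾-brakV oid c d' d uc ud' ud = brakV-⨾ c d' d uc ud' ud
  interp-⨾-brakV (g o⨾ h) c d' d uc ud' ud = ≈trans (assoc _ _ _) (⨾-cong ≈refl (interp-⨾-brakV h _ d' d _ ud' ud))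
  interp-⨾-brakV (_o⊕_ {m} {n} g h) c d' d uc ud' ud =
    ≅→≈ (≅trans (≅⨾ (interp-⊕ g h c d' uc ud') (brakV-split n d' d ud' ud))
        (≅trans (≅sym (interchange≅ _ _ _ _ _ _ _))
        (≅trans (≅ten (≈→≅ (interp-⨾-brakV g _ _ _ _ _ _)) (≈→≅ (interp-⨾-brakV h _ _ _ _ _ _)) _ _ _ _)
                (≅sym (interp-⊕ g h c d uc ud)))))
  interp-⨾-brakV (operm π) c d' d uc ud' ud =
    ≅→≈ (≅trans (≅⨾ (interp-perm π c d' uc ud') (brakV-permute π d' d ud' ud))
        (≅trans (≈→≅ (brakV-⨾ c (permute π d') (permute π d) uc _ _)) (≅sym (interp-perm π c d uc ud))))

  interp-⨾-boundary : ∀ (g : OTm m n) (h : OTm n k) c v v' d .(uc : UniqueV c) .(uv : UniqueV v) .(uv' : UniqueV v') .(ud : UniqueV d) →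
        (interp g c uc v uv ⨾ interp h v uv d ud) ≈ (interp g c uc v' uv' ⨾ interp h v' uv' d ud)
  interp-⨾-boundary g h c v v' d uc uv uv' ud =
    ≈trans (⨾-cong (≈sym (interp-⨾-brakV g c v' v uc uv' uv)) ≈refl)
    (≈trans (assoc _ _ _) (⨾-cong ≈refl (brakV-⨾-interp h v' v d uv' uv ud)))

  unique-cast : ∀ {m m'} .(p : m ≡ m') (c : Vec ℕ m) → .(UniqueV c) → UniqueV (Vec.cast p c)
  unique-cast p c u = subst Unique (sym (toList-cast p c)) (recomputeUnique u)

  interp-cast : ∀ {m' n'} (p : m ≡ m') (q : n ≡ n') (g : OTm m n) (c : Vec ℕ m') (d : Vec ℕ n')
            .(uc : UniqueV c) .(ud : UniqueV d) →
            interp (cast₂ OTm p q g) c uc d ud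
              ≅ interp g (Vec.cast (sym p) c) (unique-cast (sym p) c uc) (Vec.cast (sym q) d) (unique-cast (sym q) d ud)
  interp-cast p q g c d uc ud =
    ≅sym (interp-cast₂ p q g (Vec.cast (sym p) c) c (Vec.cast (sym q) d) d _ _ _ _
            (toList-cast (sym p) c) (toList-cast (sym q) d))

  interp-castˡ : ∀ {m'} (p : m ≡ m') (g : OTm m n) (c : Vec ℕ m') (d : Vec ℕ n)
            .(uc : UniqueV c) .(ud : UniqueV d) →
            interp (cast₂ OTm p refl g) c uc d ud ≅ interp g (Vec.cast (sym p) c) (unique-cast (sym p) c uc) d ud
  interp-castˡ p g c d uc ud =
    ≅sym (interp-cast₂ p refl g (Vec.cast (sym p) c) c d d _ _ _ _ (toList-cast (sym p) c) refl)

  interp-castʳ : ∀ {m n n'} (q : n ≡ n') (g : OTm m n) (c : Vec ℕ m) (d : Vec ℕ n')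
            .(uc : UniqueV c) .(ud : UniqueV d) →
            interp (cast₂ OTm refl q g) c uc d ud ≅ interp g c uc (Vec.cast (sym q) d) (unique-cast (sym q) d ud)
  interp-castʳ q g c d uc ud =
    ≅sym (interp-cast₂ refl q g c c (Vec.cast (sym q) d) d _ _ _ _ refl (toList-cast (sym q) d))

  interp-⊕-id : ∀ m k (c d : Vec ℕ (m + k)) .(uc : UniqueV c) .(ud : UniqueV d) →
           interp (oid {m} o⊕ oid {k}) c uc d ud ≈ interp oid c uc d ud
  interp-⊕-id m k c d uc ud = ≅→≈ (≅trans (interp-⊕ (oid {m}) (oid {k}) c d uc ud) (≅sym (brakV-split m c d uc ud)))

  interp-interchange : ∀ {m n o k l p} (f : OTm m n) (g : OTm n o) (f' : OTm k l) (g' : OTm l p) c d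
                  .(uc : UniqueV c) .(ud : UniqueV d) →
                  interp ((f o⨾ g) o⊕ (f' o⨾ g')) c uc d ud ≈ interp ((f o⊕ f') o⨾ (g o⊕ g')) c uc d ud
  interp-interchange {m} {n} {o} {k} {l} {p} f g f' g' c d uc ud =
    ≅→≈ (≅trans (interp-⊕ (f o⨾ g) (f' o⨾ g') c d uc ud)
        (≅trans (≅ten (≈→≅ left) (≈→≅ right) _ _ _ _)
        (≅trans (interchange≅ _ _ _ _ _ (Disjoint-take-drop n w uw) _)
                (≅⨾ (≅sym (interp-⊕ f f' c w uc uw)) (≅sym (interp-⊕ g g' w d uw ud))))))
    where
    w = downFrom (n + l)
    uw = unique-downFrom (n + l)
    left = interp-⨾-boundary f g (take m c) (downFrom n) (take n w) (take o d)
                             _ (unique-downFrom n) (unique-take n w uw) _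
    right = interp-⨾-boundary f' g' (drop m c) (downFrom l) (drop n w) (drop o d)
                              _ (unique-downFrom l) (unique-drop n w uw) _

  interp-unitˡ : ∀ (f : OTm m n) c d .(uc : UniqueV c) .(ud : UniqueV d) →
            interp (oid {0} o⊕ f) c uc d ud ≈ interp f c uc d ud
  interp-unitˡ f c d uc ud = ≅→≈ (≅trans (interp-⊕ oid f c d uc ud) (ten-unitˡ≅ _ _ _))

  brakV-empty : ∀ (v w : Vec ℕ 0) .(uv : UniqueV v) .(uw : UniqueV w) → brakV v w uv uw ≅ id {∅}
  brakV-empty [] [] uv uw = ≅refl

  interp-unitʳ : ∀ (f : OTm m n) (e₁ : m + 0 ≡ m) (e₂ : n + 0 ≡ n) c d .(uc : UniqueV c) .(ud : UniqueV d) →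
            interp (cast₂ OTm e₁ e₂ (f o⊕ oid {0})) c uc d ud ≈ interp f c uc d ud
  interp-unitʳ {m} {n} f e₁ e₂ c d uc ud =
    ≅→≈ (≅trans (≅sym (interp-cast₂ e₁ e₂ (f o⊕ oid) c' c d' d uc' uc ud' ud tlc tld))
        (≅trans (interp-⊕ f oid c' d' uc' ud')
        (≅trans (≅ten (interp-toList f (take m c') c (take n d') d _ uc _ ud (cong toList (take-++ c [])) (cong toList (take-++ d [])))
                      (brakV-empty (drop m c') (drop n d') _ _) _ _ (λ _ _ ()) (λ _ _ ()))
                (ten-unitʳ≅ _ (λ _ _ ()) (λ _ _ ())))))
    where
    c' = c ++ᵥ []
    d' = d ++ᵥ []
    tlc : toList c' ≡ toList c
    tlc = trans (toList-++ c []) (++-identityʳ (toList c))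
    tld : toList d' ≡ toList d
    tld = trans (toList-++ d []) (++-identityʳ (toList d))
    uc' : UniqueV c'
    uc' = subst Unique (sym tlc) (recomputeUnique uc)
    ud' : UniqueV d'
    ud' = subst Unique (sym tld) (recomputeUnique ud)

  interp-⊕-assoc : ∀ {m n k l o p} (f : OTm m n) (g : OTm k l) (h : OTm o p)
              (e₁ : (m + k) + o ≡ m + (k + o)) (e₂ : (n + l) + p ≡ n + (l + p)) c d
              .(uc : UniqueV c) .(ud : UniqueV d) →
              interp (cast₂ OTm e₁ e₂ ((f o⊕ g) o⊕ h)) c uc d ud ≈ interp (f o⊕ (g o⊕ h)) c uc d ud
  interp-⊕-assoc {m} {n} {k} {l} {o} {p} f g h e₁ e₂ c d uc ud =
    ≅→≈ (≅trans (≅sym (interp-cast₂ e₁ e₂ ((f o⊕ g) o⊕ h) c' c d' d uc' uc ud' ud tlc tld))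
        (≅trans (interp-⊕ (f o⊕ g) h c' d' uc' ud')
        (≅trans (≅ten' split-fg ≅refl (Disjoint-take-drop (m + k) c' uc') (Disjoint-take-drop (n + l) d' ud'))
        (≅trans (≅ten' (≅ten' on-f on-g (Disjoint-take-drop m (take (m + k) c') (unique-take (m + k) c' uc'))
                                        (Disjoint-take-drop n (take (n + l) d') (unique-take (n + l) d' ud')))
                       on-h
                       (Disjoint-subst (⟪⟫-take-drop m (take (m + k) c')) refl (Disjoint-take-drop (m + k) c' uc'))
                       (Disjoint-subst (⟪⟫-take-drop n (take (n + l) d')) refl (Disjoint-take-drop (n + l) d' ud')))
        (≅trans (ten-assoc≅ _ _ _ _ _ _ _)
        (≅trans (≅ten' ≅refl (≅sym (interp-⊕ g h (drop m c) (drop n d) (unique-drop m c uc) (unique-drop n d ud)))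
                   (Disjoint-subst refl (⟪⟫-take-drop k (drop m c)) (Disjoint-take-drop m c uc))
                   (Disjoint-subst refl (⟪⟫-take-drop l (drop n d)) (Disjoint-take-drop n d ud)))
                (≅sym (interp-⊕ f (g o⊕ h) c d uc ud))))))))
    where
    c' = (take m c ++ᵥ take k (drop m c)) ++ᵥ drop k (drop m c)
    d' = (take n d ++ᵥ take l (drop n d)) ++ᵥ drop l (drop n d)
    toList-regroup : ∀ a b {r} (v : Vec ℕ (a + (b + r))) →
          toList ((take a v ++ᵥ take b (drop a v)) ++ᵥ drop b (drop a v)) ≡ toList v
    toList-regroup a b v = trans (toList-++ (take a v ++ᵥ take b (drop a v)) _)
                (trans (cong (_++ toList (drop b (drop a v))) (toList-++ (take a v) _))
                (trans (++-assoc (toList (take a v)) _ _)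
                (trans (cong (toList (take a v) ++_) (toList-take++drop b (drop a v))) (toList-take++drop a v))))
    tlc = toList-regroup m k c
    tld = toList-regroup n l d
    uc' : UniqueV c'
    uc' = subst Unique (sym tlc) (recomputeUnique uc)
    ud' : UniqueV d'
    ud' = subst Unique (sym tld) (recomputeUnique ud)
    t1c = cong toList (trans (cong (take m) (take-++ (take m c ++ᵥ take k (drop m c)) (drop k (drop m c)))) (take-++ (take m c) _))
    t1d = cong toList (trans (cong (take n) (take-++ (take n d ++ᵥ take l (drop n d)) (drop l (drop n d)))) (take-++ (take n d) _))
    t2c = cong toList (trans (cong (drop m) (take-++ (take m c ++ᵥ take k (drop m c)) (drop k (drop m c)))) (drop-++ (take m c) _))
    t2d = cong toList (trans (cong (drop n) (take-++ (take n d ++ᵥ take l (drop n d)) (drop l (drop n d)))) (drop-++ (take n d) _))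
    t3c = cong toList (drop-++ (take m c ++ᵥ take k (drop m c)) (drop k (drop m c)))
    t3d = cong toList (drop-++ (take n d ++ᵥ take l (drop n d)) (drop l (drop n d)))
    split-fg = interp-⊕ f g (take (m + k) c') (take (n + l) d')
                        (unique-take (m + k) c' uc') (unique-take (n + l) d' ud')
    on-f = interp-toList f _ (take m c) _ (take n d) _ (unique-take m c uc) _ (unique-take n d ud) t1c t1d
    on-g = interp-toList g _ (take k (drop m c)) _ (take l (drop n d))
                         _ (unique-take k (drop m c) (unique-drop m c uc))
                         _ (unique-take l (drop n d) (unique-drop n d ud)) t2c t2d
    on-h = interp-toList h _ (drop k (drop m c)) _ (drop l (drop n d))
                         _ (unique-drop k (drop m c) (unique-drop m c uc))
                         _ (unique-drop l (drop n d) (unique-drop n d ud)) t3c t3d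

  interp-perm-ext : ∀ (π ρ : Permutation m n) → (∀ i → π ⟨$⟩ʳ i ≡ ρ ⟨$⟩ʳ i) →
                    ∀ c d .(uc : UniqueV c) .(ud : UniqueV d) →
               interp (operm π) c uc d ud ≈ interp (operm ρ) c uc d ud
  interp-perm-ext π ρ h c d uc ud =
    ≅→≈ (≅trans (interp-perm π c d uc ud)
        (≅trans (brakV-cong c c (permute π d) (permute ρ d) uc uc _ (unique-permute ρ d ud) refl
                   (lookup-ext _ _ (λ i → trans (lookup-permute π d i) (trans (cong (lookup d) (h i)) (sym (lookup-permute ρ d i))))))
                (≅sym (interp-perm ρ c d uc ud))))

  interp-perm-id : ∀ c d .(uc : UniqueV {n} c) .(ud : UniqueV d) → interp (operm Perm.id) c uc d ud ≈ interp oid c uc d ud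
  interp-perm-id c d uc ud =
    ≅→≈ (≅trans (interp-perm Perm.id c d uc ud) (brakV-cong c c (permute Perm.id d) d uc uc _ ud refl (permute-id d)))

  interp-perm-comp : ∀ {o} (π : Permutation m n) (ρ : Permutation n o) c d .(uc : UniqueV c) .(ud : UniqueV d) →
                interp (operm (π ∘ₚ ρ)) c uc d ud ≈ interp (operm π o⨾ operm ρ) c uc d ud
  interp-perm-comp {n = n} π ρ c d uc ud with findRenamingV c (permute π (downFrom n)) uc
      (unique-permute π (downFrom n) (unique-downFrom n)) | findRenamingV (downFrom n) (permute ρ d)
      (unique-downFrom n) (unique-permute ρ d ud)
  ... | σ₁ , e₁ | σ₂ , e₂ =
    ≅→≈ (≅trans (interp-perm (π ∘ₚ ρ) c d uc ud)
        (≅trans (brakV≅bij (σ₂ ∘π σ₁) c (permute (π ∘ₚ ρ) d) uc (unique-permute (π ∘ₚ ρ) d ud) eq)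
                (≅sym (⨾-bij≅bij σ₁ σ₂
                  (≅trans (interp-perm π c u uc (unique-downFrom n)) (brakV≅bij σ₁ c (permute π u) uc _ e₁))
                  (≅trans (interp-perm ρ u d (unique-downFrom n) ud) (brakV≅bij σ₂ u (permute ρ d) (unique-downFrom n) _ e₂))))))
    where
    u = downFrom n
    eq : mapV (app (σ₂ ∘π σ₁)) c ≡ permute (π ∘ₚ ρ) d
    eq = trans (map-∘ (app σ₂) (app σ₁) c) (trans (cong (mapV (app σ₂)) e₁)
         (trans (map-permute (app σ₂) π u) (trans (cong (permute π) e₂) (permute-∘ₚ π ρ d))))

  interp-perm-⊕ : ∀ {k l} (π : Permutation m n) (ρ : Permutation k l) c d .(uc : UniqueV c) .(ud : UniqueV d) →
             interp (operm (π ⊕ₚ ρ)) c uc d ud ≈ interp (operm π o⊕ operm ρ) c uc d ud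
  interp-perm-⊕ {m} {n} π ρ c d uc ud =
    ≅→≈ (≅trans (interp-perm (π ⊕ₚ ρ) c d uc ud)
        (≅trans (brakV-split m c (permute (π ⊕ₚ ρ) d) uc (unique-permute (π ⊕ₚ ρ) d ud))
        (≅trans (≅ten' (brakV-cong (take m c) (take m c) _ (permute π (take n d)) _ (unique-take m c uc) _
                  (unique-permute π _ (unique-take n d ud)) refl (take-permute-⊕ₚ π ρ d))
                       (brakV-cong (drop m c) (drop m c) _ (permute ρ (drop n d)) _ (unique-drop m c uc) _
                             (unique-permute ρ _ (unique-drop n d ud)) refl (drop-permute-⊕ₚ π ρ d))
                       (Disjoint-take-drop m c uc) (Disjoint-take-drop m (permute (π ⊕ₚ ρ) d) (unique-permute (π ⊕ₚ ρ) d ud)))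
        (≅trans (≅sym (≅ten' (interp-perm π (take m c) (take n d) (unique-take m c uc) (unique-take n d ud))
                            (interp-perm ρ (drop m c) (drop n d) (unique-drop m c uc) (unique-drop n d ud))
                            (Disjoint-take-drop m c uc) (Disjoint-take-drop n d ud)))
                (≅sym (interp-⊕ (operm π) (operm ρ) c d uc ud))))))

  interp-perm-nat : ∀ {k l} (f : OTm m n) (g : OTm k l) c d .(uc : UniqueV c) .(ud : UniqueV d) →
               interp ((f o⊕ g) o⨾ operm (swapₚ n l)) c uc d ud ≈ interp (operm (swapₚ m k) o⨾ (g o⊕ f)) c uc d ud
  interp-perm-nat {m} {n} {k} {l} f g c d uc ud =
    ≅→≈ (≅trans lhs (≅sym rhs))
    where
    u = downFrom (n + l)
    uu = unique-downFrom (n + l)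
    s = downFrom (k + m)
    us = unique-downFrom (k + m)
    c₁ = take m c
    c₂ = drop m c
    d₁ = take l d
    d₂ = drop l d
    uc₁ = unique-take m c (recomputeUnique uc)
    uc₂ = unique-drop m c (recomputeUnique uc)
    ud₁ = unique-take l d (recomputeUnique ud)
    ud₂ = unique-drop l d (recomputeUnique ud)
    target = ten (interp f c₁ uc₁ d₂ ud₂) (interp g c₂ uc₂ d₁ ud₁)
                 (Disjoint-take-drop m c uc) (Disjoint-sym (Disjoint-take-drop l d ud))
    lhs : interp ((f o⊕ g) o⨾ operm (swapₚ n l)) c uc d ud ≅ target
    lhs = ≅trans (≅⨾ (interp-⊕ f g c u uc uu)
                    (≅trans (interp-perm (swapₚ n l) u d uu ud)
                    (≅trans (brakV-split n u (permute (swapₚ n l) d) uu (unique-permute (swapₚ n l) d ud))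
                            (≅ten' (brakV-cong (take n u) (take n u) _ d₂ _ (unique-take n u uu) _ ud₂ refl (take-permute-swapₚ n l d))
                                   (brakV-cong (drop n u) (drop n u) _ d₁ _ (unique-drop n u uu) _ ud₁ refl (drop-permute-swapₚ n l d))
                                   (Disjoint-take-drop n u uu)
                                   (Disjoint-take-drop n (permute (swapₚ n l) d) (unique-permute (swapₚ n l) d ud))))))
          (≅trans (≅sym (interchange≅ _ _ _ _ (Disjoint-take-drop m c uc) (Disjoint-take-drop n u uu)
                                              (Disjoint-sym (Disjoint-take-drop l d ud))))
                  (≅ten' (≈→≅ (interp-⨾-brakV f c₁ (take n u) d₂ uc₁ (unique-take n u uu) ud₂))
                         (≈→≅ (interp-⨾-brakV g c₂ (drop n u) d₁ uc₂ (unique-drop n u uu) ud₁))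
                         (Disjoint-take-drop m c uc) (Disjoint-sym (Disjoint-take-drop l d ud))))
    rhs : interp (operm (swapₚ m k) o⨾ (g o⊕ f)) c uc d ud ≅ target
    rhs = ≅trans (≅⨾ (≅trans (interp-perm (swapₚ m k) c s uc us)
                    (≅trans (brakV-split m c (permute (swapₚ m k) s) uc (unique-permute (swapₚ m k) s us))
                            (≅ten' (brakV-cong c₁ c₁ _ (drop k s) _ uc₁ _ (unique-drop k s us) refl (take-permute-swapₚ m k s))
                                   (brakV-cong c₂ c₂ _ (take k s) _ uc₂ _ (unique-take k s us) refl (drop-permute-swapₚ m k s))
                                   (Disjoint-take-drop m c uc)
                                   (Disjoint-take-drop m (permute (swapₚ m k) s) (unique-permute (swapₚ m k) s us)))))
                   (≅trans (interp-⊕ g f s d us ud) (ten-comm≅ _ _ (Disjoint-take-drop k s us) (Disjoint-take-drop l d ud))))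
          (≅trans (≅sym (interchange≅ _ _ _ _ (Disjoint-take-drop m c uc) (Disjoint-sym (Disjoint-take-drop k s us))
                    (Disjoint-sym (Disjoint-take-drop l d ud))))
                  (≅ten' (≈→≅ (brakV-⨾-interp f c₁ (drop k s) d₂ uc₁ (unique-drop k s us) ud₂))
                         (≈→≅ (brakV-⨾-interp g c₂ (take k s) d₁ uc₂ (unique-take k s us) ud₁))
                         (Disjoint-take-drop m c uc) (Disjoint-sym (Disjoint-take-drop l d ud))))

  interp-rel-⨾ : ∀ (a b c : List ℕ) .(ua : Unique a) .(ub : Unique b) .(uc : Unique c)
            (f : Hom (fromList a) (fromList b)) (g : Hom (fromList b) (fromList c)) x y
            .(ux : UniqueV x) .(uy : UniqueV y) →
            interp (gen a c ua uc (f ⨾ g)) x ux y uy ≈ interp (gen a b ua ub f o⨾ gen b c ub uc g) x ux y uy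
  interp-rel-⨾ a b c ua ub uc f g x y ux uy = begin
      X ⨾ ((f ⨾ g) ⨾ Z)
    ≈⟨ ⨾-cong ≈refl (assoc f g Z) ⟩
      X ⨾ (f ⨾ (g ⨾ Z))
    ≈⟨ ⨾-cong ≈refl (⨾-cong ≈refl (≈sym (idˡ _))) ⟩
      X ⨾ (f ⨾ (id ⨾ (g ⨾ Z)))
    ≈⟨ ⨾-cong ≈refl (⨾-cong ≈refl (⨾-cong id≈P⨾Q ≈refl)) ⟩
      X ⨾ (f ⨾ ((P ⨾ Q) ⨾ (g ⨾ Z)))
    ≈⟨ ⨾-cong ≈refl (⨾-cong ≈refl (assoc P Q _)) ⟩
      X ⨾ (f ⨾ (P ⨾ (Q ⨾ (g ⨾ Z))))
    ≈⟨ ⨾-cong ≈refl (≈sym (assoc f P _)) ⟩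
      X ⨾ ((f ⨾ P) ⨾ (Q ⨾ (g ⨾ Z)))
    ≈⟨ ≈sym (assoc X _ _) ⟩
      (X ⨾ (f ⨾ P)) ⨾ (Q ⨾ (g ⨾ Z))
    ∎
    where
    open ≈-Reasoning
    u = downFrom (length b)
    uu = unique-downFrom (length b)
    X = [ toList x ∣ a ]⟨ ux , ua , length-toList x ⟩
    Z = [ c ∣ toList y ]⟨ uc , uy , sym (length-toList y) ⟩
    P = [ b ∣ toList u ]⟨ ub , uu , sym (length-toList u) ⟩
    Q = [ toList u ∣ b ]⟨ uu , ub , length-toList u ⟩
    id≈P⨾Q : id ≈ P ⨾ Q
    id≈P⨾Q = ≈trans (≈sym (brak-id b ub refl)) (≈sym (brak-⨾ b (toList u) b ub uu ub _ _ _))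

  interp-rel-id : ∀ (a : List ℕ) .(ua : Unique a) x y .(ux : UniqueV x) .(uy : UniqueV y) →
             interp (gen a a ua ua id) x ux y uy ≈ interp oid x ux y uy
  interp-rel-id a ua x y ux uy =
    ≈trans (⨾-cong ≈refl (idˡ _)) (brak-⨾ (toList x) a (toList y) ux ua uy _ _ _)

  interp-rel-⊎ : ∀ (af bf ag bg : List ℕ)
            .(uaf : Unique af) .(ubf : Unique bf) .(uag : Unique ag) .(ubg : Unique bg)
            .(ua : Unique (af ++ ag)) .(ub : Unique (bf ++ bg))
            (f : Hom (fromList af) (fromList bf)) (g : Hom (fromList ag) (fromList bg))
            .(p : Disjoint (fromList af) (fromList ag)) .(q : Disjoint (fromList bf) (fromList bg))
            (eA : fromList af ∪ fromList ag ≡ fromList (af ++ ag))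
            (eB : fromList bf ∪ fromList bg ≡ fromList (bf ++ bg))
            (e₁ : length (af ++ ag) ≡ length af + length ag)
            (e₂ : length (bf ++ bg) ≡ length bf + length bg) x y .(ux : UniqueV x) .(uy : UniqueV y) →
            interp (cast₂ OTm e₁ e₂ (gen (af ++ ag) (bf ++ bg) ua ub (cast₂ Hom eA eB (ten f g p q)))) x ux y uy
              ≈ interp (gen af bf uaf ubf f o⊕ gen ag bg uag ubg g) x ux y uy
  interp-rel-⊎ af bf ag bg uaf ubf uag ubg ua ub f g p q eA eB e₁ e₂ x y ux uy =
    ≅→≈ (≅trans (interp-cast e₁ e₂ _ x y ux uy)
        (≅trans (≅⨾ (brak-++ (toList x') (toList x₁) (toList x₂) (af ++ ag) af ag _ ua _ _ uaf (length-toList x₁) _ uag (length-toList x₂)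
                       (Disjoint-take-drop (length af) x ux) p tlx refl)
                    (≅⨾ (cast≅ eA eB (ten f g p q))
                        (brak-++ (bf ++ bg) bf bg (toList y') (toList y₁) (toList y₂) ub _ _ ubf _
                              (sym (length-toList y₁)) ubg _ (sym (length-toList y₂))
                           q (Disjoint-take-drop (length bf) y uy) refl tly)))
        (≅trans (≅⨾ ≅refl (≅sym (interchange≅ f _ g _ p q (Disjoint-take-drop (length bf) y uy))))
        (≅trans (≅sym (interchange≅ _ _ _ _ (Disjoint-take-drop (length af) x ux) p (Disjoint-take-drop (length bf) y uy)))
                (≅sym (interp-⊕ (gen af bf uaf ubf f) (gen ag bg uag ubg g) x y ux uy))))))
    where
    x' = Vec.cast (sym e₁) x
    y' = Vec.cast (sym e₂) y
    x₁ = take (length af) x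
    x₂ = drop (length af) x
    y₁ = take (length bf) y
    y₂ = drop (length bf) y
    tlx : toList x' ≡ toList x₁ ++ toList x₂
    tlx = trans (toList-cast (sym e₁) x) (sym (toList-take++drop (length af) x))
    tly : toList y' ≡ toList y₁ ++ toList y₂
    tly = trans (toList-cast (sym e₂) y) (sym (toList-take++drop (length bf) y))

  interp-rel-symˡ : ∀ (a a' b c : List ℕ) .(ua : Unique a) .(ua' : Unique a')
               .(ub : Unique b) .(uc : Unique c)
               (eS : fromList a' ≡ fromList a) (el : length a' ≡ length b)
               (ρ : Permutation (length a) (length a'))
               (hρ : ∀ i → L.lookup a' (ρ ⟨$⟩ʳ i) ≡ L.lookup a i)
               (f : Hom (fromList b) (fromList c)) x y .(ux : UniqueV x) .(uy : UniqueV y) →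
               interp (gen a c ua uc (cast₂ Hom eS refl ([ a' ∣ b ]⟨ ua' , ub , el ⟩ ⨾ f))) x ux y uy
                 ≈ interp (operm ρ o⨾ cast₂ OTm (sym el) refl (gen b c ub uc f)) x ux y uy
  interp-rel-symˡ a a' b c ua ua' ub uc eS el ρ hρ f x y ux uy
    with findRenaming (toList x) a ux ua (length-toList x) | findRenaming a' b ua' ub el
       | findRenamingV x (permute ρ u) ux (unique-permute ρ u uu) | findRenaming (toList u') b uu' ub (trans (length-toList u') (sym refl))
    where
    u = downFrom (length a')
    uu = unique-downFrom (length a')
    u' = Vec.cast el u
    uu' = unique-cast el u uu
  ... | σ₁ , h₁ | σ₂ , h₂ | σ₃ , h₃ | σ₄ , h₄ =
    ≅→≈ (≅trans (≈→≅ (≈trans (⨾-cong ≈refl (≈trans (⨾-cong (≡→≈ lhs-eq) ≈refl) (assoc _ _ _))) (≈sym (assoc _ _ _))))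
        (≅trans (≅⨾ P₁≅P₂' ≅refl)
        (≅trans (≈→≅ (assoc _ _ _))
                (≅sym (⨾-retypeʳ F (interp-castˡ (sym el) (gen b c ub uc f) u y uu uy))))))
    where
    u = downFrom (length a')
    uu = unique-downFrom (length a')
    u' = Vec.cast el u
    uu' = unique-cast el u uu
    F = interp (operm ρ) x ux u uu
    E = _≅_.eA (interp-castˡ (sym el) (gen b c ub uc f) u y uu uy)
    X = [ toList x ∣ a ]⟨ ux , ua , length-toList x ⟩
    Bk = [ a' ∣ b ]⟨ ua' , ub , el ⟩
    G = [ toList (Vec.cast (sym (sym el)) u) ∣ b ]⟨ unique-cast (sym (sym el)) u uu , ub , length-toList (Vec.cast (sym (sym el)) u) ⟩
    lhs-eq : cast₂ Hom eS refl (Bk ⨾ f) ≡ (cast₂ Hom eS refl Bk ⨾ f)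
    lhs-eq = cast-⨾ˡ eS Bk f
    P₁≅ : (X ⨾ cast₂ Hom eS refl Bk) ≅ bij (σ₂ ∘π σ₁) ⟪ x ⟫
    P₁≅ = ⨾-bij≅bij σ₁ σ₂ (brak≅bij σ₁ (toList x) a ux ua (length-toList x) h₁)
                         (≅trans (cast≅ eS refl Bk) (brak≅bij σ₂ a' b ua' ub el h₂))
    P₂≅ : (cast₂ Hom refl (_≅_.eA (interp-castˡ (sym el) (gen b c ub uc f) u y uu uy)) F ⨾ G) ≅ bij (σ₄ ∘π σ₃) ⟪ x ⟫
    P₂≅ = ⨾-bij≅bij σ₃ σ₄
      (≅trans (cast≅ refl E F) (≅trans (interp-perm ρ x u ux uu) (brakV≅bij σ₃ x (permute ρ u) ux _ h₃)))
                         (brak≅bij σ₄ (toList u') b uu' ub _ h₄)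
    bv = mapV (app σ₂) (Vec.fromList a')
    eq₁ : mapL (app (σ₂ ∘π σ₁)) (toList x) ≡ toList (permute ρ bv)
    eq₁ = trans (L.map-∘ (toList x)) (trans (cong (mapL (app σ₂)) h₁)
          (trans (cong (mapL (app σ₂)) (sym (toList∘fromList a)))
          (trans (sym (toList-map (app σ₂) (Vec.fromList a)))
          (cong toList (trans (cong (mapV (app σ₂)) (fromList-permute a a' ρ hρ)) (map-permute (app σ₂) ρ (Vec.fromList a')))))))
    σ₄u≡bv : mapV (app σ₄) u ≡ bv
    σ₄u≡bv = toList-injective _ _ (trans (toList-map (app σ₄) u) (trans (cong (mapL (app σ₄)) (sym (toList-cast el u))) (trans h₄
          (sym (trans (toList-map (app σ₂) (Vec.fromList a')) (trans (cong (mapL (app σ₂)) (toList∘fromList a')) h₂))))))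
    eq₂ : mapL (app (σ₄ ∘π σ₃)) (toList x) ≡ toList (permute ρ bv)
    eq₂ = trans (sym (toList-map (app (σ₄ ∘π σ₃)) x))
          (cong toList (trans (map-∘ (app σ₄) (app σ₃) x) (trans (cong (mapV (app σ₄)) h₃)
          (trans (map-permute (app σ₄) ρ u) (cong (permute ρ) σ₄u≡bv)))))
    P₁≅P₂' : (X ⨾ cast₂ Hom eS refl Bk) ≅ (cast₂ Hom refl (_≅_.eA (interp-castˡ (sym el) (gen b c ub uc f) u y uu uy)) F ⨾ G)
    P₁≅P₂' = ≅trans P₁≅
      (≅trans (bij-ext-map (σ₂ ∘π σ₁) (σ₄ ∘π σ₃) (toList x) (trans eq₁ (sym eq₂))) (≅sym P₂≅))

  interp-rel-symʳ : ∀ (a b c c' : List ℕ) .(ua : Unique a) .(ub : Unique b)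
               .(uc : Unique c) .(uc' : Unique c')
               (eS : fromList c ≡ fromList c') (el : length b ≡ length c)
               (ρ : Permutation (length c) (length c'))
               (hρ : ∀ i → L.lookup c' (ρ ⟨$⟩ʳ i) ≡ L.lookup c i)
               (f : Hom (fromList a) (fromList b)) x y .(ux : UniqueV x) .(uy : UniqueV y) →
               interp (gen a c' ua uc' (cast₂ Hom refl eS (f ⨾ [ b ∣ c ]⟨ ub , uc , el ⟩))) x ux y uy
                 ≈ interp (gen a b ua ub f o⨾ cast₂ OTm (sym el) refl (operm ρ)) x ux y uy
  interp-rel-symʳ a b c c' ua ub uc uc' eS el ρ hρ f x y ux uy
    with findRenaming b c ub uc el | findRenaming c' (toList y) uc' uy (sym (length-toList y))
       | findRenaming b (toList (downFrom (length b))) ub (unique-downFrom (length b)) (sym (length-toList (downFrom (length b))))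
       | findRenamingV (Vec.cast (sym (sym el)) (downFrom (length b))) (permute ρ y)
           (unique-cast (sym (sym el)) (downFrom (length b)) (unique-downFrom (length b))) (unique-permute ρ y uy)
  ... | σ₁ , h₁ | σ₂ , h₂ | σ₃ , h₃ | σ₄ , h₄ =
    ≈trans (⨾-cong ≈refl (≈trans (⨾-cong (≡→≈ (cast-⨾ʳ eS f Bk)) ≈refl) (assoc _ _ _)))
    (≈trans (≈sym (assoc _ _ _))
    (≈trans (⨾-cong ≈refl (≅→≈ Q₁≅Q₂))
    (≈trans (assoc _ _ _) (≈trans (⨾-cong ≈refl (≈sym (assoc _ _ _))) (≈sym (assoc _ _ _))))))
    where
    u = downFrom (length b)
    uu = unique-downFrom (length b)
    u' = Vec.cast (sym (sym el)) u
    Bk = [ b ∣ c ]⟨ ub , uc , el ⟩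
    Z = [ c' ∣ toList y ]⟨ uc' , uy , sym (length-toList y) ⟩
    P = [ b ∣ toList u ]⟨ ub , uu , sym (length-toList u) ⟩
    H = interp (cast₂ OTm (sym el) refl (operm ρ)) u uu y uy
    Q₁≅ : (cast₂ Hom refl eS Bk ⨾ Z) ≅ bij (σ₂ ∘π σ₁) (fromList b)
    Q₁≅ = ⨾-bij≅bij σ₁ σ₂ (≅trans (cast≅ refl eS Bk) (brak≅bij σ₁ b c ub uc el h₁))
                          (brak≅bij σ₂ c' (toList y) uc' uy _ h₂)
    Q₂≅ : (P ⨾ H) ≅ bij (σ₄ ∘π σ₃) (fromList b)
    Q₂≅ = ⨾-bij≅bij σ₃ σ₄ (brak≅bij σ₃ b (toList u) ub uu _ h₃)
            (≅trans (interp-castˡ (sym el) (operm ρ) u y uu uy)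
            (≅trans (interp-perm ρ u' y _ uy) (brakV≅bij σ₄ u' (permute ρ y) _ _ h₄)))
    eq₁ : mapL (app (σ₂ ∘π σ₁)) b ≡ toList (permute ρ y)
    eq₁ = trans (L.map-∘ b) (trans (cong (mapL (app σ₂)) h₁)
          (trans (cong (mapL (app σ₂)) (sym (toList∘fromList c)))
          (trans (sym (toList-map (app σ₂) (Vec.fromList c)))
          (cong toList (trans (cong (mapV (app σ₂)) (fromList-permute c c' ρ hρ))
                       (trans (map-permute (app σ₂) ρ (Vec.fromList c')) (cong (permute ρ) (map-fromList σ₂ c' y h₂))))))))
    eq₂ : mapL (app (σ₄ ∘π σ₃)) b ≡ toList (permute ρ y)
    eq₂ = trans (L.map-∘ b) (trans (cong (mapL (app σ₄)) (trans h₃ (sym (toList-cast (sym (sym el)) u))))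
          (trans (sym (toList-map (app σ₄) u')) (cong toList h₄)))
    Q₁≅Q₂ : (cast₂ Hom refl eS Bk ⨾ Z) ≅ (P ⨾ H)
    Q₁≅Q₂ = ≅trans Q₁≅ (≅trans (bij-ext-map (σ₂ ∘π σ₁) (σ₄ ∘π σ₃) b (trans eq₁ (sym eq₂))) (≅sym Q₂≅))

  interp-resp-∼ : ∀ {g g' : OTm m n} → g ∼ g' →
                  ∀ c d .(uc : UniqueV c) .(ud : UniqueV d) → interp g c uc d ud ≈ interp g' c uc d ud
  interp-resp-∼ O.∼refl c d uc ud = ≈refl
  interp-resp-∼ (O.∼sym p) c d uc ud = ≈sym (interp-resp-∼ p c d uc ud)
  interp-resp-∼ (O.∼trans p q) c d uc ud = ≈trans (interp-resp-∼ p c d uc ud) (interp-resp-∼ q c d uc ud)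
  interp-resp-∼ (O.⨾-cong {n = n} p q) c d uc ud = ⨾-cong (interp-resp-∼ p c (downFrom n) uc (unique-downFrom n))
      (interp-resp-∼ q (downFrom n) d (unique-downFrom n) ud)
  interp-resp-∼ (O.⊕-cong {m} {n} {k} {l} {f} {f'} {g} {g'} p q) c d uc ud =
    ≅→≈ (≅trans (interp-⊕ f g c d uc ud)
        (≅trans (≅ten' (≈→≅ (interp-resp-∼ p _ _ _ _)) (≈→≅ (interp-resp-∼ q _ _ _ _))
                       (Disjoint-take-drop m c uc) (Disjoint-take-drop n d ud))
                (≅sym (interp-⊕ f' g' c d uc ud))))
  interp-resp-∼ (O.idˡ {m} f) c d uc ud = brakV-⨾-interp f c (downFrom m) d uc (unique-downFrom m) ud
  interp-resp-∼ (O.idʳ {n = n} f) c d uc ud = interp-⨾-brakV f c (downFrom n) d uc (unique-downFrom n) ud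
  interp-resp-∼ (O.assoc f g h) c d uc ud = assoc _ _ _
  interp-resp-∼ (O.⊕-id {m} {k}) c d uc ud = interp-⊕-id m k c d uc ud
  interp-resp-∼ (O.⊕-interchange f g f' g') c d uc ud = interp-interchange f g f' g' c d uc ud
  interp-resp-∼ (O.⊕-unitˡ f) c d uc ud = interp-unitˡ f c d uc ud
  interp-resp-∼ (O.⊕-unitʳ f e₁ e₂) c d uc ud = interp-unitʳ f e₁ e₂ c d uc ud
  interp-resp-∼ (O.⊕-assoc f g h e₁ e₂) c d uc ud = interp-⊕-assoc f g h e₁ e₂ c d uc ud
  interp-resp-∼ (O.perm-ext π ρ h) c d uc ud = interp-perm-ext π ρ h c d uc ud
  interp-resp-∼ O.perm-id c d uc ud = interp-perm-id c d uc ud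
  interp-resp-∼ (O.perm-comp π ρ) c d uc ud = interp-perm-comp π ρ c d uc ud
  interp-resp-∼ (O.perm-⊕ π ρ) c d uc ud = interp-perm-⊕ π ρ c d uc ud
  interp-resp-∼ (O.perm-nat f g) c d uc ud = interp-perm-nat f g c d uc ud
  interp-resp-∼ (O.gen-cong a b ua ub e) c d uc ud = ⨾-cong ≈refl (⨾-cong e ≈refl)
  interp-resp-∼ (O.rel-⨾ a b c' ua ub uc' f g) c d uc ud = interp-rel-⨾ a b c' ua ub uc' f g c d uc ud
  interp-resp-∼ (O.rel-⊎ af bf ag bg uaf ubf uag ubg ua ub f g p q eA eB e₁ e₂) c d uc ud =
    interp-rel-⊎ af bf ag bg uaf ubf uag ubg ua ub f g p q eA eB e₁ e₂ c d uc ud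
  interp-resp-∼ (O.rel-id a ua) c d uc ud = interp-rel-id a ua c d uc ud
  interp-resp-∼ (O.rel-symˡ a a' b c' ua ua' ub uc' eS el ρ hρ f) c d uc ud =
    interp-rel-symˡ a a' b c' ua ua' ub uc' eS el ρ hρ f c d uc ud
  interp-resp-∼ (O.rel-symʳ a b c' c'' ua ub uc' uc'' eS el ρ hρ f) c d uc ud =
    interp-rel-symʳ a b c' c'' ua ub uc' uc'' eS el ρ hρ f c d uc ud

module Comparison (T : NomPROP) where

  open FiniteSets
  open NameVectors
  open NomPROPProperties T
  open Interpretation T
  open import Data.Nat using (_+_)
  open import Data.List using ([]; _∷_; _++_) renaming (map to mapL)
  import Data.List as L
  open import Data.Vec using (Vec; toList; take; drop) renaming (map to mapV)
  import Data.Vec as Vec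
  open import Data.Vec.Properties using (toList-cast; toList-map; map-∘; length-toList; toList∘fromList)
  open import Data.Fin.Permutation using (Permutation; _⟨$⟩ʳ_)
  open import Data.Product using (proj₁; proj₂)
  open import Relation.Binary.PropositionalEquality
    using (refl; trans; cong; cong₂)
  open ORDdef T using (OTm; gen; oid; _o⨾_; _o⊕_; operm)
  open NOMdef (ORD T) using (NTm; ngen; nid; _n⨾_; nten; nbij; [_∣_]ₙ⟨_,_,_⟩; _≃_)
  module N = NOMdef (ORD T)

  Φ₀ : ∀ {A B} → NTm A B → Hom A B
  Φ₀ (ngen a b ua ub g) = cast₂ Hom (⟪fromList⟫ a) (⟪fromList⟫ b)
      (interp g (Vec.fromList a) (unique-fromList a ua) (Vec.fromList b) (unique-fromList b ub))
  Φ₀ nid = id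
  Φ₀ (f n⨾ g) = Φ₀ f ⨾ Φ₀ g
  Φ₀ (nten f g p q) = ten (Φ₀ f) (Φ₀ g) p q
  Φ₀ (nbij π A) = bij π A

  Φ-cast : ∀ {A B A' B'} (p : A ≡ A') (q : B ≡ B') (h : NTm A B) →
           Φ₀ (cast₂ NTm p q h) ≡ cast₂ Hom p q (Φ₀ h)
  Φ-cast refl refl h = refl

  Φ-brak : ∀ a b .(ua : Unique a) .(ub : Unique b) e → Φ₀ [ a ∣ b ]ₙ⟨ ua , ub , e ⟩ ≡ [ a ∣ b ]⟨ ua , ub , e ⟩
  Φ-brak [] [] ua ub e = refl
  Φ-brak (x ∷ a) (y ∷ b) ua ub e =
    cong₂ (λ u v → ten u v (unique-disj x a ua) (unique-disj y b ub))
          (Φ-cast refl (τ-sing x y) (nbij (τ x y) ⟦ x ⟧))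
          (Φ-brak a b (unique-tail ua) (unique-tail ub) _)

  Φ-ngen : ∀ a b .(ua : Unique a) .(ub : Unique b) (g : OTm (length a) (length b)) →
          Φ₀ (ngen a b ua ub g) ≅ interp g (Vec.fromList a) (unique-fromList a ua) (Vec.fromList b) (unique-fromList b ub)
  Φ-ngen a b ua ub g = cast≅ (⟪fromList⟫ a) (⟪fromList⟫ b) _

  Φ-rel-⨾ : ∀ (a b c : List ℕ) .(ua : Unique a) .(ub : Unique b) .(uc : Unique c)
            (f : OTm (length a) (length b)) (g : OTm (length b) (length c)) →
            Φ₀ (ngen a c ua uc (f o⨾ g)) ≈ (Φ₀ (ngen a b ua ub f) ⨾ Φ₀ (ngen b c ub uc g))
  Φ-rel-⨾ a b c ua ub uc f g =
    ≅→≈ (≅trans (Φ-ngen a c ua uc (f o⨾ g))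
        (≅trans (≈→≅ (interp-⨾-boundary f g (Vec.fromList a) (downFrom (length b)) (Vec.fromList b) (Vec.fromList c) _
                  (unique-downFrom (length b)) (unique-fromList b ub) _))
                (≅sym (≅⨾ (Φ-ngen a b ua ub f) (Φ-ngen b c ub uc g)))))

  Φ-rel-id : ∀ (a b : List ℕ) .(ua : Unique a) .(ub : Unique b) (e : length a ≡ length b) →
             Φ₀ (ngen a b ua ub (cast₂ OTm refl e oid)) ≈ Φ₀ [ a ∣ b ]ₙ⟨ ua , ub , e ⟩
  Φ-rel-id a b ua ub e =
    ≅→≈ (≅trans (Φ-ngen a b ua ub (cast₂ OTm refl e oid))
        (≅trans (interp-castʳ e oid (Vec.fromList a) (Vec.fromList b) (unique-fromList a ua) (unique-fromList b ub))
        (≅trans (brak-≡ _ a _ b _ ua _ ub _ e (toList∘fromList a) (trans (toList-cast (sym e) (Vec.fromList b)) (toList∘fromList b)))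
                (≡→≅ (sym (Φ-brak a b ua ub e))))))

  take-drop-fromList : ∀ (a c : List ℕ) (x : Vec ℕ (length a + length c)) → toList x ≡ a ++ c →
             (toList (take (length a) x) ≡ toList (Vec.fromList a)) × (toList (drop (length a) x) ≡ toList (Vec.fromList c))
  take-drop-fromList a c x e with ++-split (toList (take (length a) x)) a (toList (drop (length a) x)) c (length-toList (take (length a) x))
                          (trans (toList-take++drop (length a) x) e)
  ... | e₁ , e₂ = trans e₁ (sym (toList∘fromList a)) , trans e₂ (sym (toList∘fromList c))

  Φ-rel-⊕ : ∀ (a b c d : List ℕ)
            .(ua : Unique a) .(ub : Unique b) .(uc : Unique c) .(ud : Unique d)
            .(uac : Unique (a ++ c)) .(ubd : Unique (b ++ d))
            (f : OTm (length a) (length b)) (g : OTm (length c) (length d))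
            .(p : Disjoint (fromList a) (fromList c)) .(q : Disjoint (fromList b) (fromList d))
            (e₁ : length (a ++ c) ≡ length a + length c)
            (e₂ : length (b ++ d) ≡ length b + length d)
            (eA : fromList a ∪ fromList c ≡ fromList (a ++ c))
            (eB : fromList b ∪ fromList d ≡ fromList (b ++ d)) →
            Φ₀ (ngen (a ++ c) (b ++ d) uac ubd (cast₂ OTm (sym e₁) (sym e₂) (f o⊕ g)))
              ≈ Φ₀ (cast₂ NTm eA eB (nten (ngen a b ua ub f) (ngen c d uc ud g) p q))
  Φ-rel-⊕ a b c d ua ub uc ud uac ubd f g p q e₁ e₂ eA eB =
    ≅→≈ (≅trans (Φ-ngen (a ++ c) (b ++ d) uac ubd (cast₂ OTm (sym e₁) (sym e₂) (f o⊕ g)))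
        (≅trans (interp-cast (sym e₁) (sym e₂) (f o⊕ g) (Vec.fromList (a ++ c)) (Vec.fromList (b ++ d))
                (unique-fromList (a ++ c) uac) (unique-fromList (b ++ d) ubd))
        (≅trans (interp-⊕ f g x' y' (unique-cast (sym (sym e₁)) (Vec.fromList (a ++ c)) (unique-fromList (a ++ c) uac))
                (unique-cast (sym (sym e₂)) (Vec.fromList (b ++ d)) (unique-fromList (b ++ d) ubd)))
        (≅trans (≅ten' (interp-toList f _ (Vec.fromList a) _ (Vec.fromList b) _ (unique-fromList a ua) _
                                      (unique-fromList b ub) (proj₁ sx) (proj₁ sy))
                       (interp-toList g _ (Vec.fromList c) _ (Vec.fromList d) _ (unique-fromList c uc) _
                                      (unique-fromList d ud) (proj₂ sx) (proj₂ sy))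
                       (Disjoint-take-drop (length a) x' (unique-cast (sym (sym e₁)) (Vec.fromList (a ++ c)) (unique-fromList (a ++ c) uac)))
                       (Disjoint-take-drop (length b) y' (unique-cast (sym (sym e₂)) (Vec.fromList (b ++ d)) (unique-fromList (b ++ d) ubd))))
        (≅trans (≅ten' (≅sym (Φ-ngen a b ua ub f)) (≅sym (Φ-ngen c d uc ud g))
                   (Disjoint-subst (sym (⟪fromList⟫ a)) (sym (⟪fromList⟫ c)) p)
                   (Disjoint-subst (sym (⟪fromList⟫ b)) (sym (⟪fromList⟫ d)) q))
        (≅trans (≅sym (cast≅ eA eB _)) (≡→≅ (sym (Φ-cast eA eB (nten (ngen a b ua ub f) (ngen c d uc ud g) p q))))))))))
    where
    x' = Vec.cast (sym (sym e₁)) (Vec.fromList (a ++ c))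
    y' = Vec.cast (sym (sym e₂)) (Vec.fromList (b ++ d))
    sx = take-drop-fromList a c x' (trans (toList-cast _ (Vec.fromList (a ++ c))) (toList∘fromList (a ++ c)))
    sy = take-drop-fromList b d y' (trans (toList-cast _ (Vec.fromList (b ++ d))) (toList∘fromList (b ++ d)))

  Φ-rel-symˡ : ∀ (a b b' c : List ℕ) .(ua : Unique a) .(ub : Unique b)
               .(ub' : Unique b') .(uc : Unique c)
               (eS : fromList b ≡ fromList b') (el : length a ≡ length b)
               (ρ : Permutation (length b) (length b'))
               (hρ : ∀ i → L.lookup b' (ρ ⟨$⟩ʳ i) ≡ L.lookup b i)
               (f : OTm (length b') (length c)) →
               Φ₀ (ngen a c ua uc (cast₂ OTm (sym el) refl (operm ρ o⨾ f)))
                 ≈ Φ₀ ([ a ∣ b ]ₙ⟨ ua , ub , el ⟩ n⨾ cast₂ NTm (sym eS) refl (ngen b' c ub' uc f))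
  Φ-rel-symˡ a b b' c ua ub ub' uc eS el ρ hρ f
    with findRenamingV (Vec.cast (sym (sym el)) (Vec.fromList a)) (permute ρ (downFrom (length b')))
                 (unique-cast (sym (sym el)) (Vec.fromList a) (unique-fromList a ua))
                     (unique-permute ρ (downFrom (length b')) (unique-downFrom (length b')))
       | findRenamingV (downFrom (length b')) (Vec.fromList b') (unique-downFrom (length b')) (unique-fromList b' ub')
       | findRenaming a b ua ub el
  ... | σ₁ , h₁ | σ₂ , h₂ | σ , h =
    ≅→≈ (≅trans (Φ-ngen a c ua uc (cast₂ OTm (sym el) refl (operm ρ o⨾ f)))
        (≅trans (interp-castˡ (sym el) (operm ρ o⨾ f) (Vec.fromList a) (Vec.fromList c) (unique-fromList a ua) (unique-fromList c uc))
        (≅trans (≈→≅ (≈trans (⨾-cong ≈refl (≈sym insert-brak)) (≈sym (assoc _ _ _))))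
        (≅trans (≅⨾ P≅K ≅refl)
                (≅sym (⨾-retypeʳ (Φ₀ Br) Gr≅))))))
    where
    u = downFrom (length b')
    uu = unique-downFrom (length b')
    insert-brak = brakV-⨾-interp f u (Vec.fromList b') (Vec.fromList c) uu (unique-fromList b' ub') (unique-fromList c uc)
    x = Vec.cast (sym (sym el)) (Vec.fromList a)
    ux = unique-cast (sym (sym el)) (Vec.fromList a) (unique-fromList a ua)
    Br = [ a ∣ b ]ₙ⟨ ua , ub , el ⟩
    Gr = cast₂ NTm (sym eS) refl (ngen b' c ub' uc f)
    Gr≅ : Φ₀ Gr ≅ interp f (Vec.fromList b') (unique-fromList b' ub') (Vec.fromList c) (unique-fromList c uc)
    Gr≅ = ≅trans (≡→≅ (Φ-cast (sym eS) refl (ngen b' c ub' uc f)))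
          (≅trans (cast≅ (sym eS) refl _) (Φ-ngen b' c ub' uc f))
    tx : toList x ≡ a
    tx = trans (toList-cast _ (Vec.fromList a)) (toList∘fromList a)
    P≅ : (interp (operm ρ) x ux u uu ⨾ brakV u (Vec.fromList b') uu (unique-fromList b' ub')) ≅ bij (σ₂ ∘π σ₁) ⟪ x ⟫
    P≅ = ⨾-bij≅bij σ₁ σ₂ (≅trans (interp-perm ρ x u ux uu) (brakV≅bij σ₁ x (permute ρ u) ux _ h₁))
                         (brakV≅bij σ₂ u (Vec.fromList b') uu _ h₂)
    K≅ : cast₂ Hom refl (_≅_.eA Gr≅) (Φ₀ Br) ≅ bij σ ⟪ x ⟫
    K≅ = ≅trans (cast≅ refl _ _) (≅trans (≡→≅ (Φ-brak a b ua ub el))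
         (≅trans (brak≅bij σ a b ua ub el h) (bij-cast≅ σ (cong fromList (sym tx)))))
    eq₁ : mapL (app (σ₂ ∘π σ₁)) (toList x) ≡ b
    eq₁ = trans (sym (toList-map (app (σ₂ ∘π σ₁)) x))
          (trans (cong toList (trans (map-∘ (app σ₂) (app σ₁) x) (trans (cong (mapV (app σ₂)) h₁)
                   (trans (map-permute (app σ₂) ρ u) (trans (cong (permute ρ) h₂) (sym (fromList-permute b b' ρ hρ)))))))
                 (toList∘fromList b))
    eq₂ : mapL (app σ) (toList x) ≡ b
    eq₂ = trans (cong (mapL (app σ)) tx) h
    P≅K : (interp (operm ρ) x ux u uu ⨾ brakV u (Vec.fromList b') uu (unique-fromList b' ub'))
            ≅ cast₂ Hom refl (_≅_.eA Gr≅) (Φ₀ Br)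
    P≅K = ≅trans P≅ (≅trans (bij-ext-map (σ₂ ∘π σ₁) σ (toList x) (trans eq₁ (sym eq₂))) (≅sym K≅))

  Φ-rel-symʳ : ∀ (a b b' c : List ℕ) .(ua : Unique a) .(ub : Unique b)
               .(ub' : Unique b') .(uc : Unique c)
               (eS : fromList b ≡ fromList b') (el : length b' ≡ length c)
               (ρ : Permutation (length b) (length b'))
               (hρ : ∀ i → L.lookup b' (ρ ⟨$⟩ʳ i) ≡ L.lookup b i)
               (f : OTm (length a) (length b)) →
               Φ₀ (ngen a c ua uc (cast₂ OTm refl el (f o⨾ operm ρ)))
                 ≈ Φ₀ (ngen a b ua ub f n⨾ cast₂ NTm (sym eS) refl [ b' ∣ c ]ₙ⟨ ub' , uc , el ⟩)
  Φ-rel-symʳ a b b' c ua ub ub' uc eS el ρ hρ f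
    with findRenamingV (Vec.fromList b) (downFrom (length b)) (unique-fromList b ub) (unique-downFrom (length b))
       | findRenamingV (downFrom (length b)) (permute ρ (Vec.cast (sym el) (Vec.fromList c))) (unique-downFrom (length b))
                 (unique-permute ρ (Vec.cast (sym el) (Vec.fromList c)) (unique-cast (sym el) (Vec.fromList c) (unique-fromList c uc)))
       | findRenaming b' c ub' uc el
  ... | σ₁ , h₁ | σ₂ , h₂ | σ , h =
    ≅→≈ (≅trans (Φ-ngen a c ua uc (cast₂ OTm refl el (f o⨾ operm ρ)))
        (≅trans (interp-castʳ el (f o⨾ operm ρ) (Vec.fromList a) (Vec.fromList c) (unique-fromList a ua) (unique-fromList c uc))
        (≅trans (≈→≅ (≈trans (⨾-cong (≈sym insert-brak) ≈refl) (assoc _ _ _)))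
        (≅trans (≅⨾ ≅refl Q≅H)
                (≅sym (⨾-retypeˡ (Φ-ngen a b ua ub f) (Φ₀ Hr)))))))
    where
    u = downFrom (length b)
    uu = unique-downFrom (length b)
    insert-brak = interp-⨾-brakV f (Vec.fromList a) (Vec.fromList b) u (unique-fromList a ua) (unique-fromList b ub) uu
    y = Vec.cast (sym el) (Vec.fromList c)
    uy = unique-cast (sym el) (Vec.fromList c) (unique-fromList c uc)
    Hr = cast₂ NTm (sym eS) refl [ b' ∣ c ]ₙ⟨ ub' , uc , el ⟩
    E = _≅_.eB (Φ-ngen a b ua ub f)
    ty : toList y ≡ c
    ty = trans (toList-cast _ (Vec.fromList c)) (toList∘fromList c)
    Q≅ : (brakV (Vec.fromList b) u (unique-fromList b ub) uu ⨾ interp (operm ρ) u uu y uy)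
           ≅ bij (σ₂ ∘π σ₁) ⟪ Vec.fromList b ⟫
    Q≅ = ⨾-bij≅bij σ₁ σ₂ (brakV≅bij σ₁ (Vec.fromList b) u _ uu h₁)
                         (≅trans (interp-perm ρ u y uu uy) (brakV≅bij σ₂ u (permute ρ y) uu _ h₂))
    H≅ : cast₂ Hom E refl (Φ₀ Hr) ≅ bij σ ⟪ Vec.fromList b ⟫
    H≅ = ≅trans (cast≅ E refl _) (≅trans (≡→≅ (Φ-cast (sym eS) refl [ b' ∣ c ]ₙ⟨ ub' , uc , el ⟩))
         (≅trans (cast≅ (sym eS) refl _) (≅trans (≡→≅ (Φ-brak b' c ub' uc el))
         (≅trans (brak≅bij σ b' c ub' uc el h) (bij-cast≅ σ (trans (sym eS) (sym (⟪fromList⟫ b))))))))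
    eq₁ : mapL (app (σ₂ ∘π σ₁)) (toList (Vec.fromList b)) ≡ toList (permute ρ y)
    eq₁ = trans (sym (toList-map (app (σ₂ ∘π σ₁)) (Vec.fromList b)))
          (cong toList (trans (map-∘ (app σ₂) (app σ₁) (Vec.fromList b)) (trans (cong (mapV (app σ₂)) h₁) h₂)))
    eq₂ : mapL (app σ) (toList (Vec.fromList b)) ≡ toList (permute ρ y)
    eq₂ = trans (sym (toList-map (app σ) (Vec.fromList b)))
          (cong toList (trans (cong (mapV (app σ)) (fromList-permute b b' ρ hρ))
                       (trans (map-permute (app σ) ρ (Vec.fromList b')) (cong (permute ρ) (map-fromList σ b' y (trans h (sym ty)))))))
    Q≅H : (brakV (Vec.fromList b) u (unique-fromList b ub) uu ⨾ interp (operm ρ) u uu y uy) ≅ cast₂ Hom E refl (Φ₀ Hr)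
    Q≅H = ≅trans Q≅ (≅trans (bij-ext-map (σ₂ ∘π σ₁) σ (toList (Vec.fromList b)) (trans eq₁ (sym eq₂))) (≅sym H≅))

  Φ-resp-≃ : ∀ {A B} {f g : NTm A B} → f ≃ g → Φ₀ f ≈ Φ₀ g
  Φ-resp-≃ N.≃refl = ≈refl
  Φ-resp-≃ (N.≃sym p) = ≈sym (Φ-resp-≃ p)
  Φ-resp-≃ (N.≃trans p q) = ≈trans (Φ-resp-≃ p) (Φ-resp-≃ q)
  Φ-resp-≃ (N.⨾-cong p q) = ⨾-cong (Φ-resp-≃ p) (Φ-resp-≃ q)
  Φ-resp-≃ (N.ten-cong p q r s) = ten-cong p q (Φ-resp-≃ r) (Φ-resp-≃ s)
  Φ-resp-≃ (N.idˡ f) = idˡ _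
  Φ-resp-≃ (N.idʳ f) = idʳ _
  Φ-resp-≃ (N.assoc f g h) = assoc _ _ _
  Φ-resp-≃ (N.ten-id p) = ten-id p
  Φ-resp-≃ (N.interchange f g f' g' p q r) = interchange _ _ _ _ p q r
  Φ-resp-≃ (N.ten-unitˡ f p q) = ten-unitˡ _ p q
  Φ-resp-≃ (N.ten-unitʳ f p q e₁ e₂) = ≈trans (≡→≈ (Φ-cast e₁ e₂ _)) (ten-unitʳ _ p q e₁ e₂)
  Φ-resp-≃ (N.ten-assoc f g h p q p' q' r s r' s' e₁ e₂) =
    ≈trans (≡→≈ (Φ-cast e₁ e₂ _)) (ten-assoc _ _ _ p q p' q' r s r' s' e₁ e₂)
  Φ-resp-≃ (N.ten-comm f g p q p' q' e₁ e₂) = ≈trans (≡→≈ (Φ-cast e₁ e₂ _)) (ten-comm _ _ p q p' q' e₁ e₂)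
  Φ-resp-≃ (N.bij-ext π ρ A h e) = ≈trans (≡→≈ (Φ-cast refl e _)) (bij-ext π ρ A h e)
  Φ-resp-≃ (N.bij-id A e) = ≈trans (≡→≈ (Φ-cast refl e _)) (bij-id A e)
  Φ-resp-≃ (N.bij-comp π ρ A e) = ≈trans (≡→≈ (Φ-cast refl e _)) (bij-comp π ρ A e)
  Φ-resp-≃ (N.bij-ten π A C p q e) = ≈trans (≡→≈ (Φ-cast refl e _)) (bij-ten π A C p q e)
  Φ-resp-≃ (N.gen-cong a b ua ub {f} {g} e) =
    ≅→≈ (≅trans (Φ-ngen a b ua ub f)
          (≅trans (≈→≅ (interp-resp-∼ e (Vec.fromList a) (Vec.fromList b) (unique-fromList a ua) (unique-fromList b ub)))
          (≅sym (Φ-ngen a b ua ub g))))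
  Φ-resp-≃ (N.rel-⨾ a b c ua ub uc f g) = Φ-rel-⨾ a b c ua ub uc f g
  Φ-resp-≃ (N.rel-⊕ a b c d ua ub uc ud uac ubd f g p q e₁ e₂ eA eB) = Φ-rel-⊕ a b c d ua ub uc ud uac ubd f g p q e₁ e₂ eA eB
  Φ-resp-≃ (N.rel-id a b ua ub e) = Φ-rel-id a b ua ub e
  Φ-resp-≃ (N.rel-symˡ a b b' c ua ub ub' uc eS el ρ hρ f) = Φ-rel-symˡ a b b' c ua ub ub' uc eS el ρ hρ f
  Φ-resp-≃ (N.rel-symʳ a b b' c ua ub ub' uc eS el ρ hρ f) = Φ-rel-symʳ a b b' c ua ub ub' uc eS el ρ hρ f

  Φ : NomMor (NOM (ORD T)) T
  Φ = record
    { map = Φ₀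
    ; map-cong = Φ-resp-≃
    ; map-id = ≈refl
    ; map-⨾ = λ f g → ≈refl
    ; map-ten = λ f g p q → ≈refl
    ; map-bij = λ π A → ≈refl
    }

  Φ-gen : ∀ (a b c d : List ℕ) .(ua : Unique a) .(ub : Unique b) .(uc : Unique c) .(ud : Unique d)
             (ec : length c ≡ length a) (ed : length d ≡ length b)
             (f : Hom (fromList a) (fromList b)) →
             Φ₀ (ngen c d uc ud (cast₂ OTm (sym ec) (sym ed) (gen a b ua ub f)))
               ≈ ([ c ∣ a ]⟨ uc , ua , ec ⟩ ⨾ (f ⨾ [ b ∣ d ]⟨ ub , ud , sym ed ⟩))
  Φ-gen a b c d ua ub uc ud ec ed f =
    ≅→≈ (≅trans (Φ-ngen c d uc ud (cast₂ OTm (sym ec) (sym ed) (gen a b ua ub f)))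
        (≅trans (interp-cast (sym ec) (sym ed) (gen a b ua ub f) (Vec.fromList c) (Vec.fromList d)
                             (unique-fromList c uc) (unique-fromList d ud))
                (≅⨾ (brak-≡ _ c a a _ uc ua ua (length-toList x) ec tc refl)
                      (≅⨾ ≅refl (brak-≡ b b _ d ub ub _ ud (sym (length-toList y)) (sym ed) refl td)))))
    where
    x = Vec.cast (sym (sym ec)) (Vec.fromList c)
    y = Vec.cast (sym (sym ed)) (Vec.fromList d)
    tc = trans (toList-cast (sym (sym ec)) (Vec.fromList c)) (toList∘fromList c)
    td = trans (toList-cast (sym (sym ed)) (Vec.fromList d)) (toList∘fromList d)

module NomMorProperties (T T' : NomPROP) (F : NomMor T T') where

  open import Data.List using ([]; _∷_)
  open import Relation.Binary.PropositionalEquality using (refl)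

  module C₁ = NomPROPProperties T
  module C₂ = NomPROPProperties T'
  open NomMor F

  map-cast₂ : ∀ {A B A' B'} (p : A ≡ A') (q : B ≡ B') (x : C₁.Hom A B) →
              map (cast₂ C₁.Hom p q x) ≡ cast₂ C₂.Hom p q (map x)
  map-cast₂ refl refl x = refl

  map-δ : ∀ x y → map (C₁.δ x y) C₂.≈ C₂.δ x y
  map-δ x y = C₂.≈trans (C₂.≡→≈ (map-cast₂ refl (τ-sing x y) (C₁.bij (τ x y) ⟦ x ⟧)))
                        (C₂.cast₂-cong refl (τ-sing x y) (map-bij (τ x y) ⟦ x ⟧))

  map-brak : ∀ a b .(ua : Unique a) .(ub : Unique b) e →
             map C₁.[ a ∣ b ]⟨ ua , ub , e ⟩ C₂.≈ C₂.[ a ∣ b ]⟨ ua , ub , e ⟩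
  map-brak []      []      ua ub e = map-id
  map-brak (x ∷ a) (y ∷ b) ua ub e =
    C₂.≈trans (map-ten _ _ _ _) (C₂.ten-cong _ _ (map-δ x y) (map-brak a b _ _ _))

module Naturality (T T' : NomPROP) (F : NomMor T T') where

  open NameVectors
  open import Data.Vec using (toList)
  open import Data.Vec.Properties using (length-toList)
  open import Relation.Binary.PropositionalEquality using (refl)

  module C₁ = NomPROPProperties T
  module C₂ = NomPROPProperties T'
  module D₁ = Interpretation T
  module D₂ = Interpretation T'
  module E₁ = Comparison T
  module E₂ = Comparison T'
  open NomMor F
  open NomMorProperties T T' F using (map-cast₂; map-brak)
  open ORDdef using (gen; oid; _o⨾_; _o⊕_; operm)
  open NOMdef using (ngen; nid; _n⨾_; nten; nbij)

  map-interp : ∀ {m n} (g : ORDdef.OTm T m n) c d .(uc : D₁.UniqueV c) .(ud : D₁.UniqueV d) →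
        map (D₁.interp g c uc d ud) C₂.≈ D₂.interp (ordMap {T} {T'} map g) c uc d ud
  map-interp (gen a b ua ub f) c d uc ud =
    C₂.≈trans (map-⨾ _ _) (C₂.⨾-cong (map-brak (toList c) a uc ua (length-toList c))
      (C₂.≈trans (map-⨾ _ _) (C₂.⨾-cong C₂.≈refl (map-brak b (toList d) ub ud (sym (length-toList d))))))
  map-interp oid c d uc ud = map-brak (toList c) (toList d) uc ud _
  map-interp (g o⨾ h) c d uc ud = C₂.≈trans (map-⨾ _ _) (C₂.⨾-cong (map-interp g _ _ _ _) (map-interp h _ _ _ _))
  map-interp (_o⊕_ {m} {n} g h) c d uc ud =
    C₂.≈trans (C₂.≡→≈ (map-cast₂ (sym (⟪⟫-take-drop m c)) (sym (⟪⟫-take-drop n d)) _))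
    (C₂.cast₂-cong (sym (⟪⟫-take-drop m c)) (sym (⟪⟫-take-drop n d))
      (C₂.≈trans (map-ten _ _ _ _) (C₂.ten-cong _ _ (map-interp g _ _ _ _) (map-interp h _ _ _ _))))
  map-interp (operm π) c d uc ud =
    C₂.≈trans (C₂.≡→≈ (map-cast₂ refl (⟪⟫-permute π d) _))
        (C₂.cast₂-cong refl (⟪⟫-permute π d) (map-brak (toList c) (toList (permute π d)) uc (unique-permute π d ud) _))

  Φ-natural : ∀ {A B} (h : NOMdef.NTm (ORD T) A B) →
        map (E₁.Φ₀ h) C₂.≈ E₂.Φ₀ (nomMap {ORD T} {ORD T'} (ordMap {T} {T'} map) h)
  Φ-natural (ngen a b ua ub g) =
    C₂.≈trans (C₂.≡→≈ (map-cast₂ (⟪fromList⟫ a) (⟪fromList⟫ b) _))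
              (C₂.cast₂-cong (⟪fromList⟫ a) (⟪fromList⟫ b) (map-interp g _ _ _ _))
  Φ-natural nid = map-id
  Φ-natural (f n⨾ g) = C₂.≈trans (map-⨾ _ _) (C₂.⨾-cong (Φ-natural f) (Φ-natural g))
  Φ-natural (nten f g p q) = C₂.≈trans (map-ten _ _ p q) (C₂.ten-cong p q (Φ-natural f) (Φ-natural g))
  Φ-natural (nbij π A) = map-bij π A

module ORDProperties (T : NomPROP) where

  open import Data.Nat using (_+_)
  open import Data.Fin.Permutation using (Permutation)
  open import Relation.Binary.PropositionalEquality using (refl; trans; cong₂; subst₂)
  open ORDdef T using (OTm; oid; _o⨾_; _o⊕_; operm; _∼_; ∼refl)

  ≡→∼ : ∀ {m n} {x y : OTm m n} → x ≡ y → x ∼ y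
  ≡→∼ refl = ∼refl

  cast₂-cong : ∀ {m n m' n'} (p : m ≡ m') (q : n ≡ n') {x y : OTm m n} → x ∼ y → cast₂ OTm p q x ∼ cast₂ OTm p q y
  cast₂-cong refl refl e = e

  cast₂-transpose : ∀ {m n m' n'} (p : m ≡ m') (q : n ≡ n') {x : OTm m n} {y : OTm m' n'} →
           cast₂ OTm p q x ∼ y → x ∼ cast₂ OTm (sym p) (sym q) y
  cast₂-transpose refl refl e = e

  cast₂-cast₂ : ∀ {m n m' n' m'' n''} (p : m ≡ m') (q : n ≡ n') (p' : m' ≡ m'') (q' : n' ≡ n'') (x : OTm m n) →
               cast₂ OTm p' q' (cast₂ OTm p q x) ≡ cast₂ OTm (trans p p') (trans q q') x
  cast₂-cast₂ refl refl refl refl x = refl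

  cast₂-irrelevant : ∀ {m n m' n'} (p p' : m ≡ m') (q q' : n ≡ n') (x : OTm m n) →
              cast₂ OTm p q x ≡ cast₂ OTm p' q' x
  cast₂-irrelevant refl refl refl refl x = refl

  cast₂-o⨾ : ∀ {m n k m' n' k'} (p : m ≡ m') (q : n ≡ n') (r : k ≡ k') (g : OTm m n) (h : OTm n k) →
            cast₂ OTm p r (g o⨾ h) ≡ (cast₂ OTm p q g o⨾ cast₂ OTm q r h)
  cast₂-o⨾ refl refl refl g h = refl

  cast₂-o⊕ : ∀ {m n k l m' n' k' l'} (p : m ≡ m') (q : n ≡ n') (r : k ≡ k') (s : l ≡ l') (g : OTm m n) (h : OTm k l) →
            (cast₂ OTm p q g o⊕ cast₂ OTm r s h) ≡ cast₂ OTm (cong₂ _+_ p r) (cong₂ _+_ q s) (g o⊕ h)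
  cast₂-o⊕ refl refl refl refl g h = refl

  cast₂-oid-swap : ∀ {m n} (e : m ≡ n) → cast₂ OTm (sym e) refl (oid {n}) ≡ cast₂ OTm refl e (oid {m})
  cast₂-oid-swap refl = refl

  cast₂-oid : ∀ {X Y n} (p : X ≡ n) (q : Y ≡ n) (e : X ≡ Y) → cast₂ OTm refl e (oid {X}) ≡ cast₂ OTm (sym p) (sym q) (oid {n})
  cast₂-oid refl refl refl = refl

  cast₂-operm : ∀ {X P Y m n} (lx : X ≡ m) (lpv : P ≡ m) (ly : Y ≡ n) (e : X ≡ P) (π : Permutation m n) →
              cast₂ OTm (sym e) refl (operm (subst₂ Permutation (sym lpv) (sym ly) π)) ≡ cast₂ OTm (sym lx) (sym ly) (operm π)
  cast₂-operm refl refl refl refl π = refl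

module Inverse (T : NomPROP) where

  open FiniteSets
  open NameVectors using (reindexing)
  open ORDProperties T
  open import Data.List using (_++_) renaming (map to mapL)
  open import Data.List.Properties using (length-map; length-++)
  import Data.List.Relation.Unary.Unique.Propositional.Properties as Unique
  import Data.Fin.Permutation as Perm
  open import Relation.Binary.PropositionalEquality using (refl; cong)

  module CT = NomPROPProperties T
  module CN = NomPROPProperties (NOM (ORD T))
  module O = ORDdef T
  module N = NOMdef (ORD T)
  open O using (OTm; gen; oid; _∼_)
  open N using (NTm; ngen; nid; _n⨾_; nten; nbij; _≃_)

  embed : ∀ a b → .(Unique a) → .(Unique b) → CT.Hom (fromList a) (fromList b) → NTm (fromList a) (fromList b)
  embed a b ua ub f = ngen a b ua ub (gen a b ua ub f)

  embed-cong : ∀ a b .(ua : Unique a) .(ub : Unique b) {f g} → f CT.≈ g → embed a b ua ub f ≃ embed a b ua ub g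
  embed-cong a b ua ub e = N.gen-cong a b ua ub (O.gen-cong a b ua ub e)

  -- The relation for ⟨a][a'|b];f[c⟩ in ORD and the one for [a⟩⟨b|b'⟩;f⟨c] in
  -- NOM cancel the symmetry ⟨a|a'⟩, so a generator does not depend on the
  -- enumeration of its boundary.
  embed-reindexˡ : ∀ a a' b .(ua : Unique a) .(ua' : Unique a') .(ub : Unique b) (eS : fromList a ≡ fromList a')
             (f : CT.Hom (fromList a) (fromList b)) →
             embed a' b ua' ub (cast₂ CT.Hom eS refl f) CN.≅ embed a b ua ub f
  embed-reindexˡ a a' b ua ua' ub eS f
    with reindexing a a' (recomputeUnique ua) (recomputeUnique ua') (⊆-fromList a' a (sym eS)) (⊆-fromList a a' eS)
  ... | ρ , hρ =
    CN.≅trans (CN.≈→≅ (N.gen-cong a' b ua' ub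
      (O.∼trans (O.gen-cong a' b ua' ub id⨾-absorbs) (O.rel-symˡ a' a a b ua' ua ua ub eS refl ρ hρ f))))
    (CN.≅trans (CN.≈→≅ (N.rel-symˡ a' a' a b ua' ua' ua ub (sym eS) refl ρ hρ (gen a b ua ub f)))
    (CN.≅trans (CN.≅⨾ (CN.≅trans (CN.≈→≅ (CN.brak-id a' ua' refl)) (CN.id-≅ (sym eS))) (CN.cast≅ (sym (sym eS)) refl _))
               (CN.idˡ≅ _)))
    where
    id⨾-absorbs : cast₂ CT.Hom eS refl f CT.≈ cast₂ CT.Hom eS refl (CT.[ a ∣ a ]⟨ ua , ua , refl ⟩ CT.⨾ f)
    id⨾-absorbs = CT.≅→≈ (CT.≅trans (CT.cast≅ eS refl f)
             (CT.≅trans (CT.≅sym (CT.≈→≅ (CT.≈trans (CT.⨾-cong (CT.brak-id a ua refl) CT.≈refl) (CT.idˡ f))))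
                        (CT.≅sym (CT.cast≅ eS refl _))))

  embed-reindexʳ : ∀ a b b' .(ua : Unique a) .(ub : Unique b) .(ub' : Unique b') (eS : fromList b ≡ fromList b')
             (f : CT.Hom (fromList a) (fromList b)) →
             embed a b' ua ub' (cast₂ CT.Hom refl eS f) CN.≅ embed a b ua ub f
  embed-reindexʳ a b b' ua ub ub' eS f
    with reindexing b' b (recomputeUnique ub') (recomputeUnique ub) (⊆-fromList b b' eS) (⊆-fromList b' b (sym eS))
  ... | ρ , hρ =
    CN.≅trans (CN.≈→≅ (N.gen-cong a b' ua ub'
      (O.∼trans (O.gen-cong a b' ua ub' ⨾id-absorbs) (O.rel-symʳ a b b b' ua ub ub ub' eS refl ρ hρ f))))
    (CN.≅trans (CN.≈→≅ (N.rel-symʳ a b b' b' ua ub ub' ub' eS refl ρ hρ (gen a b ua ub f)))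
    (CN.≅trans (CN.≅⨾ (CN.≅refl {f = embed a b ua ub f})
            (CN.≅trans (CN.cast≅ (sym eS) refl (N.[ b' ∣ b' ]ₙ⟨ ub' , ub' , refl ⟩))
          (CN.≅trans (CN.≈→≅ (CN.brak-id b' ub' refl)) (CN.id-≅ (sym eS)))))
               (CN.idʳ≅ _)))
    where
    ⨾id-absorbs : cast₂ CT.Hom refl eS f CT.≈ cast₂ CT.Hom refl eS (f CT.⨾ CT.[ b ∣ b ]⟨ ub , ub , refl ⟩)
    ⨾id-absorbs = CT.≅→≈ (CT.≅trans (CT.cast≅ refl eS f)
             (CT.≅trans (CT.≅sym (CT.≈→≅ (CT.≈trans (CT.⨾-cong CT.≈refl (CT.brak-id b ub refl)) (CT.idʳ f))))
                        (CT.≅sym (CT.cast≅ refl eS _))))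

  cast-split : ∀ {A B A' B'} (p : A ≡ A') (q : B ≡ B') (f : CT.Hom A B) →
               cast₂ CT.Hom p q f ≡ cast₂ CT.Hom refl q (cast₂ CT.Hom p refl f)
  cast-split refl refl f = refl

  embed-≅ : ∀ a b a' b' .(ua : Unique a) .(ub : Unique b) .(ua' : Unique a') .(ub' : Unique b')
         (f : CT.Hom (fromList a) (fromList b)) (f' : CT.Hom (fromList a') (fromList b')) →
         f CT.≅ f' → embed a b ua ub f CN.≅ embed a' b' ua' ub' f'
  embed-≅ a b a' b' ua ub ua' ub' f f' (CT.hq eA eB e) =
    CN.≅sym (CN.≅trans (CN.≈→≅ (embed-cong a' b' ua' ub' (CT.≈sym e)))
            (CN.≅trans (CN.≡→≅ (cong (embed a' b' ua' ub') (cast-split eA eB f)))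
            (CN.≅trans (embed-reindexʳ a' b b' ua' ub ub' eB (cast₂ CT.Hom eA refl f))
                       (embed-reindexˡ a a' b ua ua' ub eA f))))

  Ψ₀ : ∀ {A B} → CT.Hom A B → NTm A B
  Ψ₀ {A} {B} f = cast₂ NTm (fromList-elems A) (fromList-elems B)
    (embed (elems A) (elems B) (elems-unique A) (elems-unique B) (cast₂ CT.Hom (sym (fromList-elems A)) (sym (fromList-elems B)) f))

  Ψ₀-embed : ∀ {A B} (f : CT.Hom A B) a b .(ua : Unique a) .(ub : Unique b)
          (f' : CT.Hom (fromList a) (fromList b)) → f' CT.≅ f → Ψ₀ f CN.≅ embed a b ua ub f'
  Ψ₀-embed {A} {B} f a b ua ub f' r =
    CN.≅trans (CN.cast≅ (fromList-elems A) (fromList-elems B) _)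
      (embed-≅ _ _ a b _ _ ua ub _ f' (CT.≅trans (CT.cast≅ (sym (fromList-elems A)) (sym (fromList-elems B)) f) (CT.≅sym r)))

  Ψ₀-cong : ∀ {A B} {f g : CT.Hom A B} → f CT.≈ g → Ψ₀ f ≃ Ψ₀ g
  Ψ₀-cong {A} {B} e = CN.cast₂-cong (fromList-elems A) (fromList-elems B)
      (embed-cong _ _ _ _ (CT.cast₂-cong (sym (fromList-elems A)) (sym (fromList-elems B)) e))

  Ψ₀-id : ∀ {A} → Ψ₀ (CT.id {A}) ≃ nid
  Ψ₀-id {A} = CN.≅→≈ (CN.≅trans (Ψ₀-embed CT.id a a ua ua CT.id (CT.id-≅ (fromList-elems A)))
             (CN.≅trans (CN.≈→≅ (N.gen-cong a a ua ua (O.rel-id a ua)))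
             (CN.≅trans (CN.≈→≅ (N.rel-id a a ua ua refl))
             (CN.≅trans (CN.≈→≅ (CN.brak-id a ua refl)) (CN.id-≅ (fromList-elems A))))))
    where
    a = elems A
    ua = elems-unique A

  Ψ₀-⨾ : ∀ {A B C} (f : CT.Hom A B) (g : CT.Hom B C) → Ψ₀ (f CT.⨾ g) ≃ (Ψ₀ f n⨾ Ψ₀ g)
  Ψ₀-⨾ {A} {B} {C} f g =
    CN.≅→≈ (CN.≅trans (Ψ₀-embed (f CT.⨾ g) a c ua uc (f' CT.⨾ g') (CT.≅⨾ (CT.cast≅ _ _ f) (CT.cast≅ _ _ g)))
           (CN.≅trans (CN.≈→≅ (N.gen-cong a c ua uc (O.rel-⨾ a b c ua ub uc f' g')))
           (CN.≅trans (CN.≈→≅ (N.rel-⨾ a b c ua ub uc (gen a b ua ub f') (gen b c ub uc g')))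
                      (CN.≅sym (CN.≅⨾ (Ψ₀-embed f a b ua ub f' (CT.cast≅ _ _ f)) (Ψ₀-embed g b c ub uc g' (CT.cast≅ _ _ g)))))))
    where
    a = elems A
    b = elems B
    c = elems C
    ua = elems-unique A
    ub = elems-unique B
    uc = elems-unique C
    f' = cast₂ CT.Hom (sym (fromList-elems A)) (sym (fromList-elems B)) f
    g' = cast₂ CT.Hom (sym (fromList-elems B)) (sym (fromList-elems C)) g

  Ψ₀-ten : ∀ {A B C D} (f : CT.Hom A B) (g : CT.Hom C D) .(p : Disjoint A C) .(q : Disjoint B D) →
          Ψ₀ (CT.ten f g p q) ≃ nten (Ψ₀ f) (Ψ₀ g) p q
  Ψ₀-ten {A} {B} {C} {D} f g p q =
    CN.≅→≈ (CN.≅trans (Ψ₀-embed (CT.ten f g p q) (a ++ c) (b ++ d) uac ubd h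
                        (CT.≅trans (CT.cast≅ eA eB _) (CT.≅ten' (CT.cast≅ _ _ f) (CT.cast≅ _ _ g) p' q')))
           (CN.≅trans (CN.≈→≅ (N.gen-cong (a ++ c) (b ++ d) uac ubd
                        (cast₂-transpose e₁ e₂ (O.rel-⊎ a b c d ua ub uc ud uac ubd f' g' p' q' eA eB e₁ e₂))))
           (CN.≅trans (CN.≈→≅ (N.rel-⊕ a b c d ua ub uc ud uac ubd (gen a b ua ub f') (gen c d uc ud g') p' q'
                                 e₁ e₂ eA eB))
           (CN.≅trans (CN.cast≅ eA eB _)
                      (CN.≅ten' (CN.≅sym (Ψ₀-embed f a b ua ub f' (CT.cast≅ _ _ f)))
                                (CN.≅sym (Ψ₀-embed g c d uc ud g' (CT.cast≅ _ _ g))) p' q')))))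
    where
    a = elems A
    b = elems B
    c = elems C
    d = elems D
    ua = elems-unique A
    ub = elems-unique B
    uc = elems-unique C
    ud = elems-unique D
    f' = cast₂ CT.Hom (sym (fromList-elems A)) (sym (fromList-elems B)) f
    g' = cast₂ CT.Hom (sym (fromList-elems C)) (sym (fromList-elems D)) g
    p' : Disjoint (fromList a) (fromList c)
    p' = CT.Disjoint-subst (sym (fromList-elems A)) (sym (fromList-elems C)) (recomputeDisjoint p)
    q' : Disjoint (fromList b) (fromList d)
    q' = CT.Disjoint-subst (sym (fromList-elems B)) (sym (fromList-elems D)) (recomputeDisjoint q)
    uac = unique-++ a c ua uc p'
    ubd = unique-++ b d ub ud q'
    eA = sym (fromList-++ a c)
    eB = sym (fromList-++ b d)
    e₁ = length-++ a
    e₂ = length-++ b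
    h = cast₂ CT.Hom eA eB (CT.ten f' g' p' q')

  Ψ₀-bij : ∀ π A → Ψ₀ (CT.bij π A) ≃ nbij π A
  Ψ₀-bij π A =
    CN.≅→≈ (CN.≅trans (Ψ₀-embed (CT.bij π A) a b ua ub br
                         (CT.≅trans (CT.brak≅bij π a b ua ub el refl) (CT.bij-cast≅ π (fromList-elems A))))
           (CN.≅trans (CN.≈→≅ (N.gen-cong a b ua ub ord))
           (CN.≅trans (CN.≈→≅ (N.rel-id a b ua ub el))
           (CN.≅trans (CN.brak≅bij π a b ua ub el refl) (CN.bij-cast≅ π (fromList-elems A))))))
    where
    a = elems A
    ua = elems-unique A
    b = mapL (app π) a
    ub = Unique.map⁺ (app-injective π) ua
    el : length a ≡ length b
    el = sym (length-map (app π) a)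
    br = CT.[ a ∣ b ]⟨ ua , ub , el ⟩
    ord : gen a b ua ub br ∼ cast₂ OTm refl el oid
    ord = O.∼trans (O.gen-cong a b ua ub (CT.≈sym (CT.idˡ br)))
          (O.∼trans (O.rel-symʳ a a b b ua ua ub ub refl el Perm.id (λ i → refl) CT.id)
          (O.∼trans (O.⨾-cong (O.rel-id a ua) O.∼refl)
          (O.∼trans (O.idˡ _)
          (O.∼trans (cast₂-cong (sym el) refl O.perm-id) (≡→∼ (cast₂-oid-swap el))))))

  Ψ : NomMor T (NOM (ORD T))
  Ψ = record
    { map = Ψ₀
    ; map-cong = Ψ₀-cong
    ; map-id = Ψ₀-id
    ; map-⨾ = Ψ₀-⨾
    ; map-ten = Ψ₀-ten
    ; map-bij = Ψ₀-bij
    }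

module Isomorphism (T : NomPROP) where

  open FiniteSets
  open NameVectors
  open ORDProperties T
  open import Data.Nat using (_+_)
  open import Data.List using (_++_)
  import Data.List as L
  open import Data.List.Properties using (length-++)
  open import Data.Vec using (Vec; toList; take; drop)
  open import Data.Vec.Properties using (length-toList; toList∘fromList)
  import Data.Vec as Vec
  import Data.Fin as Fin
  open import Data.Fin.Properties using (cast-is-id; cast-trans)
  import Data.Fin.Permutation as Perm
  open import Data.Fin.Permutation using (Permutation; _⟨$⟩ʳ_)
  open import Relation.Binary.PropositionalEquality using (refl; trans; cong; cong₂; subst; subst₂)

  module CT = NomPROPProperties T
  module CN = NomPROPProperties (NOM (ORD T))
  module DT = Interpretation T
  module ET = Comparison T
  module GT = Inverse T
  module FG = NomMorProperties T (NOM (ORD T)) GT.Ψ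
  module O = ORDdef T
  module N = NOMdef (ORD T)
  open O using (OTm; gen; oid; _o⨾_; _o⊕_; operm; _∼_)
  open N using (NTm; ngen; nid; _n⨾_; nten; nbij; _≃_)
  open GT using (Ψ₀)
  open DT using (interp; UniqueV)

  Φ∘Ψ : ∀ {A B} (f : CT.Hom A B) → ET.Φ₀ (Ψ₀ f) CT.≈ f
  Φ∘Ψ {A} {B} f =
    CT.≅→≈ (CT.≅trans (CT.≡→≅ (ET.Φ-cast (fromList-elems A) (fromList-elems B) _))
           (CT.≅trans (CT.cast≅ (fromList-elems A) (fromList-elems B) _)
           (CT.≅trans (ET.Φ-ngen a b ua ub (gen a b ua ub f'))
           (CT.≅trans (CT.≅⨾ (CT.brak-≡ _ a a a _ ua ua ua (length-toList (Vec.fromList a)) refl (toList∘fromList a) refl)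
                             (CT.≅⨾ CT.≅refl (CT.brak-≡ b b _ b ub ub _ ub (sym (length-toList (Vec.fromList b))) refl refl (toList∘fromList b))))
           (CT.≅trans (CT.≈→≅ (CT.≈trans (CT.⨾-cong (CT.brak-id a ua refl) (CT.⨾-cong CT.≈refl (CT.brak-id b ub refl)))
                               (CT.≈trans (CT.idˡ _) (CT.idʳ _))))
                      (CT.cast≅ (sym (fromList-elems A)) (sym (fromList-elems B)) f))))))
    where
    f' = cast₂ CT.Hom (sym (fromList-elems A)) (sym (fromList-elems B)) f
    a = elems A
    b = elems B
    ua = elems-unique A
    ub = elems-unique B

  ngen-≅ : ∀ a b a' b' .(ua : Unique a) .(ub : Unique b) .(ua' : Unique a') .(ub' : Unique b')
             (ea : a ≡ a') (eb : b ≡ b') (g : OTm (length a) (length b)) (g' : OTm (length a') (length b')) →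
             cast₂ OTm (cong length ea) (cong length eb) g ≡ g' → ngen a b ua ub g CN.≅ ngen a' b' ua' ub' g'
  ngen-≅ a b a' b' ua ub ua' ub' refl refl g g' refl = CN.≅refl

  Ψ₀-cast₂ : ∀ {A B A' B'} (p : A ≡ A') (q : B ≡ B') (f : CT.Hom A B) → Ψ₀ (cast₂ CT.Hom p q f) CN.≅ Ψ₀ f
  Ψ₀-cast₂ refl refl f = CN.≅refl

  Ψ₀-brak : ∀ a b .(ua : Unique a) .(ub : Unique b) e → Ψ₀ CT.[ a ∣ b ]⟨ ua , ub , e ⟩ ≃ N.[ a ∣ b ]ₙ⟨ ua , ub , e ⟩
  Ψ₀-brak a b ua ub e = FG.map-brak a b ua ub e

  ngenV : ∀ {m n} (x : Vec ℕ m) (y : Vec ℕ n) → .(UniqueV x) → .(UniqueV y) → OTm m n → NTm ⟪ x ⟫ ⟪ y ⟫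
  ngenV x y ux uy g = ngen (toList x) (toList y) ux uy (cast₂ OTm (sym (length-toList x)) (sym (length-toList y)) g)

  Ψ₀-interp-gen : ∀ a b .(ua : Unique a) .(ub : Unique b) (f : CT.Hom (fromList a) (fromList b)) x y .(ux : UniqueV x) .(uy : UniqueV y) →
           Ψ₀ (interp (gen a b ua ub f) x ux y uy) CN.≅ ngenV x y ux uy (gen a b ua ub f)
  Ψ₀-interp-gen a b ua ub f x y ux uy =
    CN.≅trans (CN.≈→≅ (N.≃trans (GT.Ψ₀-⨾ X _) (N.⨾-cong N.≃refl (GT.Ψ₀-⨾ f Y))))
    (CN.≅trans (CN.≈→≅ (N.⨾-cong (Ψ₀-brak x' a ux ua (length-toList x)) (N.⨾-cong N.≃refl (Ψ₀-brak b y' ub uy (sym (length-toList y))))))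
    (CN.≅trans (CN.≅⨾ CN.≅refl (CN.≅⨾ (GT.Ψ₀-embed f a b ua ub f CT.≅refl) CN.≅refl))
    (CN.≈→≅ (N.≃trans
            (N.⨾-cong N.≃refl
          (N.≃sym (N.rel-symʳ a b b y' ua ub ub uy refl (sym (length-toList y)) Perm.id (λ i → refl) (gen a b ua ub f))))
            (N.≃trans (N.≃sym (N.rel-symˡ x' a a y' ux ua ua uy refl (length-toList x) Perm.id (λ i → refl) f⨾id))
                      (N.gen-cong x' y' ux uy ord))))))
    where
    x' = toList x
    y' = toList y
    X = CT.[ x' ∣ a ]⟨ ux , ua , length-toList x ⟩
    Y = CT.[ b ∣ y' ]⟨ ub , uy , sym (length-toList y) ⟩
    f⨾id = cast₂ OTm refl (sym (length-toList y)) (gen a b ua ub f o⨾ operm Perm.id)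
    ord : cast₂ OTm (sym (length-toList x)) refl (operm Perm.id o⨾ f⨾id)
            ∼ cast₂ OTm (sym (length-toList x)) (sym (length-toList y)) (gen a b ua ub f)
    ord = O.∼trans (cast₂-cong (sym (length-toList x)) refl (O.∼trans (O.⨾-cong O.perm-id O.∼refl) (O.idˡ _)))
          (O.∼trans (cast₂-cong (sym (length-toList x)) refl
                  (cast₂-cong refl (sym (length-toList y)) (O.∼trans (O.⨾-cong O.∼refl O.perm-id) (O.idʳ _))))
                    (≡→∼ (trans (cast₂-cast₂ refl (sym (length-toList y)) (sym (length-toList x)) refl _)
                               (cast₂-irrelevant (trans refl (sym (length-toList x))) (sym (length-toList x))
                                     (trans (sym (length-toList y)) refl) (sym (length-toList y)) (gen a b ua ub f)))))

  Ψ₀-interp-oid : ∀ {n} (x y : Vec ℕ n) .(ux : UniqueV x) .(uy : UniqueV y) → Ψ₀ (interp oid x ux y uy) CN.≅ ngenV x y ux uy oid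
  Ψ₀-interp-oid x y ux uy =
    CN.≈→≅ (N.≃trans (Ψ₀-brak (toList x) (toList y) ux uy e)
           (N.≃trans (N.≃sym (N.rel-id (toList x) (toList y) ux uy e))
                     (N.gen-cong (toList x) (toList y) ux uy (≡→∼ (cast₂-oid (length-toList x) (length-toList y) e)))))
    where e = trans (length-toList x) (sym (length-toList y))

  Ψ₀-interp-⨾ : ∀ {m n k} (g : OTm m n) (h : OTm n k) x y .(ux : UniqueV x) .(uy : UniqueV y) →
         Ψ₀ (interp g x ux (downFrom n) (unique-downFrom n)) CN.≅ ngenV x (downFrom n) ux (unique-downFrom n) g →
         Ψ₀ (interp h (downFrom n) (unique-downFrom n) y uy) CN.≅ ngenV (downFrom n) y (unique-downFrom n) uy h →
         Ψ₀ (interp (g o⨾ h) x ux y uy) CN.≅ ngenV x y ux uy (g o⨾ h)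
  Ψ₀-interp-⨾ {n = n} g h x y ux uy ih₁ ih₂ =
    CN.≅trans (CN.≈→≅ (GT.Ψ₀-⨾ _ _))
    (CN.≅trans (CN.≅⨾ ih₁ ih₂)
    (CN.≅trans (CN.≈→≅ (N.≃sym (N.rel-⨾ (toList x) (toList u) (toList y) ux (unique-downFrom n) uy _ _)))
               (CN.≡→≅ (cong (ngen (toList x) (toList y) ux uy)
                       (sym (cast₂-o⨾ (sym (length-toList x)) (sym (length-toList u)) (sym (length-toList y)) g h))))))
    where
    u = downFrom n

  Ψ₀-interp-⊕ : ∀ {m n k l} (g : OTm m n) (h : OTm k l) x y .(ux : UniqueV x) .(uy : UniqueV y) →
         Ψ₀ (interp g (take m x) (unique-take m x ux) (take n y) (unique-take n y uy)) CN.≅ ngenV (take m x) (take n y)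
             (unique-take m x ux) (unique-take n y uy) g →
         Ψ₀ (interp h (drop m x) (unique-drop m x ux) (drop n y) (unique-drop n y uy)) CN.≅ ngenV (drop m x) (drop n y)
             (unique-drop m x ux) (unique-drop n y uy) h →
         Ψ₀ (interp (g o⊕ h) x ux y uy) CN.≅ ngenV x y ux uy (g o⊕ h)
  Ψ₀-interp-⊕ {m} {n} {k} {l} g h x y ux uy ih₁ ih₂ =
    CN.≅trans (Ψ₀-cast₂ (sym (⟪⟫-take-drop m x)) (sym (⟪⟫-take-drop n y)) _)
    (CN.≅trans (CN.≈→≅ (GT.Ψ₀-ten _ _ p q))
    (CN.≅trans (CN.≅ten' ih₁ ih₂ p q)
    (CN.≅trans (CN.≅sym (CN.cast≅ eA eB _))
    (CN.≅trans (CN.≈→≅ (N.≃sym (N.rel-⊕ a b c d (unique-take m x ux) (unique-take n y uy) (unique-drop m x ux) (unique-drop n y uy) uac ubd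
                                  g' h' p q e₁ e₂ eA eB)))
               (ngen-≅ (a ++ c) (b ++ d) (toList x) (toList y) uac ubd ux uy (toList-take++drop m x) (toList-take++drop n y) _ _ casts-agree)))))
    where
    p = Disjoint-take-drop m x (recomputeUnique ux)
    q = Disjoint-take-drop n y (recomputeUnique uy)
    x₁ = take m x
    x₂ = drop m x
    y₁ = take n y
    y₂ = drop n y
    a = toList x₁
    c = toList x₂
    b = toList y₁
    d = toList y₂
    uac = subst Unique (sym (toList-take++drop m x)) (recomputeUnique ux)
    ubd = subst Unique (sym (toList-take++drop n y)) (recomputeUnique uy)
    eA = sym (fromList-++ a c)
    eB = sym (fromList-++ b d)
    e₁ = length-++ a
    e₂ = length-++ b
    g' = cast₂ OTm (sym (length-toList x₁)) (sym (length-toList y₁)) g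
    h' = cast₂ OTm (sym (length-toList x₂)) (sym (length-toList y₂)) h
    casts-agree : cast₂ OTm (cong length (toList-take++drop m x)) (cong length (toList-take++drop n y))
            (cast₂ OTm (sym e₁) (sym e₂) (g' o⊕ h')) ≡ cast₂ OTm (sym (length-toList x)) (sym (length-toList y)) (g o⊕ h)
    casts-agree = trans (cong (λ z → cast₂ OTm (cong length (toList-take++drop m x)) (cong length (toList-take++drop n y)) (cast₂ OTm (sym e₁) (sym e₂) z))
                      (cast₂-o⊕ (sym (length-toList x₁)) (sym (length-toList y₁)) (sym (length-toList x₂)) (sym (length-toList y₂)) g h))
          (trans (cong (cast₂ OTm (cong length (toList-take++drop m x)) (cong length (toList-take++drop n y)))
                  (cast₂-cast₂ _ _ (sym e₁) (sym e₂) (g o⊕ h)))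
          (trans (cast₂-cast₂ P1 Q1 (cong length (toList-take++drop m x)) (cong length (toList-take++drop n y)) (g o⊕ h))
                 (cast₂-irrelevant (trans P1 (cong length (toList-take++drop m x))) (sym (length-toList x))
                       (trans Q1 (cong length (toList-take++drop n y))) (sym (length-toList y)) (g o⊕ h))))
      where
      P1 = trans (cong₂ _+_ (sym (length-toList x₁)) (sym (length-toList x₂))) (sym e₁)
      Q1 = trans (cong₂ _+_ (sym (length-toList y₁)) (sym (length-toList y₂))) (sym e₂)

  Ψ₀-interp-perm : ∀ {m n} (π : Permutation m n) x y .(ux : UniqueV x) .(uy : UniqueV y) →
            Ψ₀ (interp (operm π) x ux y uy) CN.≅ ngenV x y ux uy (operm π)
  Ψ₀-interp-perm {m} {n} π x y ux uy =
    CN.≅trans (Ψ₀-cast₂ refl (⟪⟫-permute π y) _)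
    (CN.≅trans (CN.≈→≅ (Ψ₀-brak x' pvl ux upv e))
    (CN.≅trans (CN.≅sym (CN.≅trans (CN.≅⨾ (CN.≅refl {f = N.[ x' ∣ pvl ]ₙ⟨ ux , upv , e ⟩}) Z) (CN.idʳ≅ _)))
    (CN.≈→≅ (N.≃trans (N.≃sym (N.rel-symˡ x' pvl y' y' ux upv uy uy eS e ρ' hρ' oid))
                      (N.gen-cong x' y' ux uy
                        (O.∼trans (cast₂-cong (sym e) refl (O.idʳ _)) (≡→∼ (cast₂-operm (length-toList x) lpv (length-toList y) e π))))))))
    where
    x' = toList x
    y' = toList y
    pvl = toList (permute π y)
    upv = unique-permute π y (recomputeUnique uy)
    e = trans (length-toList x) (sym (length-toList (permute π y)))
    eS = ⟪⟫-permute π y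
    lpv = length-toList (permute π y)
    ρ' = subst₂ Permutation (sym lpv) (sym (length-toList y)) π
    hρ' : ∀ i → L.lookup y' (ρ' ⟨$⟩ʳ i) ≡ L.lookup pvl i
    hρ' i = trans (cong (L.lookup y') (subst₂-⟨$⟩ʳ lpv (length-toList y) π i))
            (trans (lookup-toList y _)
            (trans (sym (lookup-permute π y _))
            (trans (sym (lookup-toList (permute π y) (Fin.cast lpv i)))
                   (cong (L.lookup pvl) (trans (cast-trans lpv (sym lpv) i) (cast-is-id _ i))))))
    Z : cast₂ NTm (sym eS) refl (ngen y' y' uy uy oid) CN.≅ N.nid {fromList pvl}
    Z = CN.≅trans (CN.cast≅ (sym eS) refl _)
        (CN.≅trans (CN.≈→≅ (N.≃trans (N.rel-id y' y' uy uy refl) (CN.brak-id y' uy refl))) (CN.id-≅ (sym eS)))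

  Ψ₀-interp : ∀ {m n} (g : OTm m n) x y .(ux : UniqueV x) .(uy : UniqueV y) → Ψ₀ (interp g x ux y uy) CN.≅ ngenV x y ux uy g
  Ψ₀-interp (gen a b ua ub f) x y ux uy = Ψ₀-interp-gen a b ua ub f x y ux uy
  Ψ₀-interp oid x y ux uy = Ψ₀-interp-oid x y ux uy
  Ψ₀-interp (_o⨾_ {n = n} g h) x y ux uy =
    Ψ₀-interp-⨾ g h x y ux uy (Ψ₀-interp g x (downFrom n) ux (unique-downFrom n)) (Ψ₀-interp h (downFrom n) y (unique-downFrom n) uy)
  Ψ₀-interp (_o⊕_ {m} {n} g h) x y ux uy =
    Ψ₀-interp-⊕ g h x y ux uy (Ψ₀-interp g _ _ _ _) (Ψ₀-interp h _ _ _ _)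
  Ψ₀-interp (operm π) x y ux uy = Ψ₀-interp-perm π x y ux uy

  Ψ∘Φ : ∀ {A B} (h : NTm A B) → Ψ₀ (ET.Φ₀ h) ≃ h
  Ψ∘Φ (ngen c d uc ud g) =
    CN.≅→≈ (CN.≅trans (Ψ₀-cast₂ (⟪fromList⟫ c) (⟪fromList⟫ d) _)
           (CN.≅trans (Ψ₀-interp g (Vec.fromList c) (Vec.fromList d) (unique-fromList c uc) (unique-fromList d ud))
                      (ngen-≅ _ _ c d _ _ uc ud (toList∘fromList c) (toList∘fromList d) _ g
                         (trans (cast₂-cast₂ _ _ (cong length (toList∘fromList c)) (cong length (toList∘fromList d)) g)
                                (cast₂-irrelevant _ refl _ refl g)))))
  Ψ∘Φ nid = GT.Ψ₀-id
  Ψ∘Φ (f n⨾ g) = N.≃trans (GT.Ψ₀-⨾ _ _) (N.⨾-cong (Ψ∘Φ f) (Ψ∘Φ g))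
  Ψ∘Φ (nten f g p q) = N.≃trans (GT.Ψ₀-ten _ _ p q) (N.ten-cong p q (Ψ∘Φ f) (Ψ∘Φ g))
  Ψ∘Φ (nbij π A) = GT.Ψ₀-bij π A

  Φ-isIso : IsIso ET.Φ
  Φ-isIso = GT.Ψ , Ψ∘Φ , Φ∘Ψ

mainTheorem14 :
  Σ ((T : NomPROP) → NomMor (NOM (ORD T)) T) λ Φ →
    -- each Φ T : NOM(ORD(T)) → T is an isomorphism of nominal PROPs
    ((T : NomPROP) → IsIso (Φ T))
    -- Φ T maps [c⟩⟨a]f[b⟩⟨d] to [c|a];f;[b|d]
    × ((T : NomPROP) (a b c d : List ℕ)
         .(ua : Unique a) .(ub : Unique b) .(uc : Unique c) .(ud : Unique d)
         (ec : length c ≡ length a) (ed : length d ≡ length b)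
         (f : NomPROP.Hom T (fromList a) (fromList b)) →
         NomPROP._≈_ T
           (NomMor.map (Φ T)
             (NOMdef.ngen {ORD T} c d uc ud
               (cast₂ (ORDdef.OTm T) (sym ec) (sym ed) (ORDdef.gen {T} a b ua ub f))))
           (NomPROP._⨾_ T (NomPROP.[_∣_]⟨_,_,_⟩ T c a uc ua ec)
             (NomPROP._⨾_ T f (NomPROP.[_∣_]⟨_,_,_⟩ T b d ub ud (sym ed)))))
    -- naturality in T: F ∘ Φ T = Φ T' ∘ NOM(ORD(F))
    × ((T T' : NomPROP) (F : NomMor T T') {A B : FSet}
         (h : NomPROP.Hom (NOM (ORD T)) A B) →
         NomPROP._≈_ T'
           (NomMor.map F (NomMor.map (Φ T) h))
           (NomMor.map (Φ T') (nomMap {ORD T} {ORD T'} (ordMap {T} {T'} (NomMor.map F)) h)))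
mainTheorem14 =
  Comparison.Φ ,
  Isomorphism.Φ-isIso ,
  Comparison.Φ-gen ,
  Naturality.Φ-natural
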